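{- Let $k\geq 2$, let $\alpha_1,\ldots,\alpha_{2k}$ be positive integers with $\alpha_{2k}\geq 2$, and let $G=C(\alpha_1,\ldots,\alpha_{2k})$. Let $m_0(\epsilon(G))$ and $m_{ -2}(\epsilon(G))$ denote the multiplicities of the eigenvalues $0$ and $-2$ of $\epsilon(G)$. Then $m_{ -2}(\epsilon(G))=\sum_{i=1}^k\alpha_{2i}-k$, and $m_0(\epsilon(G))=\sum_{i=1}^k\alpha_{2i-1}-k+1$ if $\alpha_2=1$, while $m_0(\epsilon(G))=\sum_{i=1}^k\alpha_{2i-1}-k$ if $\alpha_2\neq 1$.
   Context: For a positive integer $\alpha$, $K_\alpha$ is the complete graph on $\alpha$ vertices and $\overline{H}$ denotes the complement of a graph $H$. For positive integers $\alpha_1,\ldots,\alpha_l$ the graph $C(\alpha_1,\ldots,\alpha_l)$ is defined recursively by $C(\alpha_1)=\overline{K_{\alpha_1}}$ and $C(\alpha_1,\ldots,\alpha_i)=\overline{C(\alpha_1,\ldots,\alpha_{i-1})\cup K_{\alpha_i}}$ for $2\leq i\leq l$ (disjoint union, then complement). For a connected graph $G$ with distance $d(u,v)$ and eccentricity $e(u)=\max_v d(u,v)$, the eccentricity matrix $\epsilon(G)$ has $(u,v)$-entry $d(u,v)$ if $d(u,v)=\min\{e(u),e(v)\}$ and $0$ otherwise. A multiplicity of $0$ means the value is not an eigenvalue. -}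

module Defs where

open import Data.Nat as ℕ using (ℕ; zero; suc; _⊔_; _⊓_; _≡ᵇ_)
open import Data.Integer as ℤ using (ℤ; +_; -_)
open import Data.Bool using (Bool; true; false; not; _∧_; _∨_; if_then_else_)
open import Data.Fin as Fin using (Fin; splitAt; punchIn; toℕ; _≟_)
open import Data.Sum using (inj₁; inj₂)
open import Data.List as List using (List; []; _∷_; map; foldr; allFin)
open import Data.Bool.ListAction using (any)
open import Data.Product using (Σ; _×_)
open import Relation.Nullary.Decidable using (⌊_⌋)
open import Relation.Binary.PropositionalEquality using (_≡_; _≢_)

-- Simple graphs on vertex set Fin n (adjacency, loopless, symmetric by construction)

Graph : ℕ → Set
Graph n = Fin n → Fin n → Bool

-- disjoint union of G with the complete graph K_a (new vertices come last)
unionK : ∀ {n} (a : ℕ) → Graph n → Graph (n ℕ.+ a)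
unionK {n} a G u v with splitAt n u | splitAt n v
... | inj₁ x | inj₁ y = G x y
... | inj₂ x | inj₂ y = not ⌊ x ≟ y ⌋
... | inj₁ _ | inj₂ _ = false
... | inj₂ _ | inj₁ _ = false

compl : ∀ {n} → Graph n → Graph n
compl G u v = not ⌊ u ≟ v ⌋ ∧ not (G u v)

-- number of vertices of C(α₁,…,α_l), α given 1-indexed as a function ℕ → ℕ
nv : (ℕ → ℕ) → ℕ → ℕ
nv α zero = zero
nv α (suc l) = nv α l ℕ.+ α (suc l)

-- C(α₁,…,α_l).  C(α₁) = complement of K_{α₁} (= complement of (empty ∪ K_{α₁})),
-- C(α₁,…,α_i) = complement of (C(α₁,…,α_{i-1}) ∪ K_{α_i}).
emptyGraph : Graph 0
emptyGraph ()

CG : (α : ℕ → ℕ) → (l : ℕ) → Graph (nv α l)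
CG α zero = emptyGraph
CG α (suc l) = compl (unionK (α (suc l)) (CG α l))

reach : ∀ {n} → Graph n → ℕ → Fin n → Fin n → Bool
reach G zero u v = ⌊ u ≟ v ⌋
reach {n} G (suc j) u v = reach G j u v ∨ any (λ w → G u w ∧ reach G j w v) (allFin n)

search : ∀ {n} → Graph n → Fin n → Fin n → ℕ → ℕ → ℕ
search G u v j zero = j
search G u v j (suc f) = if reach G j u v then j else search G u v (suc j) f

-- shortest-path distance (correct for connected graphs, where d(u,v) < n)
dist : ∀ {n} → Graph n → Fin n → Fin n → ℕ
dist {n} G u v = search G u v 0 n

ecc : ∀ {n} → Graph n → Fin n → ℕ
ecc {n} G u = foldr (λ v m → dist G u v ⊔ m) 0 (allFin n)

eccMatrix : ∀ {n} → Graph n → Fin n → Fin n → ℕ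
eccMatrix G u v =
  if dist G u v ≡ᵇ (ecc G u ⊓ ecc G v) then dist G u v else 0

-- Polynomials over ℤ (coefficient lists, lowest degree first)

Poly : Set
Poly = List ℤ

_+ᴾ_ : Poly → Poly → Poly
[] +ᴾ q = q
(a ∷ p) +ᴾ [] = a ∷ p
(a ∷ p) +ᴾ (b ∷ q) = (a ℤ.+ b) ∷ (p +ᴾ q)

scaleᴾ : ℤ → Poly → Poly
scaleᴾ c = map (c ℤ.*_)

_*ᴾ_ : Poly → Poly → Poly
[] *ᴾ q = []
(a ∷ p) *ᴾ q = scaleᴾ a q +ᴾ (+ 0 ∷ (p *ᴾ q))

_^ᴾ_ : Poly → ℕ → Poly
p ^ᴾ zero = + 1 ∷ []
p ^ᴾ suc m = p *ᴾ (p ^ᴾ m)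

coeff : Poly → ℕ → ℤ
coeff [] i = + 0
coeff (a ∷ p) zero = a
coeff (a ∷ p) (suc i) = coeff p i

eval : Poly → ℤ → ℤ
eval [] x = + 0
eval (a ∷ p) x = a ℤ.+ x ℤ.* eval p x

-- polynomial equality (coefficientwise, insensitive to trailing zeros)
_≈ᴾ_ : Poly → Poly → Set
p ≈ᴾ q = ∀ i → coeff p i ≡ coeff q i

isEven : ℕ → Bool
isEven zero = true
isEven (suc n) = not (isEven n)

sumᴾ : List Poly → Poly
sumᴾ = foldr _+ᴾ_ []

det : ∀ n → (Fin n → Fin n → Poly) → Poly
det zero M = + 1 ∷ []
det (suc n) M =
  sumᴾ (map (λ j → scaleᴾ (sign j) (M Fin.zero j *ᴾ det n (λ r c → M (Fin.suc r) (punchIn j c))))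
            (allFin (suc n)))
  where
  sign : Fin (suc n) → ℤ
  sign j = if isEven (toℕ j) then + 1 else - (+ 1)

charPoly : ∀ {n} → (Fin n → Fin n → ℕ) → Poly
charPoly {n} A = det n (λ u v → if ⌊ u ≟ v ⌋ then (- (+ A u v)) ∷ + 1 ∷ [] else (- (+ A u v)) ∷ [])

IsMultiplicity : Poly → ℤ → ℕ → Set
IsMultiplicity p λ₀ m = Σ Poly (λ q → (p ≈ᴾ ((((- λ₀) ∷ + 1 ∷ []) ^ᴾ m) *ᴾ q)) × (eval q λ₀ ≢ + 0))

EigMult : ∀ {n} → (Fin n → Fin n → ℕ) → ℤ → ℕ → Set
EigMult A λ₀ m = IsMultiplicity (charPoly A) λ₀ m

sumTo : (ℕ → ℕ) → ℕ → ℕ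
sumTo f zero = 0
sumTo f (suc k) = sumTo f k ℕ.+ f (suc k)

-- Every vertex of G = C(α₁, …, α_{2k}) has eccentricity 2, so ε(G) is twice the adjacency matrix of
-- the complement of G, and xI - ε(G) is assembled block by block: block i is (x + w) I - w J, where
-- w = 2 if i is even and w = 0 if i is odd, and it meets every earlier block in -2 J if i is odd and in
-- 0 if i is even. For block matrices [[A, s J], [s′ J, C]] the determinant and the sum of all cofactors
-- are determined by those of A and C, so the pair (det, cofactor sum) obeys a two-term recurrence over
-- the blocks, which factors the characteristic polynomial as
--   x ^ (Σ α_odd - k) · (x + 2) ^ (Σ α_even - k) · Q.
-- Evaluated at -2 and at 0 the recurrence preserves sign patterns of the pair that keep Q away from 0,
-- except that Q has the simple factor x when α₂ = 1 (the second block is a single vertex).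
module Submission where

open import Algebra.Bundles using (CommutativeRing)
open import Algebra.Solver.Ring.AlmostCommutativeRing using (_-Raw-AlmostCommutative⟶_; fromCommutativeRing)
open import Data.Integer using () renaming (+-*-rawRing to ℤ-rawRing)

module PolynomialRing where

  open import Defs
  open import Algebra.Structures using (IsCommutativeRing)
  open import Data.Integer as ℤ using (ℤ; +_; -_)
  import Data.Integer.Properties as ℤ
  open import Data.Integer.Tactic.RingSolver using (solve-∀)
  open import Data.List using ([]; _∷_)
  open import Data.Nat using (zero; suc)
  open import Data.Product using (_,_)
  open import Function using (_∘_)
  open import Relation.Binary.PropositionalEquality as ≡ using (_≡_; refl; cong; cong₂)

  open ≡.≡-Reasoning

  -- A record rather than a synonym of _≈ᴾ_, so that both polynomials can be inferred from a proof.
  infix 4 _≋_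
  record _≋_ (p q : Poly) : Set where
    constructor mk≋
    field coeff-≡ : p ≈ᴾ q
  open _≋_ public

  ≋-refl : ∀ {p} → p ≋ p
  ≋-refl = mk≋ λ _ → refl

  ≋-reflexive : ∀ {p q} → p ≡ q → p ≋ q
  ≋-reflexive refl = ≋-refl

  ≋-sym : ∀ {p q} → p ≋ q → q ≋ p
  ≋-sym (mk≋ e) = mk≋ (≡.sym ∘ e)

  ≋-trans : ∀ {p q r} → p ≋ q → q ≋ r → p ≋ r
  ≋-trans (mk≋ e) (mk≋ f) = mk≋ λ i → ≡.trans (e i) (f i)

  0ᴾ 1ᴾ : Poly
  0ᴾ = []
  1ᴾ = + 1 ∷ []

  infix 25 -ᴾ_
  -ᴾ_ : Poly → Poly
  -ᴾ_ = scaleᴾ (- + 1)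

  coeff-+ : ∀ p q i → coeff (p +ᴾ q) i ≡ coeff p i ℤ.+ coeff q i
  coeff-+ []      q       i       = ≡.sym (ℤ.+-identityˡ _)
  coeff-+ (a ∷ p) []      i       = ≡.sym (ℤ.+-identityʳ _)
  coeff-+ (a ∷ p) (b ∷ q) zero    = refl
  coeff-+ (a ∷ p) (b ∷ q) (suc i) = coeff-+ p q i

  coeff-scale : ∀ c p i → coeff (scaleᴾ c p) i ≡ c ℤ.* coeff p i
  coeff-scale c []      i       = ≡.sym (ℤ.*-zeroʳ c)
  coeff-scale c (a ∷ p) zero    = refl
  coeff-scale c (a ∷ p) (suc i) = coeff-scale c p i

  ∷-cong : ∀ {a b p q} → a ≡ b → p ≋ q → (a ∷ p) ≋ (b ∷ q)
  ∷-cong a≡b (mk≋ e) = mk≋ λ { zero → a≡b ; (suc i) → e i }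

  0∷0ᴾ : (+ 0 ∷ 0ᴾ) ≋ 0ᴾ
  0∷0ᴾ = mk≋ λ { zero → refl ; (suc i) → refl }

  +-cong : ∀ {p p′ q q′} → p ≋ p′ → q ≋ q′ → (p +ᴾ q) ≋ (p′ +ᴾ q′)
  +-cong {p} {p′} {q} {q′} (mk≋ e) (mk≋ f) = mk≋ λ i → begin
    coeff (p +ᴾ q) i          ≡⟨ coeff-+ p q i ⟩
    coeff p i ℤ.+ coeff q i   ≡⟨ cong₂ ℤ._+_ (e i) (f i) ⟩
    coeff p′ i ℤ.+ coeff q′ i ≡⟨ coeff-+ p′ q′ i ⟨
    coeff (p′ +ᴾ q′) i        ∎

  +-assoc : ∀ p q r → ((p +ᴾ q) +ᴾ r) ≋ (p +ᴾ (q +ᴾ r))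
  +-assoc p q r = mk≋ λ i → begin
    coeff ((p +ᴾ q) +ᴾ r) i                   ≡⟨ coeff-+ (p +ᴾ q) r i ⟩
    coeff (p +ᴾ q) i ℤ.+ coeff r i            ≡⟨ cong (ℤ._+ coeff r i) (coeff-+ p q i) ⟩
    coeff p i ℤ.+ coeff q i ℤ.+ coeff r i     ≡⟨ ℤ.+-assoc (coeff p i) _ _ ⟩
    coeff p i ℤ.+ (coeff q i ℤ.+ coeff r i)   ≡⟨ cong (λ v → coeff p i ℤ.+ v) (coeff-+ q r i) ⟨
    coeff p i ℤ.+ coeff (q +ᴾ r) i            ≡⟨ coeff-+ p (q +ᴾ r) i ⟨
    coeff (p +ᴾ (q +ᴾ r)) i                   ∎

  +-comm : ∀ p q → (p +ᴾ q) ≋ (q +ᴾ p)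
  +-comm p q = mk≋ λ i → begin
    coeff (p +ᴾ q) i        ≡⟨ coeff-+ p q i ⟩
    coeff p i ℤ.+ coeff q i ≡⟨ ℤ.+-comm (coeff p i) _ ⟩
    coeff q i ℤ.+ coeff p i ≡⟨ coeff-+ q p i ⟨
    coeff (q +ᴾ p) i        ∎

  +-identityʳ : ∀ p → (p +ᴾ 0ᴾ) ≋ p
  +-identityʳ []      = ≋-refl
  +-identityʳ (a ∷ p) = ≋-refl

  -‿inverseˡ : ∀ p → (-ᴾ p +ᴾ p) ≋ 0ᴾ
  -‿inverseˡ p = mk≋ λ i → begin
    coeff (-ᴾ p +ᴾ p) i                  ≡⟨ coeff-+ (-ᴾ p) p i ⟩
    coeff (-ᴾ p) i ℤ.+ coeff p i         ≡⟨ cong (ℤ._+ coeff p i) (coeff-scale (- + 1) p i) ⟩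
    - + 1 ℤ.* coeff p i ℤ.+ coeff p i    ≡⟨ cong (ℤ._+ coeff p i) (ℤ.-1*i≡-i (coeff p i)) ⟩
    - coeff p i ℤ.+ coeff p i            ≡⟨ ℤ.+-inverseˡ (coeff p i) ⟩
    + 0                                  ∎

  scale-cong : ∀ c {p q} → p ≋ q → scaleᴾ c p ≋ scaleᴾ c q
  scale-cong c {p} {q} (mk≋ e) = mk≋ λ i → begin
    coeff (scaleᴾ c p) i ≡⟨ coeff-scale c p i ⟩
    c ℤ.* coeff p i      ≡⟨ cong (c ℤ.*_) (e i) ⟩
    c ℤ.* coeff q i      ≡⟨ coeff-scale c q i ⟨
    coeff (scaleᴾ c q) i ∎

  scale-distribˡ : ∀ c p q → scaleᴾ c (p +ᴾ q) ≋ (scaleᴾ c p +ᴾ scaleᴾ c q)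
  scale-distribˡ c p q = mk≋ λ i → begin
    coeff (scaleᴾ c (p +ᴾ q)) i                     ≡⟨ coeff-scale c (p +ᴾ q) i ⟩
    c ℤ.* coeff (p +ᴾ q) i                          ≡⟨ cong (c ℤ.*_) (coeff-+ p q i) ⟩
    c ℤ.* (coeff p i ℤ.+ coeff q i)                 ≡⟨ ℤ.*-distribˡ-+ c (coeff p i) _ ⟩
    c ℤ.* coeff p i ℤ.+ c ℤ.* coeff q i             ≡⟨ cong₂ ℤ._+_ (coeff-scale c p i) (coeff-scale c q i) ⟨
    coeff (scaleᴾ c p) i ℤ.+ coeff (scaleᴾ c q) i   ≡⟨ coeff-+ (scaleᴾ c p) (scaleᴾ c q) i ⟨
    coeff (scaleᴾ c p +ᴾ scaleᴾ c q) i              ∎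

  scale-distribʳ : ∀ c d p → scaleᴾ (c ℤ.+ d) p ≋ (scaleᴾ c p +ᴾ scaleᴾ d p)
  scale-distribʳ c d p = mk≋ λ i → begin
    coeff (scaleᴾ (c ℤ.+ d) p) i                    ≡⟨ coeff-scale (c ℤ.+ d) p i ⟩
    (c ℤ.+ d) ℤ.* coeff p i                         ≡⟨ ℤ.*-distribʳ-+ (coeff p i) c d ⟩
    c ℤ.* coeff p i ℤ.+ d ℤ.* coeff p i             ≡⟨ cong₂ ℤ._+_ (coeff-scale c p i) (coeff-scale d p i) ⟨
    coeff (scaleᴾ c p) i ℤ.+ coeff (scaleᴾ d p) i   ≡⟨ coeff-+ (scaleᴾ c p) (scaleᴾ d p) i ⟨
    coeff (scaleᴾ c p +ᴾ scaleᴾ d p) i              ∎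

  scale-assoc : ∀ c d p → scaleᴾ c (scaleᴾ d p) ≋ scaleᴾ (c ℤ.* d) p
  scale-assoc c d p = mk≋ λ i → begin
    coeff (scaleᴾ c (scaleᴾ d p)) i ≡⟨ coeff-scale c (scaleᴾ d p) i ⟩
    c ℤ.* coeff (scaleᴾ d p) i      ≡⟨ cong (c ℤ.*_) (coeff-scale d p i) ⟩
    c ℤ.* (d ℤ.* coeff p i)         ≡⟨ ℤ.*-assoc c d (coeff p i) ⟨
    c ℤ.* d ℤ.* coeff p i           ≡⟨ coeff-scale (c ℤ.* d) p i ⟨
    coeff (scaleᴾ (c ℤ.* d) p) i    ∎

  scale-identity : ∀ p → scaleᴾ (+ 1) p ≋ p
  scale-identity p = mk≋ λ i → ≡.trans (coeff-scale (+ 1) p i) (ℤ.*-identityˡ (coeff p i))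

  scale-zero : ∀ p → scaleᴾ (+ 0) p ≋ 0ᴾ
  scale-zero p = mk≋ (coeff-scale (+ 0) p)

  scale-congˡ : ∀ {c d} p → c ≡ d → scaleᴾ c p ≋ scaleᴾ d p
  scale-congˡ p refl = ≋-refl

  +-interchange : ∀ a b c d → ((a +ᴾ b) +ᴾ (c +ᴾ d)) ≋ ((a +ᴾ c) +ᴾ (b +ᴾ d))
  +-interchange a b c d = mk≋ λ i → begin
    coeff ((a +ᴾ b) +ᴾ (c +ᴾ d)) i
      ≡⟨ ≡.trans (coeff-+ (a +ᴾ b) _ i) (cong₂ ℤ._+_ (coeff-+ a b i) (coeff-+ c d i)) ⟩
    (coeff a i ℤ.+ coeff b i) ℤ.+ (coeff c i ℤ.+ coeff d i)
      ≡⟨ interchange (coeff a i) (coeff b i) (coeff c i) (coeff d i) ⟩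
    (coeff a i ℤ.+ coeff c i) ℤ.+ (coeff b i ℤ.+ coeff d i)
      ≡⟨ ≡.trans (coeff-+ (a +ᴾ c) _ i) (cong₂ ℤ._+_ (coeff-+ a c i) (coeff-+ b d i)) ⟨
    coeff ((a +ᴾ c) +ᴾ (b +ᴾ d)) i ∎
    where
    interchange : ∀ a b c d → (a ℤ.+ b) ℤ.+ (c ℤ.+ d) ≡ (a ℤ.+ c) ℤ.+ (b ℤ.+ d)
    interchange = solve-∀

  *-zeroˡ-≋ : ∀ p q → p ≋ 0ᴾ → (p *ᴾ q) ≋ 0ᴾ
  *-zeroˡ-≋ []      q e       = ≋-refl
  *-zeroˡ-≋ (a ∷ p) q (mk≋ e) = ≋-trans
    (+-cong (≋-trans (scale-congˡ q (e zero)) (scale-zero q))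
            (≋-trans (∷-cong refl (*-zeroˡ-≋ p q (mk≋ (e ∘ suc)))) 0∷0ᴾ))
    ≋-refl

  *-congˡ : ∀ {p p′} q → p ≋ p′ → (p *ᴾ q) ≋ (p′ *ᴾ q)
  *-congˡ {[]}    {p′}     q e       = ≋-sym (*-zeroˡ-≋ p′ q (≋-sym e))
  *-congˡ {a ∷ p} {[]}     q e       = *-zeroˡ-≋ (a ∷ p) q e
  *-congˡ {a ∷ p} {b ∷ p′} q (mk≋ e) =
    +-cong (scale-congˡ q (e zero)) (∷-cong refl (*-congˡ {p} {p′} q (mk≋ (e ∘ suc))))

  *-congʳ : ∀ p {q q′} → q ≋ q′ → (p *ᴾ q) ≋ (p *ᴾ q′)
  *-congʳ []      e = ≋-refl
  *-congʳ (a ∷ p) e = +-cong (scale-cong a e) (∷-cong refl (*-congʳ p e))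

  *-cong : ∀ {p p′ q q′} → p ≋ p′ → q ≋ q′ → (p *ᴾ q) ≋ (p′ *ᴾ q′)
  *-cong {p′ = p′} {q} e f = ≋-trans (*-congˡ q e) (*-congʳ p′ f)

  *-zeroʳ : ∀ p → (p *ᴾ 0ᴾ) ≋ 0ᴾ
  *-zeroʳ []      = ≋-refl
  *-zeroʳ (a ∷ p) = ≋-trans (∷-cong refl (*-zeroʳ p)) 0∷0ᴾ

  *-distribʳ : ∀ r p q → ((p +ᴾ q) *ᴾ r) ≋ ((p *ᴾ r) +ᴾ (q *ᴾ r))
  *-distribʳ r []      q       = ≋-refl
  *-distribʳ r (a ∷ p) []      = ≋-sym (+-identityʳ _)
  *-distribʳ r (a ∷ p) (b ∷ q) = ≋-trans
    (+-cong (scale-distribʳ a b r) (∷-cong refl (*-distribʳ r p q)))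
    (+-interchange (scaleᴾ a r) (scaleᴾ b r) (+ 0 ∷ (p *ᴾ r)) (+ 0 ∷ (q *ᴾ r)))

  *-distribˡ : ∀ p q r → (p *ᴾ (q +ᴾ r)) ≋ ((p *ᴾ q) +ᴾ (p *ᴾ r))
  *-distribˡ []      q r = ≋-refl
  *-distribˡ (a ∷ p) q r = ≋-trans
    (+-cong (scale-distribˡ a q r) (∷-cong refl (*-distribˡ p q r)))
    (+-interchange (scaleᴾ a q) (scaleᴾ a r) (+ 0 ∷ (p *ᴾ q)) (+ 0 ∷ (p *ᴾ r)))

  scale-*ˡ : ∀ c p q → (scaleᴾ c p *ᴾ q) ≋ scaleᴾ c (p *ᴾ q)
  scale-*ˡ c []      q = ≋-refl
  scale-*ˡ c (a ∷ p) q = ≋-trans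
    (+-cong (≋-sym (scale-assoc c a q)) (∷-cong (≡.sym (ℤ.*-zeroʳ c)) (scale-*ˡ c p q)))
    (≋-sym (scale-distribˡ c (scaleᴾ a q) (+ 0 ∷ (p *ᴾ q))))

  *-assoc : ∀ p q r → ((p *ᴾ q) *ᴾ r) ≋ (p *ᴾ (q *ᴾ r))
  *-assoc []      q r = ≋-refl
  *-assoc (a ∷ p) q r = ≋-trans
    (*-distribʳ r (scaleᴾ a q) (+ 0 ∷ (p *ᴾ q)))
    (+-cong (scale-*ˡ a q r)
            (≋-trans (+-cong (scale-zero r) ≋-refl) (∷-cong refl (*-assoc p q r))))

  *-comm : ∀ p q → (p *ᴾ q) ≋ (q *ᴾ p)
  *-comm []      q       = ≋-sym (*-zeroʳ q)
  *-comm (a ∷ p) []      = *-zeroʳ (a ∷ p)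
  *-comm (a ∷ p) (b ∷ q) = ≋-trans
    (+-cong (≋-refl {scaleᴾ a (b ∷ q)}) (∷-cong refl (*-comm p (b ∷ q))))
    (≋-trans (mk≋ swap) (+-cong (≋-refl {scaleᴾ b (a ∷ p)}) (∷-cong refl (*-comm (a ∷ p) q))))
    where
    swap : (scaleᴾ a (b ∷ q) +ᴾ (+ 0 ∷ (scaleᴾ b p +ᴾ (+ 0 ∷ (q *ᴾ p)))))
           ≈ᴾ (scaleᴾ b (a ∷ p) +ᴾ (+ 0 ∷ (scaleᴾ a q +ᴾ (+ 0 ∷ (p *ᴾ q)))))
    swap zero    = cong (ℤ._+ + 0) (ℤ.*-comm a b)
    swap (suc i) = begin
      coeff (scaleᴾ a q +ᴾ (scaleᴾ b p +ᴾ (+ 0 ∷ (q *ᴾ p)))) i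
        ≡⟨ ≡.trans (coeff-+ (scaleᴾ a q) _ i) (cong (λ v → coeff (scaleᴾ a q) i ℤ.+ v) (coeff-+ (scaleᴾ b p) _ i)) ⟩
      coeff (scaleᴾ a q) i ℤ.+ (coeff (scaleᴾ b p) i ℤ.+ coeff (+ 0 ∷ (q *ᴾ p)) i)
        ≡⟨ exchange (coeff (scaleᴾ a q) i) (coeff (scaleᴾ b p) i) _ _ (coeff-≡ (∷-cong refl (*-comm q p)) i) ⟩
      coeff (scaleᴾ b p) i ℤ.+ (coeff (scaleᴾ a q) i ℤ.+ coeff (+ 0 ∷ (p *ᴾ q)) i)
        ≡⟨ ≡.trans (coeff-+ (scaleᴾ b p) _ i) (cong (λ v → coeff (scaleᴾ b p) i ℤ.+ v) (coeff-+ (scaleᴾ a q) _ i)) ⟨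
      coeff (scaleᴾ b p +ᴾ (scaleᴾ a q +ᴾ (+ 0 ∷ (p *ᴾ q)))) i ∎
      where
      exchange : ∀ x y u v → u ≡ v → x ℤ.+ (y ℤ.+ u) ≡ y ℤ.+ (x ℤ.+ v)
      exchange x y u v refl = ≡.trans (≡.sym (ℤ.+-assoc x y u))
        (≡.trans (cong (ℤ._+ u) (ℤ.+-comm x y)) (ℤ.+-assoc y x u))

  *-identityˡ : ∀ p → (1ᴾ *ᴾ p) ≋ p
  *-identityˡ p = ≋-trans (+-cong (scale-identity p) 0∷0ᴾ) (+-identityʳ p)

  +-*-isCommutativeRing : IsCommutativeRing _≋_ _+ᴾ_ _*ᴾ_ -ᴾ_ 0ᴾ 1ᴾ
  +-*-isCommutativeRing = record
    { isRing = record
      { +-isAbelianGroup = record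
        { isGroup = record
          { isMonoid = record
            { isSemigroup = record
              { isMagma = record
                { isEquivalence = record { refl = ≋-refl ; sym = ≋-sym ; trans = ≋-trans }
                ; ∙-cong = +-cong }
              ; assoc = +-assoc }
            ; identity = (λ _ → ≋-refl) , +-identityʳ }
          ; inverse = -‿inverseˡ , (λ p → ≋-trans (+-comm p (-ᴾ p)) (-‿inverseˡ p))
          ; ⁻¹-cong = scale-cong (- + 1) }
        ; comm = +-comm }
      ; *-cong = *-cong
      ; *-assoc = *-assoc
      ; *-identity = *-identityˡ , (λ p → ≋-trans (*-comm p 1ᴾ) (*-identityˡ p))
      ; distrib = *-distribˡ , *-distribʳ }
    ; *-comm = *-comm }

  +-*-commutativeRing : CommutativeRing _ _
  +-*-commutativeRing = record { isCommutativeRing = +-*-isCommutativeRing }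

  constant : ℤ-rawRing -Raw-AlmostCommutative⟶ fromCommutativeRing +-*-commutativeRing
  constant = record
    { ⟦_⟧    = _∷ []
    ; +-homo = λ _ _ → ≋-refl
    ; *-homo = λ _ _ → mk≋ λ { zero → ≡.sym (ℤ.+-identityʳ _) ; (suc i) → refl }
    ; -‿homo = λ a → mk≋ λ { zero → ≡.sym (ℤ.-1*i≡-i a) ; (suc i) → refl }
    ; 0-homo = 0∷0ᴾ
    ; 1-homo = ≋-refl
    }

  eval-+ : ∀ p q x → eval (p +ᴾ q) x ≡ eval p x ℤ.+ eval q x
  eval-+ []      q       x = ≡.sym (ℤ.+-identityˡ _)
  eval-+ (a ∷ p) []      x = ≡.sym (ℤ.+-identityʳ _)
  eval-+ (a ∷ p) (b ∷ q) x = ≡.trans (cong (λ v → a ℤ.+ b ℤ.+ x ℤ.* v) (eval-+ p q x)) (shuffle a b x _ _)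
    where
    shuffle : ∀ a b x u v → (a ℤ.+ b) ℤ.+ x ℤ.* (u ℤ.+ v) ≡ (a ℤ.+ x ℤ.* u) ℤ.+ (b ℤ.+ x ℤ.* v)
    shuffle = solve-∀

  eval-scale : ∀ c p x → eval (scaleᴾ c p) x ≡ c ℤ.* eval p x
  eval-scale c []      x = ≡.sym (ℤ.*-zeroʳ c)
  eval-scale c (a ∷ p) x = ≡.trans (cong (λ v → c ℤ.* a ℤ.+ x ℤ.* v) (eval-scale c p x)) (shuffle c a x _)
    where
    shuffle : ∀ c a x u → c ℤ.* a ℤ.+ x ℤ.* (c ℤ.* u) ≡ c ℤ.* (a ℤ.+ x ℤ.* u)
    shuffle = solve-∀

  eval-* : ∀ p q x → eval (p *ᴾ q) x ≡ eval p x ℤ.* eval q x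
  eval-* []      q x = refl
  eval-* (a ∷ p) q x = begin
    eval (scaleᴾ a q +ᴾ (+ 0 ∷ (p *ᴾ q))) x               ≡⟨ eval-+ (scaleᴾ a q) _ x ⟩
    eval (scaleᴾ a q) x ℤ.+ (+ 0 ℤ.+ x ℤ.* eval (p *ᴾ q) x)
      ≡⟨ cong₂ (λ u v → u ℤ.+ (+ 0 ℤ.+ x ℤ.* v)) (eval-scale a q x) (eval-* p q x) ⟩
    a ℤ.* eval q x ℤ.+ (+ 0 ℤ.+ x ℤ.* (eval p x ℤ.* eval q x)) ≡⟨ shuffle a x (eval p x) (eval q x) ⟩
    (a ℤ.+ x ℤ.* eval p x) ℤ.* eval q x                        ∎
    where
    shuffle : ∀ a x u v → a ℤ.* v ℤ.+ (+ 0 ℤ.+ x ℤ.* (u ℤ.* v)) ≡ (a ℤ.+ x ℤ.* u) ℤ.* v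
    shuffle = solve-∀

  eval-const : ∀ c x → eval (c ∷ []) x ≡ c
  eval-const c x = ≡.trans (cong (λ v → c ℤ.+ v) (ℤ.*-zeroʳ x)) (ℤ.+-identityʳ c)

module BooleanComparison where

  open import Data.Bool using (true; false)
  open import Data.Empty using (⊥-elim)
  open import Data.Nat using (zero; suc; _+_; _∸_; _<_; _≤_; s≤s; _<ᵇ_; _≡ᵇ_)
  open import Function using (_∘_)
  open import Relation.Binary.PropositionalEquality as ≡ using (_≡_; _≢_)

  <ᵇ-true : ∀ {a k} → a < k → (a <ᵇ k) ≡ true
  <ᵇ-true {zero}  {suc k} _         = ≡.refl
  <ᵇ-true {suc a} {suc k} (s≤s a<k) = <ᵇ-true a<k

  <ᵇ-false : ∀ {a k} → k ≤ a → (a <ᵇ k) ≡ false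
  <ᵇ-false {a}     {zero}  _         = ≡.refl
  <ᵇ-false {suc a} {suc k} (s≤s k≤a) = <ᵇ-false k≤a

  <ᵇ-suc : ∀ {a k} → a ≢ k → (a <ᵇ suc k) ≡ (a <ᵇ k)
  <ᵇ-suc {zero}  {zero}  a≢k = ⊥-elim (a≢k ≡.refl)
  <ᵇ-suc {zero}  {suc k} _   = ≡.refl
  <ᵇ-suc {suc a} {zero}  _   = ≡.refl
  <ᵇ-suc {suc a} {suc k} a≢k = <ᵇ-suc (a≢k ∘ ≡.cong suc)

  ≡ᵇ-true : ∀ n → (n ≡ᵇ n) ≡ true
  ≡ᵇ-true zero    = ≡.refl
  ≡ᵇ-true (suc n) = ≡ᵇ-true n

  ≡ᵇ-false : ∀ {m n} → m ≢ n → (m ≡ᵇ n) ≡ false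
  ≡ᵇ-false {zero}  {zero}  m≢n = ⊥-elim (m≢n ≡.refl)
  ≡ᵇ-false {zero}  {suc n} _   = ≡.refl
  ≡ᵇ-false {suc m} {zero}  _   = ≡.refl
  ≡ᵇ-false {suc m} {suc n} m≢n = ≡ᵇ-false (m≢n ∘ ≡.cong suc)

  ≡ᵇ-+-cancelˡ : ∀ n a b → ((n + a) ≡ᵇ (n + b)) ≡ (a ≡ᵇ b)
  ≡ᵇ-+-cancelˡ zero    a b = ≡.refl
  ≡ᵇ-+-cancelˡ (suc n) a b = ≡ᵇ-+-cancelˡ n a b

  ≡ᵇ-∸ : ∀ m {p q} → m ≤ p → m ≤ q → (p ≡ᵇ q) ≡ ((p ∸ m) ≡ᵇ (q ∸ m))
  ≡ᵇ-∸ zero    _         _         = ≡.refl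
  ≡ᵇ-∸ (suc m) (s≤s m≤p) (s≤s m≤q) = ≡ᵇ-∸ m m≤p m≤q

module Determinant {c ℓ} (CR : CommutativeRing c ℓ)
  (morphism : ℤ-rawRing -Raw-AlmostCommutative⟶ fromCommutativeRing CR) where

  open import Data.Bool using (true; false; if_then_else_)
  open import Data.Bool.Properties using (if-float)
  open import Data.Empty using (⊥-elim)
  open import Data.Fin using (Fin; zero; suc; punchIn; toℕ; fromℕ<; _↑ˡ_; _↑ʳ_)
  open import Data.Fin.Properties using (suc-injective; toℕ<n; toℕ-injective; toℕ-fromℕ<; toℕ-↑ˡ; toℕ-↑ʳ)
  open import Data.Integer as ℤ using (+_)
  open import Data.Maybe using (Maybe; just; nothing)
  open import Data.Nat as ℕ using (ℕ; zero; suc; _<ᵇ_; _≡ᵇ_)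
  import Data.Nat.Properties as ℕ
  open import Function using (_∘_)
  open import Relation.Nullary using (yes; no)
  open import Relation.Binary.PropositionalEquality as ≡ using (_≡_; _≢_)
  import Relation.Binary.Reasoning.Setoid as ≈-Reasoning

  open BooleanComparison
  open CommutativeRing CR renaming (Carrier to R)
    hiding (zero; 0#; 1#; *-identityˡ; +-identityʳ; zeroˡ; zeroʳ)
  open _-Raw-AlmostCommutative⟶_ morphism using (⟦_⟧)

  private
    decide : ∀ a b → Maybe (⟦ a ⟧ ≈ ⟦ b ⟧)
    decide a b with a ℤ.≟ b
    ... | yes ≡.refl = just refl
    ... | no _       = nothing

  open import Algebra.Solver.Ring ℤ-rawRing (fromCommutativeRing CR) morphism decide
    public using (solve; _:=_; _:+_; _:*_; :-_; con)

  -- The ring solver reads numerals through ⟦_⟧, so the constants are taken to be images of integers.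
  0# 1# : R
  0# = ⟦ + 0 ⟧
  1# = ⟦ + 1 ⟧

  private
    *-identityˡ : ∀ x → 1# * x ≈ x
    *-identityˡ = solve 1 (λ x → con (+ 1) :* x := x) refl

    +-identityʳ : ∀ x → x + 0# ≈ x
    +-identityʳ = solve 1 (λ x → x :+ con (+ 0) := x) refl

    zeroˡ : ∀ x → 0# * x ≈ 0#
    zeroˡ = solve 1 (λ x → con (+ 0) :* x := con (+ 0)) refl

    zeroʳ : ∀ x → x * 0# ≈ 0#
    zeroʳ = solve 1 (λ x → x :* con (+ 0) := con (+ 0)) refl

  Matrix : ℕ → Set c
  Matrix n = Fin n → Fin n → R

  -- Opaque: the lemmas below are its interface, and unfolding sums inside determinants defeats unification.
  opaque
    ∑ : ∀ {n} → (Fin n → R) → R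
    ∑ {zero}  f = 0#
    ∑ {suc n} f = f zero + ∑ (f ∘ suc)

    ∑-suc : ∀ {n} (f : Fin (suc n) → R) → ∑ f ≈ f zero + ∑ (f ∘ suc)
    ∑-suc f = refl

    ∑-zero : (f : Fin zero → R) → ∑ f ≈ 0#
    ∑-zero f = refl

    ∑-cong : ∀ {n} {f g : Fin n → R} → (∀ i → f i ≈ g i) → ∑ f ≈ ∑ g
    ∑-cong {zero}  e = refl
    ∑-cong {suc n} e = +-cong (e zero) (∑-cong (e ∘ suc))

    ∑-+ : ∀ {n} (f g : Fin n → R) → ∑ (λ i → f i + g i) ≈ ∑ f + ∑ g
    ∑-+ {zero}  f g = solve 0 (con (+ 0) := con (+ 0) :+ con (+ 0)) refl
    ∑-+ {suc n} f g = trans (+-cong refl (∑-+ (f ∘ suc) (g ∘ suc)))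
      (solve 4 (λ a b c d → (a :+ b) :+ (c :+ d) := (a :+ c) :+ (b :+ d)) refl _ _ _ _)

    ∑-*ˡ : ∀ {n} x (f : Fin n → R) → x * ∑ f ≈ ∑ (λ i → x * f i)
    ∑-*ˡ {zero}  x f = zeroʳ x
    ∑-*ˡ {suc n} x f = trans (distribˡ x _ _) (+-cong refl (∑-*ˡ x (f ∘ suc)))

    ∑-vanishing : ∀ {n} (f : Fin n → R) → (∀ i → f i ≈ 0#) → ∑ f ≈ 0#
    ∑-vanishing {zero}  f e = refl
    ∑-vanishing {suc n} f e = trans (+-cong (e zero) (∑-vanishing (f ∘ suc) (e ∘ suc)))
      (solve 0 (con (+ 0) :+ con (+ 0) := con (+ 0)) refl)

    ∑-neg : ∀ {n} (f : Fin n → R) → ∑ (λ i → - f i) ≈ - ∑ f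
    ∑-neg {zero}  f = solve 0 (con (+ 0) := :- con (+ 0)) refl
    ∑-neg {suc n} f = trans (+-cong refl (∑-neg (f ∘ suc)))
      (solve 2 (λ a b → :- a :+ :- b := :- (a :+ b)) refl _ _)

  ∑-linear : ∀ {n k} {f g h : Fin n → R} → (∀ i → f i ≈ k * g i + h i) → ∑ f ≈ k * ∑ g + ∑ h
  ∑-linear {k = k} e = trans (∑-cong e) (trans (∑-+ _ _) (+-cong (sym (∑-*ˡ k _)) refl))

  sign : ∀ {n} → Fin n → R
  sign zero    = 1#
  sign (suc j) = - sign j

  sign²≈1 : ∀ {n} (j : Fin n) → sign j * sign j ≈ 1#
  sign²≈1 zero    = solve 0 (con (+ 1) :* con (+ 1) := con (+ 1)) refl
  sign²≈1 (suc j) = trans (solve 1 (λ s → (:- s) :* (:- s) := s :* s) refl (sign j)) (sign²≈1 j)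

  minor : ∀ {n} → Fin (suc n) → Matrix (suc n) → Matrix n
  minor j M r c = M (suc r) (punchIn j c)

  det : ∀ n → Matrix n → R
  det zero    M = 1#
  det (suc n) M = ∑ λ j → sign j * (M zero j * det n (minor j M))

  det-cong : ∀ n {M N : Matrix n} → (∀ i j → M i j ≈ N i j) → det n M ≈ det n N
  det-cong zero    e = refl
  det-cong (suc n) e = ∑-cong λ j → *-cong refl (*-cong (e zero j) (det-cong n λ r c → e (suc r) (punchIn j c)))

  det-linear : ∀ n (r : Fin n) (k : R) (M N P : Matrix n)
    → (∀ i → i ≢ r → ∀ c → M i c ≈ N i c) → (∀ i → i ≢ r → ∀ c → M i c ≈ P i c)
    → (∀ c → M r c ≈ k * N r c + P r c) → det n M ≈ k * det n N + det n P
  det-linear (suc n) zero k M N P eN eP er = ∑-linear λ j →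
    trans (*-cong refl (*-cong (er j) (det-cong n λ a b → eN (suc a) (λ ()) (punchIn j b))))
      (trans (solve 5 (λ s k x y d → s :* ((k :* x :+ y) :* d) := k :* (s :* (x :* d)) :+ s :* (y :* d)) refl
                (sign j) k (N zero j) (P zero j) (det n (minor j N)))
             (+-cong refl (*-cong refl (*-cong refl (det-cong n λ a b →
                trans (sym (eN (suc a) (λ ()) (punchIn j b))) (eP (suc a) (λ ()) (punchIn j b)))))))
  det-linear (suc n) (suc r) k M N P eN eP er = ∑-linear λ j →
    trans (*-cong refl (*-cong (eN zero (λ ()) j)
        (det-linear n r k (minor j M) (minor j N) (minor j P)
          (λ i i≢r c → eN (suc i) (i≢r ∘ suc-injective) (punchIn j c))
          (λ i i≢r c → eP (suc i) (i≢r ∘ suc-injective) (punchIn j c))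
          (λ c → er (punchIn j c)))))
      (trans (solve 5 (λ s x k d e → s :* (x :* (k :* d :+ e)) := k :* (s :* (x :* d)) :+ s :* (x :* e)) refl
                (sign j) (N zero j) k (det n (minor j N)) (det n (minor j P)))
             (+-cong refl (*-cong refl (*-cong (trans (sym (eN zero (λ ()) j)) (eP zero (λ ()) j)) refl))))

  det-additive : ∀ n (r : Fin n) (M N P : Matrix n)
    → (∀ i → i ≢ r → ∀ c → M i c ≈ N i c) → (∀ i → i ≢ r → ∀ c → M i c ≈ P i c)
    → (∀ c → M r c ≈ N r c + P r c) → det n M ≈ det n N + det n P
  det-additive n r M N P eN eP er =
    trans (det-linear n r 1# M N P eN eP λ c → trans (er c) (+-cong (sym (*-identityˡ _)) refl))
          (+-cong (*-identityˡ _) refl)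

  -- Laplace expansion along two first rows a and b; F evaluates the remaining rows on the surviving columns.
  expand₂ : ∀ n → (a b : Fin (suc (suc n)) → R) → ((Fin n → Fin (suc (suc n))) → R) → R
  expand₂ n a b F = ∑ λ j → sign j * (a j * ∑ λ k → sign k * (b (punchIn j k) * F (punchIn j ∘ punchIn k)))

  Extensional : ∀ {n m} → ((Fin n → Fin m) → R) → Set ℓ
  Extensional F = ∀ f g → (∀ i → f i ≡ g i) → F f ≈ F g

  expand₂-equal-rows : ∀ n (a : Fin (suc (suc n)) → R) F → Extensional F → expand₂ n a a F ≈ 0#
  expand₂-equal-rows n a F ext =
    trans peel (trans (+-cong refl (trans (∑-cong λ _ → distrib-inner) (∑-+ _ _)))
      (trans (+-cong refl (+-cong peel-inner (inner-alternates n a F ext)))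
      (trans (+-cong refl (+-cong (+-cong refl pull-a₀) refl))
             (solve 4 (λ a₀ a₁ E B → con (+ 1) :* (a₀ :* (con (+ 1) :* (a₁ :* E) :+ B))
                                     :+ (((:- con (+ 1) :* (a₁ :* (con (+ 1) :* (a₀ :* E)))) :+ :- (a₀ :* B)) :+ con (+ 0))
                                     := con (+ 0)) refl (a zero) (a (suc zero)) E B))))
    where
    E : R
    E = F λ i → suc (suc i)
    G : Fin n → R
    G k = F (suc ∘ punchIn (suc k))
    B : R
    B = ∑ λ k → - sign k * (a (suc (suc k)) * G k)
    U : Fin (suc n) → R
    U j = 1# * (a zero * F (suc ∘ punchIn j))
    Q : Fin (suc n) → R
    Q j = ∑ λ k → - sign k * (a (suc (punchIn j k)) * F (punchIn (suc j) ∘ punchIn (suc k)))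
    peel : expand₂ n a a F ≈ 1# * (a zero * (1# * (a (suc zero) * E) + B)) + ∑ (λ j → - sign j * (a (suc j) * (U j + Q j)))
    peel = trans (∑-suc _) (+-cong (*-cong refl (*-cong refl (∑-suc _))) (∑-cong λ j → *-cong refl (*-cong refl (∑-suc _))))
    distrib-inner : ∀ {x y u q} → x * (y * (u + q)) ≈ x * (y * u) + x * (y * q)
    distrib-inner = solve 4 (λ x y u q → x :* (y :* (u :+ q)) := x :* (y :* u) :+ x :* (y :* q)) refl _ _ _ _
    peel-inner : ∑ (λ j → - sign j * (a (suc j) * U j))
               ≈ (- 1# * (a (suc zero) * (1# * (a zero * E)))) + ∑ (λ k → - (- sign k) * (a (suc (suc k)) * (1# * (a zero * G k))))
    peel-inner = ∑-suc _
    pull-a₀ : ∑ (λ k → - (- sign k) * (a (suc (suc k)) * (1# * (a zero * G k)))) ≈ - (a zero * B)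
    pull-a₀ = trans (∑-cong λ k → solve 4 (λ s x a₀ g → :- (:- s) :* (x :* (con (+ 1) :* (a₀ :* g))) := :- (a₀ :* (:- s :* (x :* g)))) refl
                                     (sign k) (a (suc (suc k))) (a zero) (G k))
                    (trans (∑-neg _) (-‿cong (sym (∑-*ˡ (a zero) _))))
    inner-alternates : ∀ n (a : Fin (suc (suc n)) → R) F → Extensional F
      → ∑ (λ j → - sign j * (a (suc j) * ∑ λ k → - sign k * (a (suc (punchIn j k)) * F (punchIn (suc j) ∘ punchIn (suc k))))) ≈ 0#
    inner-alternates zero a F ext = ∑-vanishing _ λ j →
      trans (*-cong refl (*-cong refl (∑-zero _))) (solve 2 (λ x y → x :* (y :* con (+ 0)) := con (+ 0)) refl _ _)
    inner-alternates (suc m) a F ext =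
      trans (∑-cong λ j → trans (*-cong refl (*-cong refl (trans (∑-cong λ k →
                trans (*-cong refl (*-cong refl (ext _ _ λ { zero → ≡.refl ; (suc i) → ≡.refl })))
                      (solve 3 (λ s x h → :- s :* (x :* h) := :- (s :* (x :* h))) refl _ _ _)) (∑-neg _))))
              (solve 3 (λ s y t → :- s :* (y :* (:- t)) := s :* (y :* t)) refl (sign j) (a (suc j)) _))
            (expand₂-equal-rows m (a ∘ suc) (F ∘ lift) λ f g e → ext _ _ λ { zero → ≡.refl ; (suc i) → ≡.cong suc (e i) })
      where
      lift : (Fin m → Fin (suc (suc m))) → Fin (suc m) → Fin (suc (suc (suc m)))
      lift g zero    = zero
      lift g (suc i) = suc (g i)

  det-equal-rows₀₁ : ∀ n (M : Matrix (suc (suc n))) → (∀ c → M zero c ≈ M (suc zero) c) → det (suc (suc n)) M ≈ 0#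
  det-equal-rows₀₁ n M e =
    trans (∑-cong λ j → *-cong refl (*-cong refl (∑-cong λ k → *-cong refl (*-cong (sym (e (punchIn j k))) refl))))
          (expand₂-equal-rows n (M zero) (λ f → det n λ r c → M (suc (suc r)) (f c))
             λ f g f≗g → det-cong n λ r c → reflexive (≡.cong (M (suc (suc r))) (f≗g c)))

  withRows₀₁ : ∀ {n} → (Fin (suc (suc n)) → R) → (Fin (suc (suc n)) → R) → Matrix (suc (suc n)) → Matrix (suc (suc n))
  withRows₀₁ u v M zero          = u
  withRows₀₁ u v M (suc zero)    = v
  withRows₀₁ u v M (suc (suc i)) = M (suc (suc i))

  -- Expand det(u+v, u+v, …) = 0 by additivity in both rows; the terms det(u,u,…) and det(v,v,…) vanish.
  det-swap₀₁ : ∀ n (M : Matrix (suc (suc n))) → det (suc (suc n)) (withRows₀₁ (M (suc zero)) (M zero) M) ≈ - det (suc (suc n)) M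
  det-swap₀₁ n M = cancel (trans (sym (det-equal-rows₀₁ n (withRows₀₁ u+v u+v M) λ _ → refl))
                                 (trans (additive₀ u+v) (+-cong (additive₁ u) (additive₁ v))))
                          (det-equal-rows₀₁ n (withRows₀₁ u u M) λ _ → refl)
                          (det-equal-rows₀₁ n (withRows₀₁ v v M) λ _ → refl)
    where
    u : Fin (suc (suc n)) → R
    u = M zero
    v : Fin (suc (suc n)) → R
    v = M (suc zero)
    D : (Fin (suc (suc n)) → R) → (Fin (suc (suc n)) → R) → R
    D x y = det (suc (suc n)) (withRows₀₁ x y M)
    u+v : Fin (suc (suc n)) → R
    u+v c = u c + v c
    additive₀ : ∀ w → D u+v w ≈ D u w + D v w
    additive₀ w = det-additive _ zero (withRows₀₁ u+v w M) (withRows₀₁ u w M) (withRows₀₁ v w M)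
      (λ { zero ne → ⊥-elim (ne ≡.refl) ; (suc zero) _ c → refl ; (suc (suc i)) _ c → refl })
      (λ { zero ne → ⊥-elim (ne ≡.refl) ; (suc zero) _ c → refl ; (suc (suc i)) _ c → refl })
      (λ c → refl)
    additive₁ : ∀ w → D w u+v ≈ D w u + D w v
    additive₁ w = det-additive _ (suc zero) (withRows₀₁ w u+v M) (withRows₀₁ w u M) (withRows₀₁ w v M)
      (λ { zero _ c → refl ; (suc zero) ne → ⊥-elim (ne ≡.refl) ; (suc (suc i)) _ c → refl })
      (λ { zero _ c → refl ; (suc zero) ne → ⊥-elim (ne ≡.refl) ; (suc (suc i)) _ c → refl })
      (λ c → refl)
    cancel : 0# ≈ (D u u + D u v) + (D v u + D v v) → D u u ≈ 0# → D v v ≈ 0# → D v u ≈ - D u v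
    cancel e uu vv = trans (solve 2 (λ b c → c := (((con (+ 0) :+ b) :+ (c :+ con (+ 0))) :+ (:- b))) refl (D u v) (D v u))
      (trans (+-cong (sym (trans e (+-cong (+-cong uu refl) (+-cong refl vv)))) refl)
             (solve 1 (λ b → con (+ 0) :+ :- b := :- b) refl (D u v)))

  moveToTop : ∀ {n} {A : Set c} → Fin (suc n) → (Fin (suc n) → A) → Fin (suc n) → A
  moveToTop r M zero    = M r
  moveToTop r M (suc i) = M (punchIn r i)

  det-moveToTop : ∀ n (r : Fin (suc n)) (M : Matrix (suc n)) → det (suc n) (moveToTop r M) ≈ sign r * det (suc n) M
  det-moveToTop n zero M =
    trans (det-cong (suc n) {moveToTop zero M} {M} λ { zero c → refl ; (suc i) c → refl })
          (sym (*-identityˡ _))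
  det-moveToTop (suc n) (suc r) M =
    trans (det-cong (suc (suc n)) {moveToTop (suc r) M} {withRows₀₁ (N (suc zero)) (N zero) N}
                    λ { zero c → refl ; (suc zero) c → refl ; (suc (suc i)) c → refl })
      (trans (det-swap₀₁ n N) (trans (-‿cong det-N) (solve 2 (λ s d → :- (s :* d) := (:- s) :* d) refl _ _)))
    where
    N : Matrix (suc (suc n))
    N zero    = M zero
    N (suc i) = moveToTop r (M ∘ suc) i
    det-N : det (suc (suc n)) N ≈ sign r * det (suc (suc n)) M
    det-N = trans (∑-cong λ j → trans (*-cong refl (*-cong refl
                 (trans (det-cong (suc n) {minor j N} {moveToTop r (minor j M)} λ { zero c → refl ; (suc i) c → refl })
                        (det-moveToTop n r (minor j M)))))
                 (solve 4 (λ s m r d → s :* (m :* (r :* d)) := r :* (s :* (m :* d))) refl (sign j) (M zero j) (sign r) _))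
              (sym (∑-*ˡ (sign r) _))

  det-equal-rows : ∀ n (j : Fin n) (M : Matrix (suc n)) → (∀ c → M zero c ≈ M (suc j) c) → det (suc n) M ≈ 0#
  det-equal-rows (suc n) j M e = cancel (sign²≈1 (suc j))
    (trans (sym (det-moveToTop (suc n) (suc j) M)) (det-equal-rows₀₁ n (moveToTop (suc j) M) (sym ∘ e)))
    where
    cancel : ∀ {s d} → s * s ≈ 1# → s * d ≈ 0# → d ≈ 0#
    cancel {s} {d} s²≈1 sd≈0 = trans (sym (*-identityˡ d))
      (trans (*-cong (sym s²≈1) refl) (trans (*-assoc s s d)
        (trans (*-cong refl sd≈0) (zeroʳ s))))

  setRow : ∀ {n} → Fin n → (Fin n → R) → Matrix n → Matrix n
  setRow r v M i with i Data.Fin.≟ r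
  ... | yes _ = v
  ... | no _  = M i

  det-addMultipleOfRow₀ : ∀ n (j : Fin n) (k : R) (M N : Matrix (suc n))
    → (∀ i → i ≢ suc j → ∀ c → N i c ≈ M i c)
    → (∀ c → N (suc j) c ≈ k * M zero c + M (suc j) c) → det (suc n) N ≈ det (suc n) M
  det-addMultipleOfRow₀ n j k M N same added =
    trans (det-linear (suc n) (suc j) k N P M (λ i ne c → trans (same i ne c) (sym (setRow-other i ne c))) same
             λ c → trans (added c) (+-cong (*-cong refl (sym (setRow-same c))) refl))
      (trans (+-cong (*-cong refl (det-equal-rows n j P λ c → trans (setRow-other zero (λ ()) c) (sym (setRow-same c)))) refl)
             (solve 2 (λ k d → k :* con (+ 0) :+ d := d) refl k _))
    where
    P : Matrix (suc n)
    P = setRow (suc j) (M zero) M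
    setRow-same : ∀ c → P (suc j) c ≈ M zero c
    setRow-same c with suc j Data.Fin.≟ suc j
    ... | yes _ = refl
    ... | no ne = ⊥-elim (ne ≡.refl)
    setRow-other : ∀ i → i ≢ suc j → ∀ c → P i c ≈ M i c
    setRow-other i ne c with i Data.Fin.≟ suc j
    ... | yes e = ⊥-elim (ne e)
    ... | no _  = refl

  Matrixℕ : Set c
  Matrixℕ = ℕ → ℕ → R

  restrict : ∀ {n} → Matrixℕ → Matrix n
  restrict M i j = M (toℕ i) (toℕ j)

  detℕ : ℕ → Matrixℕ → R
  detℕ n M = det n (restrict M)

  detℕ-cong : ∀ n (M N : Matrixℕ) → (∀ i j → i ℕ.< n → j ℕ.< n → M i j ≈ N i j) → detℕ n M ≈ detℕ n N
  detℕ-cong n M N e = det-cong n λ i j → e (toℕ i) (toℕ j) (toℕ<n i) (toℕ<n j)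

  signℕ : ℕ → R
  signℕ zero    = 1#
  signℕ (suc r) = - signℕ r

  sign≈signℕ : ∀ {n} (j : Fin n) → sign j ≈ signℕ (toℕ j)
  sign≈signℕ zero    = refl
  sign≈signℕ (suc j) = -‿cong (sign≈signℕ j)

  signℕ²≈1 : ∀ r → signℕ r * signℕ r ≈ 1#
  signℕ²≈1 zero    = *-identityˡ 1#
  signℕ²≈1 (suc r) = trans (solve 1 (λ s → (:- s) :* (:- s) := s :* s) refl (signℕ r)) (signℕ²≈1 r)

  punchInℕ : ℕ → ℕ → ℕ
  punchInℕ r i = if i <ᵇ r then i else suc i

  toℕ-punchIn : ∀ {n} (r : Fin (suc n)) (i : Fin n) → toℕ (punchIn r i) ≡ punchInℕ (toℕ r) (toℕ i)
  toℕ-punchIn zero    i       = ≡.refl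
  toℕ-punchIn (suc r) zero    = ≡.refl
  toℕ-punchIn (suc r) (suc i) = ≡.trans (≡.cong suc (toℕ-punchIn r i)) (if-float suc (toℕ i <ᵇ toℕ r))

  punchInℕ-< : ∀ {r j} → j ℕ.< r → punchInℕ r j ≡ j
  punchInℕ-< {r} {j} j<r rewrite <ᵇ-true j<r = ≡.refl

  punchInℕ-≥ : ∀ {r j} → r ℕ.≤ j → punchInℕ r j ≡ suc j
  punchInℕ-≥ {r} {j} r≤j rewrite <ᵇ-false r≤j = ≡.refl

  punchInℕ-≤ : ∀ r j → punchInℕ r j ℕ.≤ suc j
  punchInℕ-≤ r j with j <ᵇ r
  ... | true  = ℕ.n≤1+n j
  ... | false = ℕ.≤-refl

  minorℕ : ℕ → Matrixℕ → Matrixℕ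
  minorℕ j M r c = M (suc r) (punchInℕ j c)

  detℕ-expand : ∀ n (M : Matrixℕ) → detℕ (suc n) M ≈ ∑ λ (j : Fin (suc n)) → sign j * (M 0 (toℕ j) * detℕ n (minorℕ (toℕ j) M))
  detℕ-expand n M = ∑-cong λ j → *-cong refl (*-cong refl (det-cong n λ r c → reflexive (≡.cong (M (suc (toℕ r))) (toℕ-punchIn j c))))

  detℕ-moveToTop : ∀ n r → r ℕ.< suc n → (M N : Matrixℕ)
    → (∀ j → j ℕ.< suc n → N 0 j ≈ M r j)
    → (∀ i j → i ℕ.< n → j ℕ.< suc n → N (suc i) j ≈ M (punchInℕ r i) j)
    → detℕ (suc n) N ≈ signℕ r * detℕ (suc n) M
  detℕ-moveToTop n r r<1+n M N top rest =
    trans (det-cong (suc n) {restrict N} {moveToTop r′ (restrict M)} pointwise)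
      (trans (det-moveToTop n r′ (restrict M))
             (*-cong (trans (sign≈signℕ r′) (reflexive (≡.cong signℕ (toℕ-fromℕ< r<1+n)))) refl))
    where
    r′ : Fin (suc n)
    r′ = fromℕ< r<1+n
    pointwise : ∀ i j → restrict N i j ≈ moveToTop r′ (restrict M) i j
    pointwise zero    j = trans (top (toℕ j) (toℕ<n j)) (reflexive (≡.cong (λ x → M x (toℕ j)) (≡.sym (toℕ-fromℕ< r<1+n))))
    pointwise (suc i) j = trans (rest (toℕ i) (toℕ j) (toℕ<n i) (toℕ<n j))
      (reflexive (≡.cong (λ x → M x (toℕ j))
        (≡.sym (≡.trans (toℕ-punchIn r′ i) (≡.cong (λ y → punchInℕ y (toℕ i)) (toℕ-fromℕ< r<1+n))))))

  detℕ-linear : ∀ n r → r ℕ.< n → (k : R) (M N P : Matrixℕ)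
    → (∀ i j → i ℕ.< n → j ℕ.< n → i ≢ r → M i j ≈ N i j)
    → (∀ i j → i ℕ.< n → j ℕ.< n → i ≢ r → M i j ≈ P i j)
    → (∀ j → j ℕ.< n → M r j ≈ k * N r j + P r j)
    → detℕ n M ≈ k * detℕ n N + detℕ n P
  detℕ-linear n r r<n k M N P eN eP er =
    det-linear n (fromℕ< r<n) k (restrict M) (restrict N) (restrict P)
      (λ i ne c → eN (toℕ i) (toℕ c) (toℕ<n i) (toℕ<n c) (ne ∘ toℕ≡r))
      (λ i ne c → eP (toℕ i) (toℕ c) (toℕ<n i) (toℕ<n c) (ne ∘ toℕ≡r))
      (λ c → ≡.subst (λ x → M x (toℕ c) ≈ k * N x (toℕ c) + P x (toℕ c)) (≡.sym (toℕ-fromℕ< r<n)) (er (toℕ c) (toℕ<n c)))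
    where
    toℕ≡r : ∀ {i} → toℕ i ≡ r → i ≡ fromℕ< r<n
    toℕ≡r e = toℕ-injective (≡.trans e (≡.sym (toℕ-fromℕ< r<n)))

  detℕ-addMultipleOfRow₀ : ∀ n r → r ℕ.< n → (k : R) (M N : Matrixℕ)
    → (∀ i j → i ℕ.< suc n → j ℕ.< suc n → i ≢ suc r → N i j ≈ M i j)
    → (∀ j → j ℕ.< suc n → N (suc r) j ≈ k * M 0 j + M (suc r) j)
    → detℕ (suc n) N ≈ detℕ (suc n) M
  detℕ-addMultipleOfRow₀ n r r<n k M N same added =
    det-addMultipleOfRow₀ n (fromℕ< r<n) k (restrict M) (restrict N)
      (λ i ne c → same (toℕ i) (toℕ c) (toℕ<n i) (toℕ<n c) (ne ∘ toℕ≡1+r))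
      (λ c → ≡.subst (λ x → N x (toℕ c) ≈ k * M 0 (toℕ c) + M x (toℕ c)) (≡.sym (≡.cong suc (toℕ-fromℕ< r<n))) (added (toℕ c) (toℕ<n c)))
    where
    toℕ≡1+r : ∀ {i} → toℕ i ≡ suc r → i ≡ suc (fromℕ< r<n)
    toℕ≡1+r e = toℕ-injective (≡.trans e (≡.sym (≡.cong suc (toℕ-fromℕ< r<n))))

  -- Performed one row at a time: after the first r steps, rows 1, …, r have been modified.
  detℕ-addMultiplesOfRow₀ : ∀ n (M N : Matrixℕ) (k : ℕ → R)
    → (∀ j → j ℕ.< suc n → N 0 j ≈ M 0 j)
    → (∀ i j → i ℕ.< n → j ℕ.< suc n → N (suc i) j ≈ M (suc i) j + k i * M 0 j)
    → detℕ (suc n) N ≈ detℕ (suc n) M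
  detℕ-addMultiplesOfRow₀ n M N k top rest = trans (detℕ-cong (suc n) N (after n) all-done) (steps n)
    where
    after : ℕ → Matrixℕ
    after r zero    j = M 0 j
    after r (suc i) j = if i <ᵇ r then M (suc i) j + k i * M 0 j else M (suc i) j
    all-done : ∀ i j → i ℕ.< suc n → j ℕ.< suc n → N i j ≈ after n i j
    all-done zero    j _           j< = top j j<
    all-done (suc i) j (ℕ.s≤s i<n) j< rewrite <ᵇ-true i<n = rest i j i<n j<
    steps : ∀ r → detℕ (suc n) (after r) ≈ detℕ (suc n) M
    steps zero = detℕ-cong (suc n) (after 0) M λ { zero j _ _ → refl ; (suc i) j _ _ → refl }
    steps (suc r) with r ℕ.<? n
    ... | yes r<n = trans (detℕ-addMultipleOfRow₀ n r r<n (k r) (after r) (after (suc r)) same added) (steps r)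
      where
      same : ∀ i j → i ℕ.< suc n → j ℕ.< suc n → i ≢ suc r → after (suc r) i j ≈ after r i j
      same zero    j _ _ _  = refl
      same (suc i) j _ _ ne rewrite <ᵇ-suc (ne ∘ ≡.cong suc) = refl
      added : ∀ j → j ℕ.< suc n → after (suc r) (suc r) j ≈ k r * after r 0 j + after r (suc r) j
      added j _ rewrite <ᵇ-false (ℕ.≤-refl {r}) | <ᵇ-true (ℕ.n<1+n r) = +-comm _ _
    ... | no r≮n = trans (detℕ-cong (suc n) (after (suc r)) (after r) unchanged) (steps r)
      where
      unchanged : ∀ i j → i ℕ.< suc n → j ℕ.< suc n → after (suc r) i j ≈ after r i j
      unchanged zero    j _           _ = refl
      unchanged (suc i) j (ℕ.s≤s i<n) _
        rewrite <ᵇ-true (ℕ.m<n⇒m<1+n (ℕ.<-≤-trans i<n (ℕ.≮⇒≥ r≮n))) | <ᵇ-true (ℕ.<-≤-trans i<n (ℕ.≮⇒≥ r≮n)) = refl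

  ∑-splitAt : ∀ p q (f : Fin (p ℕ.+ q) → R) → ∑ f ≈ ∑ (λ i → f (i ↑ˡ q)) + ∑ (λ i → f (p ↑ʳ i))
  ∑-splitAt zero    q f = trans (solve 1 (λ x → x := con (+ 0) :+ x) refl _) (+-cong (sym (∑-zero _)) refl)
  ∑-splitAt (suc p) q f = trans (∑-suc f) (trans (+-cong refl (∑-splitAt p q (f ∘ suc)))
    (trans (sym (+-assoc _ _ _)) (+-cong (sym (∑-suc _)) refl)))

  shift : ℕ → Matrixℕ → Matrixℕ
  shift m M i j = M (m ℕ.+ i) (m ℕ.+ j)

  detℕ-blockTriangular : ∀ m a (M : Matrixℕ) → (∀ i j → i ℕ.< m → m ℕ.≤ j → j ℕ.< m ℕ.+ a → M i j ≈ 0#)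
    → detℕ (m ℕ.+ a) M ≈ detℕ m M * detℕ a (shift m M)
  detℕ-blockTriangular zero    a M zeros = sym (*-identityˡ _)
  detℕ-blockTriangular (suc m) a M zeros = begin
    detℕ (suc m ℕ.+ a) M
      ≈⟨ trans (detℕ-expand (m ℕ.+ a) M) (∑-splitAt (suc m) a _) ⟩
    ∑ (λ j → term (j ↑ˡ a)) + ∑ (λ i → term (suc m ↑ʳ i))
      ≈⟨ trans (+-cong refl (∑-vanishing _ right-columns-vanish)) (+-identityʳ _) ⟩
    ∑ (λ j → term (j ↑ˡ a))
      ≈⟨ ∑-cong left-columns ⟩
    ∑ (λ j → sign j * (M 0 (toℕ j) * detℕ m (minorℕ (toℕ j) M)) * detℕ a (shift (suc m) M))
      ≈⟨ trans (*-comm _ _) (trans (∑-*ˡ _ _) (∑-cong λ _ → *-comm _ _)) ⟨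
    (∑ λ j → sign j * (M 0 (toℕ j) * detℕ m (minorℕ (toℕ j) M))) * detℕ a (shift (suc m) M)
      ≈⟨ *-cong (detℕ-expand m M) refl ⟨
    detℕ (suc m) M * detℕ a (shift (suc m) M) ∎
    where
    open ≈-Reasoning setoid
    term : Fin (suc m ℕ.+ a) → R
    term j = sign j * (M 0 (toℕ j) * detℕ (m ℕ.+ a) (minorℕ (toℕ j) M))
    right-columns-vanish : ∀ i → term (suc m ↑ʳ i) ≈ 0#
    right-columns-vanish i = trans (*-cong refl (*-cong
      (trans (reflexive (≡.cong (M 0) (toℕ-↑ʳ (suc m) i)))
             (zeros 0 (suc m ℕ.+ toℕ i) (ℕ.s≤s ℕ.z≤n) (ℕ.s≤s (ℕ.m≤m+n m (toℕ i))) (ℕ.+-monoʳ-< (suc m) (toℕ<n i)))) refl))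
      (trans (*-cong refl (zeroˡ _)) (zeroʳ _))
    minor-blockTriangular : ∀ (j : Fin (suc m)) → detℕ (m ℕ.+ a) (minorℕ (toℕ j) M) ≈ detℕ m (minorℕ (toℕ j) M) * detℕ a (shift (suc m) M)
    minor-blockTriangular j = trans
      (detℕ-blockTriangular m a (minorℕ (toℕ j) M) λ i c i<m m≤c c< →
        trans (reflexive (≡.cong (M (suc i)) (punchInℕ-≥ (ℕ.≤-trans (ℕ.≤-pred (toℕ<n j)) m≤c))))
              (zeros (suc i) (suc c) (ℕ.s≤s i<m) (ℕ.s≤s m≤c) (ℕ.s≤s c<)))
      (*-cong refl (detℕ-cong a _ _ λ r c _ _ →
        reflexive (≡.cong (M (suc (m ℕ.+ r))) (punchInℕ-≥ (ℕ.≤-trans (ℕ.≤-pred (toℕ<n j)) (ℕ.m≤m+n m c))))))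
    left-columns : ∀ j → term (j ↑ˡ a) ≈ sign j * (M 0 (toℕ j) * detℕ m (minorℕ (toℕ j) M)) * detℕ a (shift (suc m) M)
    left-columns j = trans
      (*-cong (trans (sign≈signℕ (j ↑ˡ a)) (trans (reflexive (≡.cong signℕ (toℕ-↑ˡ j a))) (sym (sign≈signℕ j))))
        (*-cong (reflexive (≡.cong (M 0) (toℕ-↑ˡ j a)))
          (trans (detℕ-cong (m ℕ.+ a) _ _ λ r c _ _ → reflexive (≡.cong (λ z → minorℕ z M r c) (toℕ-↑ˡ j a)))
                 (minor-blockTriangular j))))
      (solve 4 (λ s x d e → s :* (x :* (d :* e)) := (s :* (x :* d)) :* e) refl _ _ _ _)

  -- The first k columns are supported on the first k - 1 rows, so they are linearly dependent.
  detℕ-deficientColumns : ∀ n k → 1 ℕ.≤ k → k ℕ.≤ n → (M : Matrixℕ)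
    → (∀ i j → i ℕ.< n → j ℕ.< k → k ℕ.≤ suc i → M i j ≈ 0#) → detℕ n M ≈ 0#
  detℕ-deficientColumns zero    (suc k) _   ()    M zeros
  detℕ-deficientColumns (suc n) k 1≤k k≤1+n M zeros = trans (detℕ-expand n M) (∑-vanishing _ term)
    where
    term : ∀ (j : Fin (suc n)) → sign j * (M 0 (toℕ j) * detℕ n (minorℕ (toℕ j) M)) ≈ 0#
    term j with toℕ j ℕ.<? k
    ... | no j≮k = trans (*-cong refl (*-cong refl
          (detℕ-deficientColumns n k 1≤k (ℕ.≤-trans (ℕ.≮⇒≥ j≮k) (ℕ.≤-pred (toℕ<n j))) (minorℕ (toℕ j) M) λ i c i<n c<k k≤1+i →
            trans (reflexive (≡.cong (M (suc i)) (punchInℕ-< (ℕ.<-≤-trans c<k (ℕ.≮⇒≥ j≮k)))))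
                  (zeros (suc i) c (ℕ.s≤s i<n) c<k (ℕ.m≤n⇒m≤1+n k≤1+i)))))
        (trans (*-cong refl (zeroʳ _)) (zeroʳ _))
    ... | yes j<k = smaller-k k 1≤k k≤1+n zeros j<k
      where
      smaller-k : ∀ k → 1 ℕ.≤ k → k ℕ.≤ suc n → (∀ i j → i ℕ.< suc n → j ℕ.< k → k ℕ.≤ suc i → M i j ≈ 0#)
        → toℕ j ℕ.< k → sign j * (M 0 (toℕ j) * detℕ n (minorℕ (toℕ j) M)) ≈ 0#
      smaller-k (suc zero) _ _ zeros j<1 =
        trans (*-cong refl (*-cong (zeros 0 (toℕ j) (ℕ.s≤s ℕ.z≤n) j<1 ℕ.≤-refl) refl)) (trans (*-cong refl (zeroˡ _)) (zeroʳ _))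
      smaller-k (suc (suc k)) _ 2+k≤1+n zeros j<2+k = trans (*-cong refl (*-cong refl
          (detℕ-deficientColumns n (suc k) (ℕ.s≤s ℕ.z≤n) (ℕ.≤-pred 2+k≤1+n) (minorℕ (toℕ j) M) λ i c i<n c<1+k 1+k≤1+i →
            zeros (suc i) (punchInℕ (toℕ j) c) (ℕ.s≤s i<n) (ℕ.≤-<-trans (punchInℕ-≤ (toℕ j) c) (ℕ.s≤s c<1+k)) (ℕ.s≤s 1+k≤1+i))))
        (trans (*-cong refl (zeroʳ _)) (zeroʳ _))

  addJ : R → Matrixℕ → Matrixℕ
  addJ t X i j = X i j + t

  subtractRow₀ : Matrixℕ → Matrixℕ
  subtractRow₀ X zero    j = X 0 j
  subtractRow₀ X (suc i) j = X (suc i) j - X 0 j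

  onesRow₀ : Matrixℕ → Matrixℕ
  onesRow₀ X zero    j = 1#
  onesRow₀ X (suc i) j = X (suc i) j - X 0 j

  detℕ-subtractRow₀ : ∀ n X → detℕ (suc n) (subtractRow₀ X) ≈ detℕ (suc n) X
  detℕ-subtractRow₀ n X = detℕ-addMultiplesOfRow₀ n X (subtractRow₀ X) (λ _ → - 1#) (λ j _ → refl)
    λ i j _ _ → solve 2 (λ x y → x :+ (:- y) := x :+ (:- con (+ 1)) :* y) refl (X (suc i) j) (X 0 j)

  subtractRow₀-addJ : ∀ t X i j → subtractRow₀ (addJ t X) (suc i) j ≈ subtractRow₀ X (suc i) j
  subtractRow₀-addJ t X i j = solve 3 (λ x y t → (x :+ t) :+ (:- (y :+ t)) := x :+ (:- y)) refl (X (suc i) j) (X 0 j) t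

  -- det (X + t J) is affine in t; its slope is the sum of all cofactors of X.
  cofactorSum : ℕ → Matrixℕ → R
  cofactorSum n X = detℕ n (addJ 1# X) - detℕ n X

  detℕ-addJ-suc : ∀ n t X → detℕ (suc n) (addJ t X) ≈ t * detℕ (suc n) (onesRow₀ X) + detℕ (suc n) X
  detℕ-addJ-suc n t X = trans (sym (detℕ-subtractRow₀ n (addJ t X)))
    (trans (detℕ-linear (suc n) 0 (ℕ.s≤s ℕ.z≤n) t (subtractRow₀ (addJ t X)) (onesRow₀ X) (subtractRow₀ X)
              (λ { zero j _ _ ne → ⊥-elim (ne ≡.refl) ; (suc i) j _ _ _ → subtractRow₀-addJ t X i j })
              (λ { zero j _ _ ne → ⊥-elim (ne ≡.refl) ; (suc i) j _ _ _ → subtractRow₀-addJ t X i j })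
              (λ j _ → solve 2 (λ x t → x :+ t := t :* con (+ 1) :+ x) refl (X 0 j) t))
       (+-cong refl (detℕ-subtractRow₀ n X)))

  cofactorSum-suc : ∀ n X → cofactorSum (suc n) X ≈ detℕ (suc n) (onesRow₀ X)
  cofactorSum-suc n X = trans (+-cong (detℕ-addJ-suc n 1# X) refl)
    (solve 2 (λ d x → (con (+ 1) :* d :+ x) :+ (:- x) := d) refl _ _)

  detℕ-addJ : ∀ n t X → detℕ n (addJ t X) ≈ detℕ n X + t * cofactorSum n X
  detℕ-addJ zero    t X = solve 1 (λ t → con (+ 1) := con (+ 1) :+ t :* (con (+ 1) :+ (:- con (+ 1)))) refl t
  detℕ-addJ (suc n) t X = trans (detℕ-addJ-suc n t X) (trans (+-comm _ _) (+-cong refl (*-cong refl (sym (cofactorSum-suc n X)))))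

  cofactorSum-addJ : ∀ n t X → cofactorSum n (addJ t X) ≈ cofactorSum n X
  cofactorSum-addJ zero    t X = refl
  cofactorSum-addJ (suc n) t X = trans (cofactorSum-suc n (addJ t X))
    (trans (detℕ-cong (suc n) (onesRow₀ (addJ t X)) (onesRow₀ X) λ { zero j _ _ → refl ; (suc i) j _ _ → subtractRow₀-addJ t X i j })
           (sym (cofactorSum-suc n X)))

  blockMatrix : ℕ → Matrixℕ → R → R → Matrixℕ → Matrixℕ
  blockMatrix m A s s′ C i j =
    if i <ᵇ m then (if j <ᵇ m then A i j else s) else (if j <ᵇ m then s′ else C (i ℕ.∸ m) (j ℕ.∸ m))

  -- Subtract the first row of each diagonal block from the other rows of that block and split the
  -- first row as s (0, 1) + (A₀, 0): the second summand is block triangular with determinant det A det C;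
  -- in the first, expanding the first row of the C-block as s′ (1, 0) + (0, C₀) leaves a block triangular
  -- matrix with determinant (cofactorSum A) (cofactorSum C) and a matrix whose first m columns have rank < m.
  module BlockMatrixDeterminant (m′ a′ : ℕ) (A C : Matrixℕ) (s s′ : R) where
    m : ℕ
    m = suc m′
    a : ℕ
    a = suc a′
    N : ℕ
    N = m ℕ.+ a
    X : Matrixℕ
    X = blockMatrix m A s s′ C

    ≈-1* : ∀ x y → x - y ≈ x + - 1# * y
    ≈-1* = solve 2 (λ x y → x :+ (:- y) := x :+ (:- con (+ 1)) :* y) refl
    0≈-1* : ∀ x → 0# ≈ x + - 1# * x
    0≈-1* = solve 1 (λ x → con (+ 0) := x :+ (:- con (+ 1)) :* x) refl
    ≈+0* : ∀ x y → x ≈ x + 0# * y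
    ≈+0* = solve 2 (λ x y → x := x :+ con (+ 0) :* y) refl
    ≈*0+ : ∀ x y → x ≈ y * 0# + x
    ≈*0+ = solve 2 (λ x y → x := y :* con (+ 0) :+ x) refl
    ≈*1+0 : ∀ y → y ≈ y * 1# + 0#
    ≈*1+0 = solve 1 (λ y → y := y :* con (+ 1) :+ con (+ 0)) refl

    leftRight : R → R → ℕ → R
    leftRight x y j = if j <ᵇ m then x else y
    A-difference : ℕ → ℕ → R
    A-difference i j = if j <ᵇ m then A i j - A 0 j else 0#
    A-row₀ : ℕ → R
    A-row₀ j = if j <ᵇ m then A 0 j else 0#
    C-row C-row′ C-difference : ℕ → ℕ → R
    C-row c j = if j <ᵇ m then s′ else C c (j ℕ.∸ m)
    C-row′ c j = if j <ᵇ m then 0# else C c (j ℕ.∸ m)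
    C-difference c j = if j <ᵇ m then 0# else C c (j ℕ.∸ m) - C 0 (j ℕ.∸ m)

    Y Z₀ Z₁ Z₁′ R₁ R₂ W₁ W₂ W₂′ : Matrixℕ
    Y zero    = X 0
    Y (suc i) = if i <ᵇ m′ then A-difference (suc i) else X (suc i)
    Z₀ zero    = A-row₀
    Z₀ (suc i) = Y (suc i)
    Z₁ zero    = leftRight 0# 1#
    Z₁ (suc i) = Y (suc i)
    Z₁′ i = if i <ᵇ m′ then A-difference (suc i) else (if i <ᵇ m then leftRight 0# 1# else C-row (i ℕ.∸ m))
    R₁ zero    = Z₁′ m
    R₁ (suc i) = Z₁′ (punchInℕ m i)
    R₂ zero    = C-row 0
    R₂ (suc i) = if i <ᵇ m′ then A-difference (suc i) else (if i <ᵇ m then leftRight 0# 1# else C-difference (suc i ℕ.∸ m))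
    W₁ zero    = leftRight 1# 0#
    W₁ (suc i) = R₂ (suc i)
    W₂ zero    = C-row′ 0
    W₂ (suc i) = R₂ (suc i)
    W₂′ i = if i <ᵇ m′ then A-difference (suc i) else (if i <ᵇ m then C-row′ 0 else R₂ i)

    m′<1+N : m′ ℕ.< suc (m′ ℕ.+ a)
    m′<1+N = ℕ.s≤s (ℕ.m≤m+n m′ a)

    m<1+N : m ℕ.< suc (m′ ℕ.+ a)
    m<1+N = ℕ.s≤s (≡.subst (suc m′ ℕ.≤_) (≡.sym (ℕ.+-suc m′ a′)) (ℕ.s≤s (ℕ.m≤m+n m′ a′)))

    Y≈X : detℕ N Y ≈ detℕ N X
    Y≈X = detℕ-addMultiplesOfRow₀ (m′ ℕ.+ a) X Y (λ i → if i <ᵇ m′ then - 1# else 0#) (λ j _ → refl) λ i j _ _ → row i j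
      where
      row : ∀ i j → Y (suc i) j ≈ X (suc i) j + (if i <ᵇ m′ then - 1# else 0#) * X 0 j
      row i j with i ℕ.<? m′
      row i j | yes i<m′ rewrite <ᵇ-true i<m′ with j ℕ.<? m
      ... | yes j<m rewrite <ᵇ-true j<m = ≈-1* _ _
      ... | no j≮m rewrite <ᵇ-false (ℕ.≮⇒≥ j≮m) = 0≈-1* s
      row i j | no i≮m′ rewrite <ᵇ-false (ℕ.≮⇒≥ i≮m′) = ≈+0* _ _

    Y≈sZ₁+Z₀ : detℕ N Y ≈ s * detℕ N Z₁ + detℕ N Z₀
    Y≈sZ₁+Z₀ = detℕ-linear N 0 (ℕ.s≤s ℕ.z≤n) s Y Z₁ Z₀
      (λ { zero j _ _ ne → ⊥-elim (ne ≡.refl) ; (suc i) j _ _ _ → refl })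
      (λ { zero j _ _ ne → ⊥-elim (ne ≡.refl) ; (suc i) j _ _ _ → refl })
      λ j _ → row j
      where
      row : ∀ j → Y 0 j ≈ s * Z₁ 0 j + Z₀ 0 j
      row j with j ℕ.<? m
      ... | yes j<m rewrite <ᵇ-true j<m = ≈*0+ _ _
      ... | no j≮m rewrite <ᵇ-false (ℕ.≮⇒≥ j≮m) = ≈*1+0 s

    Z₀≈A·C : detℕ N Z₀ ≈ detℕ m A * detℕ a C
    Z₀≈A·C = trans (detℕ-blockTriangular m a Z₀ upperRight)
      (*-cong (trans (detℕ-cong m Z₀ (subtractRow₀ A) upperLeft) (detℕ-subtractRow₀ m′ A))
              (detℕ-cong a (shift m Z₀) C λ i j _ _ → lowerRight i j))
      where
      upperRight : ∀ i j → i ℕ.< m → m ℕ.≤ j → j ℕ.< m ℕ.+ a → Z₀ i j ≈ 0#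
      upperRight zero    j _           m≤j _ rewrite <ᵇ-false m≤j = refl
      upperRight (suc i) j (ℕ.s≤s i<m′) m≤j _ rewrite <ᵇ-true i<m′ | <ᵇ-false m≤j = refl
      upperLeft : ∀ i j → i ℕ.< m → j ℕ.< m → Z₀ i j ≈ subtractRow₀ A i j
      upperLeft zero    j _           j<m rewrite <ᵇ-true j<m = refl
      upperLeft (suc i) j (ℕ.s≤s i<m′) j<m rewrite <ᵇ-true i<m′ | <ᵇ-true j<m = refl
      lowerRight : ∀ i j → shift m Z₀ i j ≈ C i j
      lowerRight i j rewrite <ᵇ-false (ℕ.m≤m+n m′ i) | <ᵇ-false (ℕ.m≤m+n m′ j) | ℕ.m+n∸m≡n m′ i | ℕ.m+n∸m≡n m′ j = refl

    Z₁≈±Z₁′ : detℕ N Z₁ ≈ signℕ m′ * detℕ N Z₁′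
    Z₁≈±Z₁′ = detℕ-moveToTop (m′ ℕ.+ a) m′ m′<1+N Z₁′ Z₁ (λ j _ → top j) λ i j _ _ → rest i j
      where
      top : ∀ j → Z₁ 0 j ≈ Z₁′ m′ j
      top j rewrite <ᵇ-false (ℕ.≤-refl {m′}) | <ᵇ-true (ℕ.n<1+n m′) = refl
      rest : ∀ i j → Z₁ (suc i) j ≈ Z₁′ (punchInℕ m′ i) j
      rest i j with i ℕ.<? m′
      ... | yes i<m′ rewrite punchInℕ-< i<m′ | <ᵇ-true i<m′ = refl
      ... | no i≮m′ rewrite punchInℕ-≥ (ℕ.≮⇒≥ i≮m′) | <ᵇ-false (ℕ.≮⇒≥ i≮m′)
                          | <ᵇ-false (ℕ.m≤n⇒m≤1+n (ℕ.≮⇒≥ i≮m′)) = refl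

    Z₁′≈±R₁ : detℕ N Z₁′ ≈ signℕ m * detℕ N R₁
    Z₁′≈±R₁ = sym (trans (*-cong refl (detℕ-moveToTop (m′ ℕ.+ a) m m<1+N Z₁′ R₁ (λ j _ → refl) λ i j _ _ → refl))
      (trans (sym (*-assoc _ _ _)) (trans (*-cong (signℕ²≈1 m) refl) (*-identityˡ _))))

    R₁-top : ∀ j → R₁ 0 j ≡ C-row 0 j
    R₁-top j rewrite <ᵇ-false (ℕ.n≤1+n m′) | <ᵇ-false (ℕ.≤-refl {m}) | ℕ.n∸n≡0 m = ≡.refl

    R₂≈R₁ : detℕ N R₂ ≈ detℕ N R₁
    R₂≈R₁ = detℕ-addMultiplesOfRow₀ (m′ ℕ.+ a) R₁ R₂ (λ i → if i <ᵇ m then 0# else - 1#)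
      (λ j _ → reflexive (≡.sym (R₁-top j))) λ i j _ _ → row i j
      where
      row : ∀ i j → R₂ (suc i) j ≈ R₁ (suc i) j + (if i <ᵇ m then 0# else - 1#) * R₁ 0 j
      row i j rewrite R₁-top j with i ℕ.<? m′
      ... | yes i<m′ rewrite punchInℕ-< (ℕ.m<n⇒m<1+n i<m′) | <ᵇ-true i<m′ | <ᵇ-true (ℕ.m<n⇒m<1+n i<m′) = ≈+0* _ _
      ... | no i≮m′ with i ℕ.<? m
      ...   | yes i<m rewrite punchInℕ-< i<m | <ᵇ-false (ℕ.≮⇒≥ i≮m′) | <ᵇ-true i<m = ≈+0* _ _
      ...   | no i≮m rewrite punchInℕ-≥ (ℕ.≮⇒≥ i≮m) | <ᵇ-false (ℕ.≮⇒≥ i≮m′) | <ᵇ-false (ℕ.≮⇒≥ i≮m)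
                         | <ᵇ-false (ℕ.m≤n⇒m≤1+n (ℕ.≮⇒≥ i≮m′)) with j ℕ.<? m
      ...     | yes j<m rewrite <ᵇ-true j<m = 0≈-1* s′
      ...     | no j≮m rewrite <ᵇ-false (ℕ.≮⇒≥ j≮m) = ≈-1* _ _

    R₂≈s′W₁+W₂ : detℕ N R₂ ≈ s′ * detℕ N W₁ + detℕ N W₂
    R₂≈s′W₁+W₂ = detℕ-linear N 0 (ℕ.s≤s ℕ.z≤n) s′ R₂ W₁ W₂
      (λ { zero j _ _ ne → ⊥-elim (ne ≡.refl) ; (suc i) j _ _ _ → refl })
      (λ { zero j _ _ ne → ⊥-elim (ne ≡.refl) ; (suc i) j _ _ _ → refl })
      λ j _ → row j
      where
      row : ∀ j → R₂ 0 j ≈ s′ * W₁ 0 j + W₂ 0 j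
      row j with j ℕ.<? m
      ... | yes j<m rewrite <ᵇ-true j<m = ≈*1+0 s′
      ... | no j≮m rewrite <ᵇ-false (ℕ.≮⇒≥ j≮m) = ≈*0+ _ _

    W₁≈TA·TC : detℕ N W₁ ≈ cofactorSum m A * cofactorSum a C
    W₁≈TA·TC = trans (detℕ-blockTriangular m a W₁ upperRight)
      (*-cong (trans (detℕ-cong m W₁ (onesRow₀ A) upperLeft) (sym (cofactorSum-suc m′ A)))
              (trans (detℕ-cong a (shift m W₁) (onesRow₀ C) λ i j _ _ → lowerRight i j) (sym (cofactorSum-suc a′ C))))
      where
      upperRight : ∀ i j → i ℕ.< m → m ℕ.≤ j → j ℕ.< m ℕ.+ a → W₁ i j ≈ 0#
      upperRight zero    j _           m≤j _ rewrite <ᵇ-false m≤j = refl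
      upperRight (suc i) j (ℕ.s≤s i<m′) m≤j _ rewrite <ᵇ-true i<m′ | <ᵇ-false m≤j = refl
      upperLeft : ∀ i j → i ℕ.< m → j ℕ.< m → W₁ i j ≈ onesRow₀ A i j
      upperLeft zero    j _           j<m rewrite <ᵇ-true j<m = refl
      upperLeft (suc i) j (ℕ.s≤s i<m′) j<m rewrite <ᵇ-true i<m′ | <ᵇ-true j<m = refl
      lowerRight : ∀ i j → shift m W₁ i j ≈ onesRow₀ C i j
      lowerRight zero j rewrite ℕ.+-identityʳ m′ | <ᵇ-false (ℕ.≤-refl {m′}) | <ᵇ-true (ℕ.n<1+n m′) | <ᵇ-false (ℕ.m≤m+n m′ j) = refl
      lowerRight (suc i) j
        rewrite <ᵇ-false (ℕ.m≤m+n m′ (suc i)) | <ᵇ-false (≡.subst (m ℕ.≤_) (≡.sym (ℕ.+-suc m′ i)) (ℕ.s≤s (ℕ.m≤m+n m′ i)))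
              | <ᵇ-false (ℕ.m≤m+n m′ j) | ℕ.m+n∸m≡n m′ j | ℕ.m+n∸m≡n m′ (suc i) = refl

    W₂≈0 : detℕ N W₂ ≈ 0#
    W₂≈0 = trans (detℕ-moveToTop (m′ ℕ.+ a) m′ m′<1+N W₂′ W₂ (λ j _ → top j) λ i j _ _ → rest i j)
      (trans (*-cong refl (detℕ-deficientColumns N m (ℕ.s≤s ℕ.z≤n) (ℕ.m≤m+n m a) W₂′ λ i j _ j<m m≤1+i → lowerLeft i j j<m m≤1+i))
             (zeroʳ _))
      where
      top : ∀ j → W₂ 0 j ≈ W₂′ m′ j
      top j rewrite <ᵇ-false (ℕ.≤-refl {m′}) | <ᵇ-true (ℕ.n<1+n m′) = refl
      rest : ∀ i j → W₂ (suc i) j ≈ W₂′ (punchInℕ m′ i) j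
      rest i j with i ℕ.<? m′
      ... | yes i<m′ rewrite punchInℕ-< i<m′ | <ᵇ-true i<m′ = refl
      ... | no i≮m′ rewrite punchInℕ-≥ (ℕ.≮⇒≥ i≮m′) | <ᵇ-false (ℕ.m≤n⇒m≤1+n (ℕ.≮⇒≥ i≮m′))
                          | <ᵇ-false (ℕ.≮⇒≥ i≮m′) = refl
      lowerLeft : ∀ i j → j ℕ.< m → m ℕ.≤ suc i → W₂′ i j ≈ 0#
      lowerLeft i j j<m (ℕ.s≤s m′≤i) rewrite <ᵇ-false m′≤i with i ℕ.<? m
      ... | yes i<m rewrite <ᵇ-true i<m | <ᵇ-true j<m = refl
      lowerLeft zero    j j<m (ℕ.s≤s m′≤i) | no i≮m = ⊥-elim (i≮m (ℕ.s≤s ℕ.z≤n))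
      lowerLeft (suc i) j j<m (ℕ.s≤s m′≤i) | no i≮m rewrite <ᵇ-false (ℕ.≮⇒≥ i≮m) with i ℕ.<? m
      ...   | yes i<m rewrite <ᵇ-true i<m | <ᵇ-true j<m = refl
      ...   | no i≮m′ rewrite <ᵇ-false (ℕ.≮⇒≥ i≮m′) | <ᵇ-true j<m = refl

    det-X : detℕ N X ≈ detℕ m A * detℕ a C - s * s′ * (cofactorSum m A * cofactorSum a C)
    det-X = begin
      detℕ N X
        ≈⟨ trans (sym Y≈X) Y≈sZ₁+Z₀ ⟩
      s * detℕ N Z₁ + detℕ N Z₀
        ≈⟨ +-cong (*-cong refl Z₁≈±Z₁′) Z₀≈A·C ⟩
      s * (signℕ m′ * detℕ N Z₁′) + detℕ m A * detℕ a C
        ≈⟨ +-cong (*-cong refl (*-cong refl Z₁′≈±R₁)) refl ⟩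
      s * (signℕ m′ * (- signℕ m′ * detℕ N R₁)) + detℕ m A * detℕ a C
        ≈⟨ +-cong (*-cong refl (*-cong refl (*-cong refl R₁≈s′TA·TC))) refl ⟩
      s * (signℕ m′ * (- signℕ m′ * (s′ * TA·TC + 0#))) + detℕ m A * detℕ a C
        ≈⟨ solve 5 (λ σ s s′ Q P → s :* (σ :* ((:- σ) :* (s′ :* Q :+ con (+ 0)))) :+ P := P :+ :- ((σ :* σ) :* (s :* s′ :* Q))) refl
                   (signℕ m′) s s′ TA·TC _ ⟩
      detℕ m A * detℕ a C - (signℕ m′ * signℕ m′) * (s * s′ * TA·TC)
        ≈⟨ +-cong refl (-‿cong (trans (*-cong (signℕ²≈1 m′) refl) (*-identityˡ _))) ⟩
      detℕ m A * detℕ a C - s * s′ * TA·TC ∎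
      where
      open ≈-Reasoning setoid
      TA·TC : R
      TA·TC = cofactorSum m A * cofactorSum a C
      R₁≈s′TA·TC : detℕ N R₁ ≈ s′ * TA·TC + 0#
      R₁≈s′TA·TC = trans (sym R₂≈R₁) (trans R₂≈s′W₁+W₂ (+-cong (*-cong refl W₁≈TA·TC) W₂≈0))

  detℕ-blockMatrix : ∀ m a′ (A C : Matrixℕ) (s s′ : R) →
    detℕ (m ℕ.+ suc a′) (blockMatrix m A s s′ C) ≈ detℕ m A * detℕ (suc a′) C - s * s′ * (cofactorSum m A * cofactorSum (suc a′) C)
  detℕ-blockMatrix zero     a′ A C s s′ =
    solve 4 (λ s s′ d t → d := con (+ 1) :* d :+ :- (s :* s′ :* ((con (+ 1) :+ (:- con (+ 1))) :* t))) refl s s′ _ _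
  detℕ-blockMatrix (suc m′) a′ A C s s′ = BlockMatrixDeterminant.det-X m′ a′ A C s s′

  cofactorSum-blockMatrix : ∀ m a′ (A C : Matrixℕ) (s s′ : R) →
    cofactorSum (m ℕ.+ suc a′) (blockMatrix m A s s′ C)
      ≈ detℕ m A * cofactorSum (suc a′) C + cofactorSum m A * detℕ (suc a′) C - (s + s′) * (cofactorSum m A * cofactorSum (suc a′) C)
  cofactorSum-blockMatrix m a′ A C s s′ =
    trans (+-cong (trans (detℕ-cong (m ℕ.+ suc a′) _ _ λ i j _ _ → addJ-blockMatrix i j)
                  (trans (detℕ-blockMatrix m a′ (addJ 1# A) (addJ 1# C) (s + 1#) (s′ + 1#))
                         (+-cong (*-cong (detℕ-addJ m 1# A) (detℕ-addJ (suc a′) 1# C))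
                                 (-‿cong (*-cong refl (*-cong (cofactorSum-addJ m 1# A) (cofactorSum-addJ (suc a′) 1# C)))))))
                  (-‿cong (detℕ-blockMatrix m a′ A C s s′)))
          (solve 6 (λ DA TA DC TC s s′ →
              ((DA :+ con (+ 1) :* TA) :* (DC :+ con (+ 1) :* TC) :+ :- ((s :+ con (+ 1)) :* (s′ :+ con (+ 1)) :* (TA :* TC)))
                :+ :- (DA :* DC :+ :- (s :* s′ :* (TA :* TC)))
              := DA :* TC :+ TA :* DC :+ :- ((s :+ s′) :* (TA :* TC))) refl _ _ _ _ s s′)
    where
    addJ-blockMatrix : ∀ i j → addJ 1# (blockMatrix m A s s′ C) i j ≈ blockMatrix m (addJ 1# A) (s + 1#) (s′ + 1#) (addJ 1# C) i j
    addJ-blockMatrix i j with i <ᵇ m | j <ᵇ m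
    ... | true  | true  = refl
    ... | true  | false = refl
    ... | false | true  = refl
    ... | false | false = refl

  infixr 8 _^_
  _^_ : R → ℕ → R
  x ^ zero  = 1#
  x ^ suc n = x * x ^ n

  ^-+ : ∀ y m n → y ^ (m ℕ.+ n) ≈ y ^ m * y ^ n
  ^-+ y zero    n = sym (*-identityˡ _)
  ^-+ y (suc m) n = trans (*-cong refl (^-+ y m n)) (sym (*-assoc _ _ _))

  fromℕ : ℕ → R
  fromℕ zero    = 0#
  fromℕ (suc n) = 1# + fromℕ n

  scalarPlusJ : R → R → Matrixℕ
  scalarPlusJ c d i j = (if i ≡ᵇ j then c else 0#) + d

  detℕ-1 : ∀ (A : Matrixℕ) → detℕ 1 A ≈ A 0 0
  detℕ-1 A = trans (∑-suc _) (trans (+-cong refl (∑-zero _))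
    (solve 1 (λ x → con (+ 1) :* (x :* con (+ 1)) :+ con (+ 0) := x) refl _))

  private
    constant : R → Matrixℕ
    constant x _ _ = x

    cofactorSum-1 : ∀ x → cofactorSum 1 (constant x) ≈ 1#
    cofactorSum-1 x = trans (+-cong (detℕ-1 (addJ 1# (constant x))) (-‿cong (detℕ-1 (constant x))))
      (solve 1 (λ x → (x :+ con (+ 1)) :+ :- x := con (+ 1)) refl x)

    scalarPlusJ-split : ∀ c d a′ i j → i ℕ.< suc (suc a′) → j ℕ.< suc (suc a′) →
      scalarPlusJ c d i j ≈ blockMatrix 1 (constant (c + d)) d d (scalarPlusJ c d) i j
    scalarPlusJ-split c d a′ zero    zero    _ _ = refl
    scalarPlusJ-split c d a′ zero    (suc j) _ _ = solve 1 (λ d → con (+ 0) :+ d := d) refl d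
    scalarPlusJ-split c d a′ (suc i) zero    _ _ = solve 1 (λ d → con (+ 0) :+ d := d) refl d
    scalarPlusJ-split c d a′ (suc i) (suc j) _ _ = refl

  detℕ-scalarPlusJ : ∀ c d a′ → detℕ (suc a′) (scalarPlusJ c d) ≈ c ^ a′ * (c + fromℕ (suc a′) * d)
  cofactorSum-scalarPlusJ : ∀ c d a′ → cofactorSum (suc a′) (scalarPlusJ c d) ≈ fromℕ (suc a′) * c ^ a′

  detℕ-scalarPlusJ c d zero = trans (detℕ-1 (scalarPlusJ c d))
    (solve 2 (λ c d → c :+ d := con (+ 1) :* (c :+ (con (+ 1) :+ con (+ 0)) :* d)) refl c d)
  detℕ-scalarPlusJ c d (suc a′) =
    trans (detℕ-cong (suc (suc a′)) _ _ (scalarPlusJ-split c d a′))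
      (trans (detℕ-blockMatrix 1 a′ (constant (c + d)) (scalarPlusJ c d) d d)
        (trans (+-cong (*-cong (detℕ-1 (constant (c + d))) (detℕ-scalarPlusJ c d a′))
                       (-‿cong (*-cong refl (*-cong (cofactorSum-1 (c + d)) (cofactorSum-scalarPlusJ c d a′)))))
          (solve 4 (λ c d p n → (c :+ d) :* (p :* (c :+ n :* d)) :+ :- (d :* d :* (con (+ 1) :* (n :* p)))
                    := (c :* p) :* (c :+ (con (+ 1) :+ n) :* d)) refl c d (c ^ a′) (fromℕ (suc a′)))))

  cofactorSum-scalarPlusJ c d zero =
    trans (+-cong (detℕ-1 (addJ 1# (scalarPlusJ c d))) (-‿cong (detℕ-1 (scalarPlusJ c d))))
      (solve 2 (λ c d → (c :+ d :+ con (+ 1)) :+ :- (c :+ d) := (con (+ 1) :+ con (+ 0)) :* con (+ 1)) refl c d)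
  cofactorSum-scalarPlusJ c d (suc a′) =
    trans (+-cong (detℕ-cong (suc (suc a′)) (addJ 1# (scalarPlusJ c d)) (addJ 1# B) λ i j i< j< → +-cong (scalarPlusJ-split c d a′ i j i< j<) refl)
                  (-‿cong (detℕ-cong (suc (suc a′)) (scalarPlusJ c d) B (scalarPlusJ-split c d a′))))
      (trans (cofactorSum-blockMatrix 1 a′ (constant (c + d)) (scalarPlusJ c d) d d)
        (trans (+-cong (+-cong (*-cong (detℕ-1 (constant (c + d))) (cofactorSum-scalarPlusJ c d a′))
                               (*-cong (cofactorSum-1 (c + d)) (detℕ-scalarPlusJ c d a′)))
                       (-‿cong (*-cong refl (*-cong (cofactorSum-1 (c + d)) (cofactorSum-scalarPlusJ c d a′)))))
          (solve 4 (λ c d p n → (c :+ d) :* (n :* p) :+ con (+ 1) :* (p :* (c :+ n :* d)) :+ :- ((d :+ d) :* (con (+ 1) :* (n :* p)))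
                    := (con (+ 1) :+ n) :* (c :* p)) refl c d (c ^ a′) (fromℕ (suc a′)))))
    where
    B : Matrixℕ
    B = blockMatrix 1 (constant (c + d)) d d (scalarPlusJ c d)

module PolynomialDeterminant where

  open import Defs using (Poly; scaleᴾ; _*ᴾ_; _^ᴾ_; sumᴾ; isEven)
  import Defs
  open import Data.Bool using (true; false; not; if_then_else_)
  open import Data.Fin using (Fin; zero; suc; toℕ; punchIn)
  open import Data.Integer using (ℤ; +_; -_)
  open import Data.List using ([]; _∷_; tabulate)
  open import Data.List.Properties using (map-tabulate)
  open import Data.Nat using (zero; suc)
  open import Function using (_∘_)
  open import Relation.Binary.PropositionalEquality as ≡ using (_≡_)

  open PolynomialRing
  open Determinant +-*-commutativeRing constant public

  ^≡^ᴾ : ∀ p n → p ^ n ≡ p ^ᴾ n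
  ^≡^ᴾ p zero    = ≡.refl
  ^≡^ᴾ p (suc n) = ≡.cong (p *ᴾ_) (^≡^ᴾ p n)

  sumᴾ-tabulate : ∀ m (f : Fin m → Poly) → sumᴾ (tabulate f) ≋ ∑ f
  sumᴾ-tabulate zero    f = ≋-sym (≋-trans (∑-zero f) 0∷0ᴾ)
  sumᴾ-tabulate (suc m) f = ≋-trans (+-cong ≋-refl (sumᴾ-tabulate m (f ∘ suc))) (≋-sym (∑-suc f))

  signℤ : ∀ {n} → Fin n → ℤ
  signℤ j = if isEven (toℕ j) then + 1 else - + 1

  signℤ≋sign : ∀ {n} (j : Fin n) → (signℤ j ∷ []) ≋ sign j
  signℤ≋sign zero    = ≋-refl
  signℤ≋sign (suc j) = ≋-trans (flip (isEven (toℕ j))) (scale-cong (- + 1) (signℤ≋sign j))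
    where
    flip : ∀ b → ((if not b then + 1 else - + 1) ∷ []) ≋ scaleᴾ (- + 1) ((if b then + 1 else - + 1) ∷ [])
    flip true  = ≋-refl
    flip false = ≋-refl

  det-agrees : ∀ n (M : Fin n → Fin n → Poly) → Defs.det n M ≋ det n M
  det-agrees zero    M = ≋-refl
  det-agrees (suc n) M =
    ≋-trans (≋-reflexive (≡.cong sumᴾ (map-tabulate (λ j → j) term)))
      (≋-trans (sumᴾ-tabulate (suc n) term) (∑-cong λ j →
        ≋-trans (scale-as-product (signℤ j) _)
          (*-cong (signℤ≋sign j) (*-cong (≋-refl {M zero j}) (det-agrees n (minor j M))))))
    where
    term : Fin (suc n) → Poly
    term j = scaleᴾ (signℤ j) (M zero j *ᴾ Defs.det n λ r c → M (suc r) (punchIn j c))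
    scale-as-product : ∀ c p → scaleᴾ c p ≋ ((c ∷ []) *ᴾ p)
    scale-as-product c p = ≋-sym (≋-trans (+-cong (≋-refl {scaleᴾ c p}) 0∷0ᴾ) (+-identityʳ (scaleᴾ c p)))

module CographDistances where

  open import Defs
  open import Data.Bool using (Bool; true; false; not; _∧_; if_then_else_)
  import Data.Bool.Properties as Bool
  open import Data.Bool.ListAction using (any)
  open import Data.Empty using (⊥; ⊥-elim)
  open import Data.Fin using (Fin; zero; suc; toℕ; fromℕ<; splitAt; _≟_)
  open import Data.Fin.Properties using (toℕ<n; toℕ-injective; toℕ-fromℕ<)
  open import Data.List using (tabulate; foldr)
  open import Data.Nat as ℕ using (ℕ; zero; suc; _+_; _*_; _∸_; _⊔_; _≡ᵇ_; _<ᵇ_; _≤_; _<_; z≤n; s≤s)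
  import Data.Nat.Properties as ℕ
  open import Data.Product using (Σ; _×_; _,_; proj₁; proj₂)
  open import Data.Sum using (_⊎_; inj₁; inj₂)
  open import Function using (_∘_)
  open import Relation.Nullary using (yes; no)
  open import Relation.Nullary.Decidable using (⌊_⌋)
  open import Relation.Binary.PropositionalEquality as ≡ using (_≡_; _≢_; refl; sym; trans; cong)

  open BooleanComparison

  data SplitView (m : ℕ) {n : ℕ} (i : Fin (m + n)) : Fin m ⊎ Fin n → Set where
    left  : ∀ x → toℕ i ≡ toℕ x → toℕ x < m → SplitView m i (inj₁ x)
    right : ∀ y → toℕ i ≡ m + toℕ y → SplitView m i (inj₂ y)

  splitView : ∀ m {n} (i : Fin (m + n)) → SplitView m i (splitAt m i)
  splitView zero    i       = right i refl
  splitView (suc m) zero    = left zero refl (s≤s z≤n)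
  splitView (suc m) (suc i) with splitAt m i | splitView m i
  ... | inj₁ x | left .x e x<m = left (suc x) (cong suc e) (s≤s x<m)
  ... | inj₂ y | right .y e    = right y (cong suc e)

  ⌊≟⌋≡≡ᵇ : ∀ {n} (u v : Fin n) → ⌊ u ≟ v ⌋ ≡ (toℕ u ≡ᵇ toℕ v)
  ⌊≟⌋≡≡ᵇ u v with u ≟ v
  ... | yes refl = sym (≡ᵇ-true (toℕ u))
  ... | no u≢v   = sym (≡ᵇ-false (u≢v ∘ toℕ-injective))

  isEven-+ : ∀ a b → isEven (a + b) ≡ (if isEven a then isEven b else not (isEven b))
  isEven-+ zero    b = refl
  isEven-+ (suc a) b rewrite isEven-+ a b with isEven a
  ... | true  = refl
  ... | false = Bool.not-involutive _

  isEven-2* : ∀ k → isEven (2 * k) ≡ true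
  isEven-2* k rewrite ℕ.+-identityʳ k | isEven-+ k k with isEven k
  ... | true  = refl
  ... | false = refl

  isEven-∸ : ∀ m i → i ≤ m → isEven m ≡ true → isEven (m ∸ i) ≡ isEven i
  isEven-∸ m i i≤m even-m with isEven-+ (m ∸ i) i
  ... | e rewrite ℕ.m∸n+n≡m i≤m | even-m with isEven (m ∸ i) | isEven i
  ...   | true  | true  = refl
  ...   | false | false = refl
  ...   | true  | false = ⊥-elim (Bool.not-¬ refl e)
  ...   | false | true  = ⊥-elim (Bool.not-¬ refl e)

  module Blocks (α : ℕ → ℕ) where

    blockOf : ℕ → ℕ → ℕ
    blockOf zero    p = 0
    blockOf (suc l) p = if p <ᵇ nv α l then blockOf l p else suc l

    blockOf≤ : ∀ l p → blockOf l p ≤ l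
    blockOf≤ zero    p = z≤n
    blockOf≤ (suc l) p with p <ᵇ nv α l
    ... | true  = ℕ.m≤n⇒m≤1+n (blockOf≤ l p)
    ... | false = ℕ.≤-refl

    -- C(α₁, …, α_l) complements C(α₁, …, α_{l-1}) ∪ K_{α_l}, so every step flips all earlier adjacencies:
    -- vertices of blocks i < j are adjacent iff l - j is even, distinct vertices of block i iff l - i is odd.
    adjacentBlocks : ℕ → ℕ → ℕ → Bool
    adjacentBlocks l i j = if i ≡ᵇ j then not (isEven (l ∸ i)) else isEven (l ∸ (i ⊔ j))

    adjacentBlocks-suc : ∀ l i j → i ≤ l → j ≤ l → adjacentBlocks (suc l) i j ≡ not (adjacentBlocks l i j)
    adjacentBlocks-suc l i j i≤l j≤l with i ≡ᵇ j
    ... | true  rewrite ℕ.+-∸-assoc 1 i≤l = refl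
    ... | false rewrite ℕ.+-∸-assoc 1 (ℕ.⊔-lub i≤l j≤l) = refl

    adjacentBlocks-newˡ : ∀ l i → i ≤ l → adjacentBlocks (suc l) i (suc l) ≡ true
    adjacentBlocks-newˡ l i i≤l
      rewrite ≡ᵇ-false (ℕ.<⇒≢ (s≤s i≤l)) | ℕ.m≤n⇒m⊔n≡n (ℕ.m≤n⇒m≤1+n i≤l) | ℕ.n∸n≡0 l = refl

    adjacentBlocks-newʳ : ∀ l j → j ≤ l → adjacentBlocks (suc l) (suc l) j ≡ true
    adjacentBlocks-newʳ l j j≤l
      rewrite ≡ᵇ-false (ℕ.>⇒≢ (s≤s j≤l)) | ℕ.m≥n⇒m⊔n≡m (ℕ.m≤n⇒m≤1+n j≤l) | ℕ.n∸n≡0 l = refl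

    adjacentBlocks-new : ∀ l → adjacentBlocks (suc l) (suc l) (suc l) ≡ false
    adjacentBlocks-new l rewrite ≡ᵇ-true l | ℕ.n∸n≡0 l = refl

    CG-adjacency : ∀ l (u v : Fin (nv α l)) →
      CG α l u v ≡ (not (toℕ u ≡ᵇ toℕ v) ∧ adjacentBlocks l (blockOf l (toℕ u)) (blockOf l (toℕ v)))
    CG-adjacency (suc l) u v rewrite ⌊≟⌋≡≡ᵇ u v
      with splitAt (nv α l) u | splitView (nv α l) u | splitAt (nv α l) v | splitView (nv α l) v
    ... | inj₁ x | left .x ex x<n | inj₁ y | left .y ey y<n
      rewrite ex | ey | <ᵇ-true x<n | <ᵇ-true y<n | CG-adjacency l x y
            | adjacentBlocks-suc l (blockOf l (toℕ x)) (blockOf l (toℕ y)) (blockOf≤ l (toℕ x)) (blockOf≤ l (toℕ y))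
      = absorb (not (toℕ x ≡ᵇ toℕ y)) (adjacentBlocks l (blockOf l (toℕ x)) (blockOf l (toℕ y)))
      where
      absorb : ∀ c p → (c ∧ not (c ∧ p)) ≡ (c ∧ not p)
      absorb true  p = refl
      absorb false p = refl
    ... | inj₁ x | left .x ex x<n | inj₂ y | right .y ey
      rewrite ex | ey | <ᵇ-true x<n | <ᵇ-false (ℕ.m≤m+n (nv α l) (toℕ y)) | adjacentBlocks-newˡ l (blockOf l (toℕ x)) (blockOf≤ l (toℕ x))
      = refl
    ... | inj₂ x | right .x ex | inj₁ y | left .y ey y<n
      rewrite ex | ey | <ᵇ-true y<n | <ᵇ-false (ℕ.m≤m+n (nv α l) (toℕ x)) | adjacentBlocks-newʳ l (blockOf l (toℕ y)) (blockOf≤ l (toℕ y))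
      = refl
    ... | inj₂ x | right .x ex | inj₂ y | right .y ey
      rewrite ex | ey | <ᵇ-false (ℕ.m≤m+n (nv α l) (toℕ x)) | <ᵇ-false (ℕ.m≤m+n (nv α l) (toℕ y))
            | ⌊≟⌋≡≡ᵇ x y | ≡ᵇ-+-cancelˡ (nv α l) (toℕ x) (toℕ y) | adjacentBlocks-new l
      = contradiction-free (toℕ x ≡ᵇ toℕ y)
      where
      contradiction-free : ∀ c → (not c ∧ not (not c)) ≡ (not c ∧ false)
      contradiction-free true  = refl
      contradiction-free false = refl

  any-tabulate-true : ∀ {A : Set} {n} (p : A → Bool) (f : Fin n → A) w → p (f w) ≡ true → any p (tabulate f) ≡ true
  any-tabulate-true p f zero    e rewrite e = refl
  any-tabulate-true p f (suc w) e rewrite any-tabulate-true p (f ∘ suc) w e = Bool.∨-zeroʳ (p (f zero))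

  any-tabulate-false : ∀ {A : Set} {n} (p : A → Bool) (f : Fin n → A) → (∀ w → p (f w) ≡ false) → any p (tabulate f) ≡ false
  any-tabulate-false {n = zero}  p f h = refl
  any-tabulate-false {n = suc n} p f h rewrite h zero = any-tabulate-false p (f ∘ suc) (h ∘ suc)

  foldr-⊔-≤ : ∀ {m n} (h : Fin n → ℕ) (f : Fin m → Fin n) b → (∀ w → h w ≤ b) → foldr (λ v m → h v ⊔ m) 0 (tabulate f) ≤ b
  foldr-⊔-≤ {zero}  h f b h≤b = z≤n
  foldr-⊔-≤ {suc m} h f b h≤b = ℕ.⊔-lub (h≤b (f zero)) (foldr-⊔-≤ h (f ∘ suc) b h≤b)

  ≤-foldr-⊔ : ∀ {m n} (h : Fin n → ℕ) (f : Fin m → Fin n) w → h (f w) ≤ foldr (λ v m → h v ⊔ m) 0 (tabulate f)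
  ≤-foldr-⊔ h f zero    = ℕ.m≤m⊔n _ _
  ≤-foldr-⊔ h f (suc w) = ℕ.≤-trans (≤-foldr-⊔ h (f ∘ suc) w) (ℕ.m≤n⊔m _ _)

  module Distance {N : ℕ} (G : Graph N) where

    ≟-refl : ∀ (u : Fin N) → ⌊ u ≟ u ⌋ ≡ true
    ≟-refl u rewrite ⌊≟⌋≡≡ᵇ u u = ≡ᵇ-true (toℕ u)

    ≟-≢ : ∀ {u v : Fin N} → u ≢ v → ⌊ u ≟ v ⌋ ≡ false
    ≟-≢ {u} {v} u≢v rewrite ⌊≟⌋≡≡ᵇ u v = ≡ᵇ-false (u≢v ∘ toℕ-injective)

    reach-1-edge : ∀ u v → G u v ≡ true → reach G 1 u v ≡ true
    reach-1-edge u v e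
      rewrite any-tabulate-true (λ w → G u w ∧ reach G 0 w v) (λ w → w) v (≡.subst (λ b → (b ∧ ⌊ v ≟ v ⌋) ≡ true) (sym e) (≟-refl v))
      = Bool.∨-zeroʳ _

    reach-1-non-edge : ∀ u v → u ≢ v → G u v ≡ false → reach G 1 u v ≡ false
    reach-1-non-edge u v u≢v e rewrite ≟-≢ u≢v = any-tabulate-false _ (λ w → w) only-v
      where
      only-v : ∀ w → (G u w ∧ ⌊ w ≟ v ⌋) ≡ false
      only-v w with w ≟ v
      ... | yes refl rewrite e = refl
      ... | no _     = Bool.∧-zeroʳ _

    reach-2-path : ∀ u v w → G u w ≡ true → G w v ≡ true → reach G 2 u v ≡ true
    reach-2-path u v w uw wv
      rewrite any-tabulate-true (λ w′ → G u w′ ∧ reach G 1 w′ v) (λ w → w) w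
                (≡.subst (λ b → (b ∧ reach G 1 w v) ≡ true) (sym uw) (reach-1-edge w v wv))
      = Bool.∨-zeroʳ _

    dist-self : ∀ u → dist G u u ≡ 0
    dist-self u = search-self N
      where
      search-self : ∀ M → search G u u 0 M ≡ 0
      search-self zero    = refl
      search-self (suc M) rewrite ≟-refl u = refl

    dist-edge : ∀ u v → u ≢ v → G u v ≡ true → dist G u v ≡ 1
    dist-edge u v u≢v e = search-edge N refl
      where
      search-edge : ∀ M → M ≡ N → search G u v 0 M ≡ 1
      search-edge zero          M≡N = ⊥-elim (Fin0 (≡.subst Fin (sym M≡N) u))
        where Fin0 : Fin 0 → ⊥
              Fin0 ()
      search-edge (suc zero)    _   rewrite ≟-≢ u≢v = refl
      search-edge (suc (suc M)) _   rewrite reach-1-edge u v e | ≟-≢ u≢v = refl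

    dist-path : ∀ u v w → u ≢ v → G u v ≡ false → G u w ≡ true → G w v ≡ true → dist G u v ≡ 2
    dist-path u v w u≢v uv uw wv = search-path N refl
      where
      search-path : ∀ M → M ≡ N → search G u v 0 M ≡ 2
      search-path zero                M≡N = ⊥-elim (u≢v (toℕ-injective (trans (only-vertex M≡N u) (sym (only-vertex M≡N v)))))
        where only-vertex : 0 ≡ N → ∀ (x : Fin N) → toℕ x ≡ 0
              only-vertex 0≡N x = ⊥-elim (ℕ.n≮0 (≡.subst (toℕ x <_) (sym 0≡N) (toℕ<n x)))
      search-path (suc zero)          M≡N = ⊥-elim (u≢v (toℕ-injective (trans (only-vertex u) (sym (only-vertex v)))))
        where only-vertex : ∀ (x : Fin N) → toℕ x ≡ 0
              only-vertex x = ℕ.n<1⇒n≡0 (≡.subst (toℕ x <_) (sym M≡N) (toℕ<n x))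
      search-path (suc (suc zero))    _ rewrite reach-1-non-edge u v u≢v uv | ≟-≢ u≢v = refl
      search-path (suc (suc (suc M))) _ rewrite reach-2-path u v w uw wv | reach-1-non-edge u v u≢v uv | ≟-≢ u≢v = refl

    ecc-attained : ∀ u w b → (∀ v → dist G u v ≤ b) → dist G u w ≡ b → ecc G u ≡ b
    ecc-attained u w b ≤b e = ℕ.≤-antisym (foldr-⊔-≤ (dist G u) (λ x → x) b ≤b) (≡.subst (_≤ _) e (≤-foldr-⊔ (dist G u) (λ x → x) w))

  farBlocks : ℕ → ℕ → Bool
  farBlocks i j = if i ≡ᵇ j then isEven i else not (isEven (i ⊔ j))

  farBlocks-even-suc : ∀ i → isEven i ≡ true → farBlocks i (suc i) ≡ true
  farBlocks-even-suc i even-i rewrite ≡ᵇ-false (ℕ.<⇒≢ (ℕ.n<1+n i)) | ℕ.m≤n⇒m⊔n≡n (ℕ.n≤1+n i) | even-i = refl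

  farBlocks-odd-1 : ∀ i → i ≢ 1 → 1 ≤ i → isEven i ≡ false → farBlocks i 1 ≡ true
  farBlocks-odd-1 i i≢1 1≤i odd-i rewrite ≡ᵇ-false i≢1 | ℕ.m≥n⇒m⊔n≡m 1≤i | odd-i = refl

  module EvenCograph (α : ℕ → ℕ) (k : ℕ) (2≤k : 2 ≤ k)
                     (α-positive : ∀ i → 1 ≤ i → i ≤ 2 * k → 1 ≤ α i) (2≤αL : 2 ≤ α (2 * k)) where
    open Blocks α

    L : ℕ
    L = 2 * k
    n : ℕ
    n = nv α L
    G : Graph n
    G = CG α L

    block : Fin n → ℕ
    block u = blockOf L (toℕ u)

    block≤L : ∀ u → block u ≤ L
    block≤L u = blockOf≤ L (toℕ u)

    4≤L : 4 ≤ L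
    4≤L = ℕ.*-monoʳ-≤ 2 2≤k

    1≤L : 1 ≤ L
    1≤L = ℕ.≤-trans (s≤s z≤n) 4≤L

    adjacentBlocks≡not-far : ∀ i j → i ≤ L → j ≤ L → adjacentBlocks L i j ≡ not (farBlocks i j)
    adjacentBlocks≡not-far i j i≤L j≤L with i ≡ᵇ j
    ... | true  rewrite isEven-∸ L i i≤L (isEven-2* k) = refl
    ... | false rewrite isEven-∸ L (i ⊔ j) (ℕ.⊔-lub i≤L j≤L) (isEven-2* k) = sym (Bool.not-involutive _)

    adjacency : ∀ u v → G u v ≡ (not (toℕ u ≡ᵇ toℕ v) ∧ not (farBlocks (block u) (block v)))
    adjacency u v rewrite CG-adjacency L u v | adjacentBlocks≡not-far (block u) (block v) (block≤L u) (block≤L v) = refl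

    nv-mono : ∀ {a c} → a ≤ c → nv α a ≤ nv α c
    nv-mono {a} {zero}  z≤n = z≤n
    nv-mono {a} {suc c} a≤1+c with ℕ.m≤n⇒m<n∨m≡n a≤1+c
    ... | inj₁ (s≤s a≤c) = ℕ.≤-trans (nv-mono a≤c) (ℕ.m≤m+n _ _)
    ... | inj₂ refl      = ℕ.≤-refl

    blockOf-vertex : ∀ l j t → suc j ≤ l → t < α (suc j) → blockOf l (nv α j + t) ≡ suc j
    blockOf-vertex (suc l) j t (s≤s j≤l) t<α with ℕ.m≤n⇒m<n∨m≡n j≤l
    ... | inj₂ refl rewrite <ᵇ-false (ℕ.m≤m+n (nv α j) t) = refl
    ... | inj₁ j<l  rewrite <ᵇ-true (ℕ.<-≤-trans (ℕ.+-monoʳ-< (nv α j) t<α) (nv-mono j<l)) = blockOf-vertex l j t j<l t<α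

    1≤blockOf : ∀ l p → p < nv α l → 1 ≤ blockOf l p
    1≤blockOf (suc l) p p<n with p ℕ.<? nv α l
    ... | yes p<n′ rewrite <ᵇ-true p<n′ = 1≤blockOf l p p<n′
    ... | no p≮n′  rewrite <ᵇ-false (ℕ.≮⇒≥ p≮n′) = s≤s z≤n

    1≤block : ∀ u → 1 ≤ block u
    1≤block u = 1≤blockOf L (toℕ u) (toℕ<n u)

    vertexIn : ∀ j t → 1 ≤ j → j ≤ L → t < α j → Σ (Fin n) λ w → (block w ≡ j) × (toℕ w ≡ nv α (j ∸ 1) + t)
    vertexIn (suc j) t _ 1+j≤L t<α = w , block-w , toℕ-fromℕ< _
      where
      w : Fin n
      w = fromℕ< (ℕ.<-≤-trans (ℕ.+-monoʳ-< (nv α j) t<α) (nv-mono 1+j≤L))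
      block-w : block w ≡ suc j
      block-w rewrite toℕ-fromℕ< (ℕ.<-≤-trans (ℕ.+-monoʳ-< (nv α j) t<α) (nv-mono 1+j≤L)) = blockOf-vertex L j t 1+j≤L t<α

    firstVertexIn : ∀ j → 1 ≤ j → j ≤ L → Σ (Fin n) λ w → block w ≡ j
    firstVertexIn j 1≤j j≤L with vertexIn j 0 1≤j j≤L (α-positive j 1≤j j≤L)
    ... | w , block-w , _ = w , block-w

    distinct-blocks : ∀ u v → block u ≢ block v → toℕ u ≢ toℕ v
    distinct-blocks u v ne e = ne (cong (blockOf L) e)

    adjacent : ∀ u v → block u ≢ block v → farBlocks (block u) (block v) ≡ false → G u v ≡ true
    adjacent u v ne far rewrite adjacency u v | ≡ᵇ-false (distinct-blocks u v ne) | far = refl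

    -- The last block L is even, so it is joined to every other block.
    farBlocks-last : ∀ i → i ≢ L → i ≤ L → (farBlocks i L ≡ false) × (farBlocks L i ≡ false)
    farBlocks-last i i≢L i≤L rewrite ≡ᵇ-false i≢L | ≡ᵇ-false (i≢L ∘ sym) | ℕ.m≤n⇒m⊔n≡n i≤L | ℕ.m≥n⇒m⊔n≡m i≤L | isEven-2* k
      = refl , refl

    adjacent-to-last : ∀ x y → block x ≢ L → block y ≡ L → G x y ≡ true
    adjacent-to-last x y x≢L y≡L = adjacent x y (λ e → x≢L (trans e y≡L))
      (≡.subst (λ z → farBlocks (block x) z ≡ false) (sym y≡L) (proj₁ (farBlocks-last (block x) x≢L (block≤L x))))

    adjacent-from-last : ∀ x y → block x ≡ L → block y ≢ L → G x y ≡ true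
    adjacent-from-last x y x≡L y≢L = adjacent x y (λ e → y≢L (trans (sym e) x≡L))
      (≡.subst (λ z → farBlocks z (block y) ≡ false) (sym x≡L) (proj₂ (farBlocks-last (block y) y≢L (block≤L y))))

    -- Non-adjacent vertices have a common neighbour: in block L - 1 if both lie in block L, in block L otherwise.
    common-neighbour : ∀ u v → farBlocks (block u) (block v) ≡ true → Σ (Fin n) λ w → (G u w ≡ true) × (G w v ≡ true)
    common-neighbour u v far with block u ℕ.≟ L | block v ℕ.≟ L
    ... | yes u≡L | no v≢L = ⊥-elim (Bool.not-¬ refl (trans (sym far)
          (≡.subst (λ z → farBlocks z (block v) ≡ false) (sym u≡L) (proj₂ (farBlocks-last (block v) v≢L (block≤L v))))))
    ... | no u≢L | yes v≡L = ⊥-elim (Bool.not-¬ refl (trans (sym far)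
          (≡.subst (λ z → farBlocks (block u) z ≡ false) (sym v≡L) (proj₁ (farBlocks-last (block u) u≢L (block≤L u))))))
    ... | yes u≡L | yes v≡L with firstVertexIn (L ∸ 1) (ℕ.≤-trans (s≤s z≤n) (ℕ.∸-monoˡ-≤ 1 4≤L)) (ℕ.m∸n≤m L 1)
    ...   | w , w∈L-1 = w , adjacent-from-last u w u≡L w≢L , adjacent-to-last w v w≢L v≡L
      where
      w≢L : block w ≢ L
      w≢L e = ℕ.<-irrefl (trans (sym w∈L-1) e) (ℕ.∸-monoʳ-< {o = 0} (s≤s z≤n) 1≤L)
    common-neighbour u v far | no u≢L | no v≢L with firstVertexIn L 1≤L ℕ.≤-refl
    ... | w , w∈L = w , adjacent-to-last u w u≢L w∈L , adjacent-from-last w v w∈L v≢L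

    far-in : ∀ {u} j → 1 ≤ j → j ≤ L → block u ≢ j → farBlocks (block u) j ≡ true →
      Σ (Fin n) λ v → (toℕ u ≢ toℕ v) × (farBlocks (block u) (block v) ≡ true)
    far-in {u} j 1≤j j≤L u∉j far with firstVertexIn j 1≤j j≤L
    ... | w , w∈j = w , distinct-blocks u w (λ e → u∉j (trans e w∈j)) , ≡.subst (λ i → farBlocks (block u) i ≡ true) (sym w∈j) far

    far-vertex : ∀ u → Σ (Fin n) λ v → (toℕ u ≢ toℕ v) × (farBlocks (block u) (block v) ≡ true)
    far-vertex u with block u ℕ.≟ L
    ... | yes u≡L = last-block
      where
      far-in-last : ∀ w → block w ≡ L → farBlocks (block u) (block w) ≡ true
      far-in-last w w≡L rewrite u≡L | w≡L | ≡ᵇ-true L = isEven-2* k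
      -- Block L has at least two vertices, so one of its first two differs from u.
      last-block : Σ (Fin n) λ v → (toℕ u ≢ toℕ v) × (farBlocks (block u) (block v) ≡ true)
      last-block with vertexIn L 0 1≤L ℕ.≤-refl (ℕ.≤-trans (s≤s z≤n) 2≤αL) | vertexIn L 1 1≤L ℕ.≤-refl 2≤αL
      ... | w₀ , w₀∈L , toℕ-w₀ | w₁ , w₁∈L , toℕ-w₁ with toℕ u ℕ.≟ toℕ w₀
      ...   | no u≢w₀  = w₀ , u≢w₀ , far-in-last w₀ w₀∈L
      ...   | yes u≡w₀ = w₁ , (λ u≡w₁ → 0≢1 (ℕ.+-cancelˡ-≡ (nv α (L ∸ 1)) 0 1
                                   (trans (sym toℕ-w₀) (trans (trans (sym u≡w₀) u≡w₁) toℕ-w₁))))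
                            , far-in-last w₁ w₁∈L
        where
        0≢1 : 0 ≢ 1
        0≢1 ()
    ... | no u≢L = below-last (isEven (block u)) refl
      where
      below-last : ∀ b → isEven (block u) ≡ b → Σ (Fin n) λ v → (toℕ u ≢ toℕ v) × (farBlocks (block u) (block v) ≡ true)
      below-last true even = far-in (suc (block u)) (s≤s z≤n) (ℕ.≤∧≢⇒< (block≤L u) u≢L) (ℕ.<⇒≢ (ℕ.n<1+n (block u)))
                               (farBlocks-even-suc (block u) even)
      below-last false odd with block u ℕ.≟ 1
      ... | no u≢1  = far-in 1 (s≤s z≤n) 1≤L u≢1 (farBlocks-odd-1 (block u) u≢1 (1≤block u) odd)
      ... | yes u≡1 = far-in 3 (s≤s z≤n) (ℕ.≤-trans (s≤s (s≤s (s≤s z≤n))) 4≤L) (λ e → 1≢3 (trans (sym u≡1) e))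
                        (≡.subst (λ i → farBlocks i 3 ≡ true) (sym u≡1) refl)
        where
        1≢3 : 1 ≢ 3
        1≢3 ()

    dist-formula : ∀ u v → dist G u v ≡ (if toℕ u ≡ᵇ toℕ v then 0 else (if farBlocks (block u) (block v) then 2 else 1))
    dist-formula u v with toℕ u ℕ.≟ toℕ v
    ... | yes u≡v rewrite toℕ-injective u≡v | ≡ᵇ-true (toℕ v) = Distance.dist-self G v
    ... | no u≢v rewrite ≡ᵇ-false u≢v with farBlocks (block u) (block v) in far
    ...   | true with common-neighbour u v far
    ...     | w , uw , wv = Distance.dist-path G u v w (u≢v ∘ cong toℕ) non-edge uw wv
      where
      non-edge : G u v ≡ false
      non-edge rewrite adjacency u v | ≡ᵇ-false u≢v | far = refl
    dist-formula u v | no u≢v | false = Distance.dist-edge G u v (u≢v ∘ cong toℕ) edge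
      where
      edge : G u v ≡ true
      edge rewrite adjacency u v | ≡ᵇ-false u≢v | far = refl

    ecc≡2 : ∀ u → ecc G u ≡ 2
    ecc≡2 u with far-vertex u
    ... | v , u≢v , far = Distance.ecc-attained G u v 2 dist≤2 dist≡2
      where
      dist≤2 : ∀ v → dist G u v ≤ 2
      dist≤2 v rewrite dist-formula u v with toℕ u ≡ᵇ toℕ v | farBlocks (block u) (block v)
      ... | true  | _     = z≤n
      ... | false | true  = ℕ.≤-refl
      ... | false | false = s≤s z≤n
      dist≡2 : dist G u v ≡ 2
      dist≡2 rewrite dist-formula u v | ≡ᵇ-false u≢v | far = refl

    eccMatrix-formula : ∀ u v → eccMatrix G u v ≡ (if toℕ u ≡ᵇ toℕ v then 0 else (if farBlocks (block u) (block v) then 2 else 0))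
    eccMatrix-formula u v rewrite ecc≡2 u | ecc≡2 v | dist-formula u v with toℕ u ≡ᵇ toℕ v | farBlocks (block u) (block v)
    ... | true  | _     = refl
    ... | false | true  = refl
    ... | false | false = refl

module CharacteristicPolynomial where

  open import Defs
  open import Data.Bool using (Bool; true; false; not; if_then_else_)
  open import Data.Integer using (ℤ; +_; -_)
  open import Data.List using ([]; _∷_)
  open import Data.Nat as ℕ using (ℕ; zero; suc; _∸_; _≡ᵇ_; _≤_; s≤s; z≤n)
  import Data.Nat.Properties as ℕ
  open import Data.Product using (_×_; _,_; proj₁; proj₂)
  open import Relation.Nullary using (yes; no)
  open import Relation.Binary.PropositionalEquality as ≡ using (_≡_; refl; sym; cong)

  open BooleanComparison
  open PolynomialRing
  open PolynomialDeterminant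
  open CographDistances using (farBlocks; module Blocks)

  x : Poly
  x = + 0 ∷ + 1 ∷ []

  const : ℤ → Poly
  const c = c ∷ []

  -- In G = C(α₁, …, α_{2k}) distinct vertices of block i are at distance 2 iff i is even, and block i is
  -- at distance 2 from all earlier blocks iff i is odd. So in xI - ε(G) block i is (diagonal e) I + (inside e) J
  -- and meets the earlier blocks in (across e) J, where e is the parity of i; charMatrix l below is the
  -- leading submatrix on the first l blocks.
  weight : Bool → ℕ
  weight e = if e then 2 else 0

  diagonal inside across : Bool → Poly
  diagonal e = x +ᴾ const (+ weight e)
  inside   e = const (- + weight e)
  across   e = const (- + weight (not e))

  module Blockwise (α : ℕ → ℕ) where
    open Blocks α

    charMatrix : ℕ → Matrixℕ
    charMatrix l p q = if p ≡ᵇ q then x else const (- + weight (farBlocks (blockOf l p) (blockOf l q)))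

    charMatrix-suc : ∀ l p q → let e = isEven (suc l) in
      charMatrix (suc l) p q ≋ blockMatrix (nv α l) (charMatrix l) (across e) (across e) (scalarPlusJ (diagonal e) (inside e)) p q
    charMatrix-suc l p q with p ℕ.<? nv α l | q ℕ.<? nv α l
    ... | yes p<n | yes q<n rewrite <ᵇ-true p<n | <ᵇ-true q<n = ≋-refl
    ... | yes p<n | no q≮n rewrite <ᵇ-true p<n | <ᵇ-false (ℕ.≮⇒≥ q≮n)
                                 | ≡ᵇ-false (ℕ.<⇒≢ (ℕ.<-≤-trans p<n (ℕ.≮⇒≥ q≮n)))
                                 | ≡ᵇ-false (ℕ.<⇒≢ (s≤s (blockOf≤ l p)))
                                 | ℕ.m≤n⇒m⊔n≡n (ℕ.m≤n⇒m≤1+n (blockOf≤ l p)) = ≋-refl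
    ... | no p≮n | yes q<n rewrite <ᵇ-false (ℕ.≮⇒≥ p≮n) | <ᵇ-true q<n
                                 | ≡ᵇ-false (ℕ.>⇒≢ (ℕ.<-≤-trans q<n (ℕ.≮⇒≥ p≮n)))
                                 | ≡ᵇ-false (ℕ.>⇒≢ (s≤s (blockOf≤ l q)))
                                 | ℕ.m≥n⇒m⊔n≡m (ℕ.m≤n⇒m≤1+n (blockOf≤ l q)) = ≋-refl
    ... | no p≮n | no q≮n rewrite <ᵇ-false (ℕ.≮⇒≥ p≮n) | <ᵇ-false (ℕ.≮⇒≥ q≮n) | ≡ᵇ-true (suc l)
                                | ≡ᵇ-∸ (nv α l) (ℕ.≮⇒≥ p≮n) (ℕ.≮⇒≥ q≮n)
      = diagonal-entry (isEven (suc l)) ((p ∸ nv α l) ≡ᵇ (q ∸ nv α l))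
      where
      diagonal-entry : ∀ e b → (if b then x else const (- + weight e)) ≋ ((if b then diagonal e else 0#) +ᴾ inside e)
      diagonal-entry true  true  = ≋-refl
      diagonal-entry true  false = ≋-refl
      diagonal-entry false true  = ≋-refl
      diagonal-entry false false = ≋-refl

    D T : ℕ → Poly
    D l = detℕ (nv α l) (charMatrix l)
    T l = cofactorSum (nv α l) (charMatrix l)

  blockFactor : Bool → ℕ → Poly
  blockFactor e a = diagonal e +ᴾ (fromℕ a *ᴾ inside e)

  nextD nextT : Bool → ℕ → Poly → Poly → Poly
  nextD e a d t = (d *ᴾ blockFactor e a) +ᴾ (-ᴾ ((across e *ᴾ across e) *ᴾ (t *ᴾ fromℕ a)))
  nextT e a d t = ((d *ᴾ fromℕ a) +ᴾ (t *ᴾ blockFactor e a)) +ᴾ (-ᴾ ((across e +ᴾ across e) *ᴾ (t *ᴾ fromℕ a)))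

  nextD-cong : ∀ e a {d d′ t t′} → d ≋ d′ → t ≋ t′ → nextD e a d t ≋ nextD e a d′ t′
  nextD-cong e a d≋d′ t≋t′ = +-cong (*-cong d≋d′ (≋-refl {blockFactor e a}))
    (scale-cong (- + 1) (*-cong (≋-refl {across e *ᴾ across e}) (*-cong t≋t′ (≋-refl {fromℕ a}))))

  nextT-cong : ∀ e a {d d′ t t′} → d ≋ d′ → t ≋ t′ → nextT e a d t ≋ nextT e a d′ t′
  nextT-cong e a d≋d′ t≋t′ =
    +-cong (+-cong (*-cong d≋d′ (≋-refl {fromℕ a})) (*-cong t≋t′ (≋-refl {blockFactor e a})))
      (scale-cong (- + 1) (*-cong (≋-refl {across e +ᴾ across e}) (*-cong t≋t′ (≋-refl {fromℕ a}))))

  nextD-homogeneous : ∀ e a f d t → nextD e a (f *ᴾ d) (f *ᴾ t) ≋ f *ᴾ nextD e a d t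
  nextD-homogeneous e a f d t =
    solve 6 (λ f d t g s n → ((f :* d) :* g) :+ :- ((s :* s) :* ((f :* t) :* n)) := f :* ((d :* g) :+ :- ((s :* s) :* (t :* n))))
      ≋-refl f d t (blockFactor e a) (across e) (fromℕ a)

  nextT-homogeneous : ∀ e a f d t → nextT e a (f *ᴾ d) (f *ᴾ t) ≋ f *ᴾ nextT e a d t
  nextT-homogeneous e a f d t =
    solve 6 (λ f d t g s n → (((f :* d) :* n) :+ ((f :* t) :* g)) :+ :- ((s :+ s) :* ((f :* t) :* n))
                             := f :* (((d :* n) :+ (t :* g)) :+ :- ((s :+ s) :* (t :* n))))
      ≋-refl f d t (blockFactor e a) (across e) (fromℕ a)

  module Recurrence (α : ℕ → ℕ) where
    open Blocks α
    open Blockwise α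

    D-T-suc : ∀ l a′ → α (suc l) ≡ suc a′ → let e = isEven (suc l) in
      (D (suc l) ≋ (diagonal e ^ a′) *ᴾ nextD e (suc a′) (D l) (T l)) × (T (suc l) ≋ (diagonal e ^ a′) *ᴾ nextT e (suc a′) (D l) (T l))
    D-T-suc l a′ αl≡1+a′ =
      ≋-trans (≋-reflexive (cong (λ z → detℕ (nv α l ℕ.+ z) (charMatrix (suc l))) αl≡1+a′))
        (≋-trans (detℕ-cong (nv α l ℕ.+ suc a′) (charMatrix (suc l)) B λ p q _ _ → charMatrix-suc l p q)
        (≋-trans (detℕ-blockMatrix (nv α l) a′ (charMatrix l) C s s)
        (≋-trans (+-cong (*-cong (≋-refl {D l}) (detℕ-scalarPlusJ c (inside e) a′))
                         (scale-cong (- + 1) (*-cong (≋-refl {s *ᴾ s}) (*-cong (≋-refl {T l}) (cofactorSum-scalarPlusJ c (inside e) a′)))))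
          (solve 6 (λ D T F g s n → (D :* (F :* g)) :+ :- ((s :* s) :* (T :* (n :* F))) := F :* ((D :* g) :+ :- ((s :* s) :* (T :* n))))
             ≋-refl (D l) (T l) (c ^ a′) (blockFactor e (suc a′)) s (fromℕ (suc a′))))))
      ,
      ≋-trans (≋-reflexive (cong (λ z → cofactorSum (nv α l ℕ.+ z) (charMatrix (suc l))) αl≡1+a′))
        (≋-trans (+-cong (detℕ-cong (nv α l ℕ.+ suc a′) (addJ 1# (charMatrix (suc l))) (addJ 1# B) λ p q _ _ → +-cong (charMatrix-suc l p q) ≋-refl)
                         (scale-cong (- + 1) (detℕ-cong (nv α l ℕ.+ suc a′) (charMatrix (suc l)) B λ p q _ _ → charMatrix-suc l p q)))
        (≋-trans (cofactorSum-blockMatrix (nv α l) a′ (charMatrix l) C s s)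
        (≋-trans (+-cong (+-cong (*-cong (≋-refl {D l}) (cofactorSum-scalarPlusJ c (inside e) a′))
                                 (*-cong (≋-refl {T l}) (detℕ-scalarPlusJ c (inside e) a′)))
                         (scale-cong (- + 1) (*-cong (≋-refl {s +ᴾ s}) (*-cong (≋-refl {T l}) (cofactorSum-scalarPlusJ c (inside e) a′)))))
          (solve 6 (λ D T F g s n → ((D :* (n :* F)) :+ (T :* (F :* g))) :+ :- ((s :+ s) :* (T :* (n :* F)))
                                    := F :* (((D :* n) :+ (T :* g)) :+ :- ((s :+ s) :* (T :* n))))
             ≋-refl (D l) (T l) (c ^ a′) (blockFactor e (suc a′)) s (fromℕ (suc a′))))))
      where
      e : Bool
      e = isEven (suc l)
      c : Poly
      c = diagonal e
      s : Poly
      s = across e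
      C : Matrixℕ
      C = scalarPlusJ c (inside e)
      B : Matrixℕ
      B = blockMatrix (nv α l) (charMatrix l) s s C

  n≡1+[n∸1] : ∀ {n} → 1 ≤ n → n ≡ suc (n ∸ 1)
  n≡1+[n∸1] {suc n} _ = refl

  Pair : Set
  Pair = Poly × Poly

  step : Bool → ℕ → Pair → Pair
  step e a (d , t) = nextD e a d t , nextT e a d t

  -- iterate α l₀ p j applies to p the steps of the blocks l₀ + 1, …, l₀ + j.
  iterate : (ℕ → ℕ) → ℕ → Pair → ℕ → Pair
  iterate α l₀ p zero    = p
  iterate α l₀ p (suc j) = step (isEven (suc (l₀ ℕ.+ j))) (α (suc (l₀ ℕ.+ j))) (iterate α l₀ p j)

  prefactor : (ℕ → ℕ) → ℕ → Poly
  prefactor α zero    = 1#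
  prefactor α (suc l) = prefactor α l *ᴾ (diagonal (isEven (suc l)) ^ (α (suc l) ∸ 1))

  module Factorisation (α : ℕ → ℕ) where
    open Blockwise α
    open Recurrence α

    D-T-factor : ∀ l → (∀ i → 1 ≤ i → i ≤ l → 1 ≤ α i) →
      (D l ≋ prefactor α l *ᴾ proj₁ (iterate α 0 (1# , 0#) l)) × (T l ≋ prefactor α l *ᴾ proj₂ (iterate α 0 (1# , 0#) l))
    D-T-factor zero    _       = solve 0 (con (+ 1) := con (+ 1) :* con (+ 1)) ≋-refl
                               , solve 0 (con (+ 1) :+ :- con (+ 1) := con (+ 1) :* con (+ 0)) ≋-refl
    D-T-factor (suc l) α-positive =
      ≋-trans (proj₁ (D-T-suc l a′ α≡1+a′))
        (≋-trans (*-cong (≋-refl {c ^ a′}) (≋-trans (nextD-cong e (suc a′) D≋ T≋) (nextD-homogeneous e (suc a′) F d t)))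
        (≋-trans (regroup (nextD e (suc a′) d t)) (≋-reflexive (cong (λ z → (F *ᴾ (c ^ a′)) *ᴾ nextD e z d t) (sym α≡1+a′)))))
      , ≋-trans (proj₂ (D-T-suc l a′ α≡1+a′))
        (≋-trans (*-cong (≋-refl {c ^ a′}) (≋-trans (nextT-cong e (suc a′) D≋ T≋) (nextT-homogeneous e (suc a′) F d t)))
        (≋-trans (regroup (nextT e (suc a′) d t)) (≋-reflexive (cong (λ z → (F *ᴾ (c ^ a′)) *ᴾ nextT e z d t) (sym α≡1+a′)))))
      where
      e : Bool
      e = isEven (suc l)
      c : Poly
      c = diagonal e
      a′ : ℕ
      a′ = α (suc l) ∸ 1
      α≡1+a′ : α (suc l) ≡ suc a′
      α≡1+a′ = n≡1+[n∸1] (α-positive (suc l) (s≤s z≤n) ℕ.≤-refl)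
      F : Poly
      F = prefactor α l
      d : Poly
      d = proj₁ (iterate α 0 (1# , 0#) l)
      t : Poly
      t = proj₂ (iterate α 0 (1# , 0#) l)
      IH : (D l ≋ F *ᴾ d) × (T l ≋ F *ᴾ t)
      IH = D-T-factor l λ i 1≤i i≤l → α-positive i 1≤i (ℕ.m≤n⇒m≤1+n i≤l)
      D≋ : D l ≋ F *ᴾ d
      D≋ = proj₁ IH
      T≋ : T l ≋ F *ᴾ t
      T≋ = proj₂ IH
      regroup : ∀ y → (c ^ a′) *ᴾ (F *ᴾ y) ≋ (F *ᴾ (c ^ a′)) *ᴾ y
      regroup = solve 3 (λ c F y → c :* (F :* y) := (F :* c) :* y) ≋-refl (c ^ a′) F

  infix 4 _≋²_
  _≋²_ : Pair → Pair → Set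
  (d , t) ≋² (d′ , t′) = (d ≋ d′) × (t ≋ t′)

  iterate-+ : ∀ α p j → iterate α 0 p (2 ℕ.+ j) ≡ iterate α 2 (iterate α 0 p 2) j
  iterate-+ α p zero    = refl
  iterate-+ α p (suc j) = cong (step (isEven (suc (2 ℕ.+ j))) (α (suc (2 ℕ.+ j)))) (iterate-+ α p j)

  iterate-cong : ∀ α l₀ {p q} j → p ≋² q → iterate α l₀ p j ≋² iterate α l₀ q j
  iterate-cong α l₀ zero    p≋q = p≋q
  iterate-cong α l₀ (suc j) p≋q with iterate-cong α l₀ j p≋q
  ... | d≋ , t≋ = nextD-cong e a d≋ t≋ , nextT-cong e a d≋ t≋
    where
    e : Bool
    e = isEven (suc (l₀ ℕ.+ j))
    a : ℕ
    a = α (suc (l₀ ℕ.+ j))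

  iterate-homogeneous : ∀ α l₀ f d t j →
    iterate α l₀ (f *ᴾ d , f *ᴾ t) j ≋² (f *ᴾ proj₁ (iterate α l₀ (d , t) j) , f *ᴾ proj₂ (iterate α l₀ (d , t) j))
  iterate-homogeneous α l₀ f d t zero    = ≋-refl , ≋-refl
  iterate-homogeneous α l₀ f d t (suc j) with iterate-homogeneous α l₀ f d t j
  ... | d≋ , t≋ = ≋-trans (nextD-cong e a d≋ t≋) (nextD-homogeneous e a f _ _) , ≋-trans (nextT-cong e a d≋ t≋) (nextT-homogeneous e a f _ _)
    where
    e : Bool
    e = isEven (suc (l₀ ℕ.+ j))
    a : ℕ
    a = α (suc (l₀ ℕ.+ j))

  -- With α₂ = 1 the second block is a single vertex, and both polynomials acquire a factor x.
  firstTwoBlocks-α₂≡1 : ∀ α → α 2 ≡ 1 → iterate α 0 (1# , 0#) 2 ≋² (x *ᴾ x , x *ᴾ (1# +ᴾ fromℕ (α 1)))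
  firstTwoBlocks-α₂≡1 α α₂≡1 =
    ≋-trans (≋-reflexive (cong (λ z → nextD true z d₁ t₁) α₂≡1)) second-d ,
    ≋-trans (≋-reflexive (cong (λ z → nextT true z d₁ t₁) α₂≡1)) second-t
    where
    a : ℕ
    a = α 1
    d₁ : Poly
    d₁ = nextD false a 1# 0#
    t₁ : Poly
    t₁ = nextT false a 1# 0#
    first-d : d₁ ≋ x
    first-d = solve 3 (λ X n s → con (+ 1) :* (X :+ n :* con (+ 0)) :+ :- ((s :* s) :* (con (+ 0) :* n)) := X)
      ≋-refl (diagonal false) (fromℕ a) (across false)
    first-t : t₁ ≋ fromℕ a
    first-t = solve 3 (λ X n s → ((con (+ 1) :* n) :+ (con (+ 0) :* (X :+ n :* con (+ 0)))) :+ :- ((s :+ s) :* (con (+ 0) :* n)) := n)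
      ≋-refl (diagonal false) (fromℕ a) (across false)
    second-d : nextD true 1 d₁ t₁ ≋ x *ᴾ x
    second-d = ≋-trans (solve 3 (λ d t g → (d :* g) :+ :- ((con (+ 0) :* con (+ 0)) :* (t :* (con (+ 1) :+ con (+ 0)))) := d :* g)
                                 ≋-refl d₁ t₁ (blockFactor true 1))
                       (*-cong first-d (≋-refl {x}))
    second-t : nextT true 1 d₁ t₁ ≋ x *ᴾ (1# +ᴾ fromℕ a)
    second-t = ≋-trans (solve 3 (λ d t g → ((d :* (con (+ 1) :+ con (+ 0))) :+ (t :* g)) :+ :- ((con (+ 0) :+ con (+ 0)) :* (t :* (con (+ 1) :+ con (+ 0))))
                                           := d :+ t :* g) ≋-refl d₁ t₁ (blockFactor true 1))
      (≋-trans (+-cong first-d (*-cong first-t (≋-refl {x})))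
               (solve 2 (λ X n → X :+ n :* X := X :* (con (+ 1) :+ n)) ≋-refl x (fromℕ a)))

module Evaluation where

  open import Defs using (Poly; eval; isEven; _+ᴾ_; _*ᴾ_)
  open import Data.Bool using (Bool; true; false; not)
  open import Data.Integer using (ℤ; +_; -_; _+_; _*_; _-_)
  import Data.Integer.Properties as ℤ
  open import Data.Integer.Tactic.RingSolver using (solve-∀)
  open import Data.Nat as ℕ using (ℕ; zero; suc; _≤_; s≤s; z≤n)
  import Data.Nat.Properties as ℕ
  open import Data.Product using (Σ; _×_; _,_; proj₁; proj₂)
  open import Data.Sum using (inj₁; inj₂)
  open import Function using (_∘_)
  open import Relation.Binary.PropositionalEquality as ≡ using (_≡_; _≢_; refl; sym; trans; cong; cong₂)

  open PolynomialRing
  open PolynomialDeterminant using (fromℕ; 1#; 0#; _^_)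
  open CharacteristicPolynomial

  evalPair : Pair → ℤ → ℤ × ℤ
  evalPair (d , t) v = eval d v , eval t v

  stepAt : Bool → ℕ → ℤ → ℤ × ℤ → ℤ × ℤ
  stepAt e a v (d , t) = d * g + - ((s * s) * (t * + a)) , (d * + a + t * g) + - ((s + s) * (t * + a))
    where
    g : ℤ
    g = (v + + weight e) + + a * - + weight e
    s : ℤ
    s = - + weight (not e)

  eval-neg : ∀ p v → eval (-ᴾ p) v ≡ - eval p v
  eval-neg p v = trans (eval-scale (- + 1) p v) (ℤ.-1*i≡-i _)

  eval-x : ∀ v → eval x v ≡ v
  eval-x v = simplify v
    where
    simplify : ∀ v → + 0 + v * (+ 1 + v * + 0) ≡ v
    simplify = solve-∀

  eval-fromℕ : ∀ a v → eval (fromℕ a) v ≡ + a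
  eval-fromℕ zero    v = eval-const (+ 0) v
  eval-fromℕ (suc a) v = trans (eval-+ 1# (fromℕ a) v) (cong₂ _+_ (eval-const (+ 1) v) (eval-fromℕ a v))

  eval-blockFactor : ∀ e a v → eval (blockFactor e a) v ≡ (v + + weight e) + + a * - + weight e
  eval-blockFactor e a v = trans (eval-+ (diagonal e) (fromℕ a *ᴾ inside e) v)
    (cong₂ _+_ (trans (eval-+ x (const (+ weight e)) v) (cong₂ _+_ (eval-x v) (eval-const (+ weight e) v)))
               (trans (eval-* (fromℕ a) (inside e) v) (cong₂ _*_ (eval-fromℕ a v) (eval-const (- + weight e) v))))

  eval-step : ∀ e a p v → evalPair (step e a p) v ≡ stepAt e a v (evalPair p v)
  eval-step e a (d , t) v = cong₂ _,_
    (trans (eval-+ (d *ᴾ g) _ v) (cong₂ _+_ (trans (eval-* d g v) (cong (eval d v *_) g≡))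
      (trans (eval-neg ((s *ᴾ s) *ᴾ (t *ᴾ n)) v) (cong -_ (trans (eval-* (s *ᴾ s) (t *ᴾ n) v)
        (cong₂ _*_ (trans (eval-* s s v) (cong₂ _*_ s≡ s≡)) tn≡))))))
    (trans (eval-+ ((d *ᴾ n) +ᴾ (t *ᴾ g)) _ v) (cong₂ _+_
      (trans (eval-+ (d *ᴾ n) (t *ᴾ g) v) (cong₂ _+_ (trans (eval-* d n v) (cong (eval d v *_) (eval-fromℕ a v)))
                                                      (trans (eval-* t g v) (cong (eval t v *_) g≡))))
      (trans (eval-neg ((s +ᴾ s) *ᴾ (t *ᴾ n)) v) (cong -_ (trans (eval-* (s +ᴾ s) (t *ᴾ n) v)
        (cong₂ _*_ (trans (eval-+ s s v) (cong₂ _+_ s≡ s≡)) tn≡))))))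
    where
    g : Poly
    g = blockFactor e a
    s : Poly
    s = across e
    n : Poly
    n = fromℕ a
    g≡ : eval g v ≡ (v + + weight e) + + a * - + weight e
    g≡ = eval-blockFactor e a v
    s≡ : eval s v ≡ - + weight (not e)
    s≡ = eval-const _ v
    tn≡ : eval (t *ᴾ n) v ≡ eval t v * + a
    tn≡ = trans (eval-* t n v) (cong (eval t v *_) (eval-fromℕ a v))

  eval-iterate : ∀ α l₀ p v j → evalPair (iterate α l₀ p (suc j)) v
    ≡ stepAt (isEven (suc (l₀ ℕ.+ j))) (α (suc (l₀ ℕ.+ j))) v (evalPair (iterate α l₀ p j) v)
  eval-iterate α l₀ p v j = eval-step (isEven (suc (l₀ ℕ.+ j))) (α (suc (l₀ ℕ.+ j))) (iterate α l₀ p j) v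

  -- Unless d = 0, d and t have opposite signs and |m t| ≥ |d|.
  record OppositeSigns (m : ℕ) (p : ℤ × ℤ) : Set where
    constructor opposite
    field
      ς     : ℤ
      D r   : ℕ
      ς≢0   : ς ≢ + 0
      d≡ςD  : proj₁ p ≡ ς * + D
      mt≡   : + m * proj₂ p ≡ - (ς * + (D ℕ.+ r))

  record StrictlyOppositeSigns (p : ℤ × ℤ) : Set where
    constructor strictlyOpposite
    field
      ς    : ℤ
      D W  : ℕ
      ς≢0  : ς ≢ + 0
      d≡ςD : proj₁ p ≡ ς * + D
      4t≡  : + 4 * proj₂ p ≡ - (ς * + W)
      1≤D  : 1 ≤ D
      1≤W  : 1 ≤ W

  AfterEven₋₂ AfterOdd₋₂ AfterEven₀ AfterOdd₀ : ℤ × ℤ → Set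
  AfterEven₋₂ p = Σ (OppositeSigns 2 p) λ o → 1 ≤ OppositeSigns.D o × 1 ≤ OppositeSigns.r o
  AfterOdd₋₂  p = Σ (OppositeSigns 2 p) λ o → 1 ≤ OppositeSigns.D o
  AfterEven₀  p = Σ (OppositeSigns 4 p) λ o → 1 ≤ OppositeSigns.r o
  AfterOdd₀     = StrictlyOppositeSigns

  ςD≢0 : ∀ ς D → ς ≢ + 0 → 1 ≤ D → ς * + D ≢ + 0
  ςD≢0 ς D ς≢0 1≤D e with ℤ.i*j≡0⇒i≡0∨j≡0 ς e
  ... | inj₁ ς≡0 = ς≢0 ς≡0
  ςD≢0 ς (suc D) ς≢0 1≤D e | inj₂ ()

  neg≢0 : ∀ ς → ς ≢ + 0 → - ς ≢ + 0
  neg≢0 ς ς≢0 e = ς≢0 (trans (sym (ℤ.neg-involutive ς)) (cong -_ e))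

  pos-[cab] : ∀ c a b → + (c ℕ.* a ℕ.* b) ≡ + c * + a * + b
  pos-[cab] c a b = trans (ℤ.pos-* (c ℕ.* a) b) (cong (_* + b) (ℤ.pos-* c a))

  pos-[2ab+2ce] : ∀ a b c e → + (2 ℕ.* a ℕ.* b ℕ.+ 2 ℕ.* c ℕ.* e) ≡ + 2 * + a * + b + + 2 * + c * + e
  pos-[2ab+2ce] a b c e = trans (ℤ.pos-+ (2 ℕ.* a ℕ.* b) (2 ℕ.* c ℕ.* e)) (cong₂ _+_ (pos-[cab] 2 a b) (pos-[cab] 2 c e))

  oddStep₋₂ : ∀ a p → 1 ≤ a → AfterEven₋₂ p → AfterOdd₋₂ (stepAt false a (- + 2) p)
  oddStep₋₂ (suc a′) (d , t) _ (opposite ς D (suc r′) ς≢0 d≡ 2t≡ , 1≤D , _) =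
    opposite ς D₁ r₁ ς≢0 d₁≡ 2t₁≡ , ℕ.≤-trans (s≤s z≤n) (ℕ.m≤n+m (2 ℕ.* suc a′ ℕ.* suc r′) (2 ℕ.* a′ ℕ.* D))
    where
    r : ℕ
    r = suc r′
    D₁ : ℕ
    D₁ = 2 ℕ.* a′ ℕ.* D ℕ.+ 2 ℕ.* suc a′ ℕ.* r
    r₁ : ℕ
    r₁ = 2 ℕ.* a′ ℕ.* r
    2t≡′ : + 2 * t ≡ - (ς * (+ D + + r))
    2t≡′ = trans 2t≡ (cong (λ z → - (ς * z)) (ℤ.pos-+ D r))
    expand-d : ∀ d t a → d * ((- + 2 + + 0) + a * - + 0) + - ((- + 2 * - + 2) * (t * a)) ≡ - + 2 * d + (- + 2 * a) * (+ 2 * t)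
    expand-d = solve-∀
    collect-d : ∀ ς D r a′ → - + 2 * (ς * D) + (- + 2 * (+ 1 + a′)) * - (ς * (D + r)) ≡ ς * (+ 2 * a′ * D + + 2 * (+ 1 + a′) * r)
    collect-d = solve-∀
    d₁≡ : proj₁ (stepAt false (suc a′) (- + 2) (d , t)) ≡ ς * + D₁
    d₁≡ = trans (expand-d d t (+ suc a′)) (trans (cong₂ (λ y z → - + 2 * y + (- + 2 * + suc a′) * z) d≡ 2t≡′)
            (trans (collect-d ς (+ D) (+ r) (+ a′)) (cong (ς *_) (sym (pos-[2ab+2ce] a′ D (suc a′) r)))))
    expand-t : ∀ d t a → + 2 * ((d * a + t * ((- + 2 + + 0) + a * - + 0)) + - ((- + 2 + - + 2) * (t * a)))
                         ≡ + 2 * a * d + (+ 4 * a - + 2) * (+ 2 * t)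
    expand-t = solve-∀
    collect-t : ∀ ς D r a′ → + 2 * (+ 1 + a′) * (ς * D) + (+ 4 * (+ 1 + a′) - + 2) * - (ς * (D + r))
                             ≡ - (ς * ((+ 2 * a′ * D + + 2 * (+ 1 + a′) * r) + + 2 * a′ * r))
    collect-t = solve-∀
    2t₁≡ : + 2 * proj₂ (stepAt false (suc a′) (- + 2) (d , t)) ≡ - (ς * + (D₁ ℕ.+ r₁))
    2t₁≡ = trans (expand-t d t (+ suc a′)) (trans (cong₂ (λ y z → + 2 * + suc a′ * y + (+ 4 * + suc a′ - + 2) * z) d≡ 2t≡′)
             (trans (collect-t ς (+ D) (+ r) (+ a′))
                    (cong (λ z → - (ς * z)) (sym (trans (ℤ.pos-+ D₁ r₁) (cong₂ _+_ (pos-[2ab+2ce] a′ D (suc a′) r) (pos-[cab] 2 a′ r)))))))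

  evenStep₋₂ : ∀ b p → 1 ≤ b → AfterOdd₋₂ p → AfterEven₋₂ (stepAt true b (- + 2) p)
  evenStep₋₂ (suc b′) (d , t) _ (opposite ς (suc D′) r ς≢0 d≡ 2t≡ , _) =
    opposite (- ς) D₂ r₂ (neg≢0 ς ς≢0) d₂≡ 2t₂≡ , s≤s z≤n , ℕ.≤-trans (s≤s z≤n) (ℕ.m≤m+n (2 ℕ.* b ℕ.* D) (2 ℕ.* b ℕ.* r))
    where
    b : ℕ
    b = suc b′
    D : ℕ
    D = suc D′
    D₂ : ℕ
    D₂ = 2 ℕ.* b ℕ.* D
    r₂ : ℕ
    r₂ = 2 ℕ.* b ℕ.* D ℕ.+ 2 ℕ.* b ℕ.* r
    2t≡′ : + 2 * t ≡ - (ς * (+ D + + r))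
    2t≡′ = trans 2t≡ (cong (λ z → - (ς * z)) (ℤ.pos-+ D r))
    expand-d : ∀ d t b → d * ((- + 2 + + 2) + b * - + 2) + - ((- + 0 * - + 0) * (t * b)) ≡ (- + 2 * b) * d
    expand-d = solve-∀
    collect-d : ∀ ς D b → (- + 2 * b) * (ς * D) ≡ - ς * (+ 2 * b * D)
    collect-d = solve-∀
    d₂≡ : proj₁ (stepAt true b (- + 2) (d , t)) ≡ - ς * + D₂
    d₂≡ = trans (expand-d d t (+ b)) (trans (cong ((- + 2 * + b) *_) d≡)
            (trans (collect-d ς (+ D) (+ b)) (cong (- ς *_) (sym (pos-[cab] 2 b D)))))
    expand-t : ∀ d t b → + 2 * ((d * b + t * ((- + 2 + + 2) + b * - + 2)) + - ((- + 0 + - + 0) * (t * b)))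
                         ≡ + 2 * b * d + (- + 2 * b) * (+ 2 * t)
    expand-t = solve-∀
    collect-t : ∀ ς D r b → + 2 * b * (ς * D) + (- + 2 * b) * - (ς * (D + r))
                            ≡ - (- ς * (+ 2 * b * D + (+ 2 * b * D + + 2 * b * r)))
    collect-t = solve-∀
    2t₂≡ : + 2 * proj₂ (stepAt true b (- + 2) (d , t)) ≡ - (- ς * + (D₂ ℕ.+ r₂))
    2t₂≡ = trans (expand-t d t (+ b)) (trans (cong₂ (λ y z → + 2 * + b * y + (- + 2 * + b) * z) d≡ 2t≡′)
             (trans (collect-t ς (+ D) (+ r) (+ b))
                    (cong (λ z → - (- ς * z)) (sym (trans (ℤ.pos-+ D₂ r₂) (cong₂ _+_ (pos-[cab] 2 b D) (pos-[2ab+2ce] b D b r)))))))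

  oddStep₀ : ∀ a p → 1 ≤ a → AfterEven₀ p → AfterOdd₀ (stepAt false a (+ 0) p)
  oddStep₀ (suc a′) (d , t) _ (opposite ς D r ς≢0 d≡ 4t≡ , 1≤r) =
    strictlyOpposite ς D₁ W₁ ς≢0 d₁≡ 4t₁≡ (ℕ.*-mono-≤ {1} {a} (s≤s z≤n) (ℕ.≤-trans 1≤r (ℕ.m≤n+m r D)))
                                          (ℕ.*-mono-≤ {1} {4 ℕ.* a} (s≤s z≤n) 1≤r)
    where
    a : ℕ
    a = suc a′
    D₁ : ℕ
    D₁ = a ℕ.* (D ℕ.+ r)
    W₁ : ℕ
    W₁ = 4 ℕ.* a ℕ.* r
    4t≡′ : + 4 * t ≡ - (ς * (+ D + + r))
    4t≡′ = trans 4t≡ (cong (λ z → - (ς * z)) (ℤ.pos-+ D r))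
    expand-d : ∀ d t a → d * ((+ 0 + + 0) + a * - + 0) + - ((- + 2 * - + 2) * (t * a)) ≡ - a * (+ 4 * t)
    expand-d = solve-∀
    collect-d : ∀ ς D r a → - a * - (ς * (D + r)) ≡ ς * (a * (D + r))
    collect-d = solve-∀
    d₁≡ : proj₁ (stepAt false a (+ 0) (d , t)) ≡ ς * + D₁
    d₁≡ = trans (expand-d d t (+ a)) (trans (cong (λ z → - + a * z) 4t≡′)
            (trans (collect-d ς (+ D) (+ r) (+ a)) (cong (ς *_) (sym (trans (ℤ.pos-* a (D ℕ.+ r)) (cong (λ z → + a * z) (ℤ.pos-+ D r)))))))
    expand-t : ∀ d t a → + 4 * ((d * a + t * ((+ 0 + + 0) + a * - + 0)) + - ((- + 2 + - + 2) * (t * a)))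
                         ≡ + 4 * a * d + (+ 4 * a) * (+ 4 * t)
    expand-t = solve-∀
    collect-t : ∀ ς D r a → + 4 * a * (ς * D) + (+ 4 * a) * - (ς * (D + r)) ≡ - (ς * (+ 4 * a * r))
    collect-t = solve-∀
    4t₁≡ : + 4 * proj₂ (stepAt false a (+ 0) (d , t)) ≡ - (ς * + W₁)
    4t₁≡ = trans (expand-t d t (+ a)) (trans (cong₂ (λ y z → + 4 * + a * y + (+ 4 * + a) * z) d≡ 4t≡′)
             (trans (collect-t ς (+ D) (+ r) (+ a)) (cong (λ z → - (ς * z)) (sym (pos-[cab] 4 a r)))))

  evenStep₀-d : ∀ b′ p (o : AfterOdd₀ p) →
    proj₁ (stepAt true (suc b′) (+ 0) p) ≡ - StrictlyOppositeSigns.ς o * + (2 ℕ.* b′ ℕ.* StrictlyOppositeSigns.D o)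
  evenStep₀-d b′ (d , t) (strictlyOpposite ς D W ς≢0 d≡ 4t≡ _ _) =
    trans (expand-d d t (+ suc b′)) (trans (cong ((+ 2 - + 2 * + suc b′) *_) d≡)
      (trans (collect-d ς (+ D) (+ b′)) (cong (- ς *_) (sym (pos-[cab] 2 b′ D)))))
    where
    expand-d : ∀ d t b → d * ((+ 0 + + 2) + b * - + 2) + - ((- + 0 * - + 0) * (t * b)) ≡ (+ 2 - + 2 * b) * d
    expand-d = solve-∀
    collect-d : ∀ ς D b′ → (+ 2 - + 2 * (+ 1 + b′)) * (ς * D) ≡ - ς * (+ 2 * b′ * D)
    collect-d = solve-∀

  evenStep₀ : ∀ b p → 1 ≤ b → AfterOdd₀ p → AfterEven₀ (stepAt true b (+ 0) p)
  evenStep₀ (suc b′) (d , t) _ o@(strictlyOpposite ς D W ς≢0 d≡ 4t≡ 1≤D 1≤W) =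
    opposite (- ς) D₂ r₂ (neg≢0 ς ς≢0) (evenStep₀-d b′ (d , t) o) 4t₂≡ ,
    ℕ.≤-trans (ℕ.*-mono-≤ {1} {4} (s≤s z≤n) 1≤D) (ℕ.m≤m+n (4 ℕ.* D) _)
    where
    D₂ : ℕ
    D₂ = 2 ℕ.* b′ ℕ.* D
    r₂ : ℕ
    r₂ = 4 ℕ.* D ℕ.+ (2 ℕ.* b′ ℕ.* D ℕ.+ 2 ℕ.* b′ ℕ.* W)
    expand-t : ∀ d t b → + 4 * ((d * b + t * ((+ 0 + + 2) + b * - + 2)) + - ((- + 0 + - + 0) * (t * b)))
                         ≡ + 4 * b * d + (+ 2 - + 2 * b) * (+ 4 * t)
    expand-t = solve-∀
    collect-t : ∀ ς D W b′ → + 4 * (+ 1 + b′) * (ς * D) + (+ 2 - + 2 * (+ 1 + b′)) * - (ς * W)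
                             ≡ - (- ς * (+ 2 * b′ * D + (+ 4 * D + (+ 2 * b′ * D + + 2 * b′ * W))))
    collect-t = solve-∀
    4t₂≡ : + 4 * proj₂ (stepAt true (suc b′) (+ 0) (d , t)) ≡ - (- ς * + (D₂ ℕ.+ r₂))
    4t₂≡ = trans (expand-t d t (+ suc b′)) (trans (cong₂ (λ y z → + 4 * + suc b′ * y + (+ 2 - + 2 * + suc b′) * z) d≡ 4t≡)
             (trans (collect-t ς (+ D) (+ W) (+ b′)) (cong (λ z → - (- ς * z))
               (sym (trans (ℤ.pos-+ D₂ r₂) (cong₂ _+_ (pos-[cab] 2 b′ D)
                 (trans (ℤ.pos-+ (4 ℕ.* D) _) (cong₂ _+_ (ℤ.pos-* 4 D) (pos-[2ab+2ce] b′ D b′ W)))))))))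

  firstBlock : ∀ a v → stepAt false a v (+ 1 , + 0) ≡ (v , + a)
  firstBlock a v = cong₂ _,_ (simplify-d v (+ a)) (simplify-t v (+ a))
    where
    simplify-d : ∀ v a → + 1 * ((v + + 0) + a * - + 0) + - ((- + 2 * - + 2) * (+ 0 * a)) ≡ v
    simplify-d = solve-∀
    simplify-t : ∀ v a → (+ 1 * a + + 0 * ((v + + 0) + a * - + 0)) + - ((- + 2 + - + 2) * (+ 0 * a)) ≡ a
    simplify-t = solve-∀

  eval-firstTwoBlocks : ∀ α v → evalPair (iterate α 0 (1# , 0#) 2) v ≡ stepAt true (α 2) v (v , + α 1)
  eval-firstTwoBlocks α v = trans (eval-iterate α 0 (1# , 0#) v 1) (cong (stepAt true (α 2) v)
    (trans (eval-iterate α 0 (1# , 0#) v 0) (trans (cong (stepAt false (α 1) v) (cong₂ _,_ (eval-const (+ 1) v) (eval-const (+ 0) v)))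
                                                   (firstBlock (α 1) v))))

  start₋₂ : ∀ a b → 1 ≤ a → 1 ≤ b → AfterEven₋₂ (stepAt true b (- + 2) (- + 2 , + a))
  start₋₂ (suc a′) (suc b′) _ _ =
    opposite (+ 1) (4 ℕ.* b) (4 ℕ.* a ℕ.* b) (λ ()) (trans (simplify-d (+ a) (+ b)) (cong (λ z → + 1 * z) (sym (ℤ.pos-* 4 b))))
      (trans (simplify-t (+ a) (+ b))
        (cong (λ z → - (+ 1 * z)) (sym (trans (ℤ.pos-+ (4 ℕ.* b) (4 ℕ.* a ℕ.* b)) (cong₂ _+_ (ℤ.pos-* 4 b) (pos-[cab] 4 a b))))))
    , s≤s z≤n , s≤s z≤n
    where
    a : ℕ
    a = suc a′
    b : ℕ
    b = suc b′
    simplify-d : ∀ a b → - + 2 * ((- + 2 + + 2) + b * - + 2) + - ((- + 0 * - + 0) * (a * b)) ≡ + 1 * (+ 4 * b)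
    simplify-d = solve-∀
    simplify-t : ∀ a b → + 2 * ((- + 2 * b + a * ((- + 2 + + 2) + b * - + 2)) + - ((- + 0 + - + 0) * (a * b)))
                         ≡ - (+ 1 * (+ 4 * b + + 4 * a * b))
    simplify-t = solve-∀

  start₀ : ∀ a b → 1 ≤ a → 2 ≤ b → AfterEven₀ (stepAt true b (+ 0) (+ 0 , + a))
  start₀ (suc a′) (suc zero)     _ (s≤s ())
  start₀ (suc a′) (suc (suc b″)) _ _ =
    opposite (+ 1) 0 (8 ℕ.* a ℕ.* b′) (λ ()) (simplify-d (+ a) (+ b′))
      (trans (simplify-t (+ a) (+ b′)) (cong (λ z → - (+ 1 * (+ 0 + z))) (sym (pos-[cab] 8 a b′))))
    , s≤s z≤n
    where
    a : ℕ
    a = suc a′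
    b′ : ℕ
    b′ = suc b″
    simplify-d : ∀ a b′ → + 0 * ((+ 0 + + 2) + (+ 1 + b′) * - + 2) + - ((- + 0 * - + 0) * (a * (+ 1 + b′))) ≡ + 1 * + 0
    simplify-d = solve-∀
    simplify-t : ∀ a b′ → + 4 * ((+ 0 * (+ 1 + b′) + a * ((+ 0 + + 2) + (+ 1 + b′) * - + 2)) + - ((- + 0 + - + 0) * (a * (+ 1 + b′))))
                          ≡ - (+ 1 * (+ 0 + + 8 * a * b′))
    simplify-t = solve-∀

  start₀-x : ∀ a → AfterEven₀ (evalPair (x , 1# +ᴾ fromℕ a) (+ 0))
  start₀-x a = opposite (- + 1) 0 (4 ℕ.+ 4 ℕ.* a) (λ ()) (eval-x (+ 0))
    (trans (cong (λ z → + 4 * z) (trans (eval-+ 1# (fromℕ a) (+ 0)) (cong₂ _+_ (eval-const (+ 1) (+ 0)) (eval-fromℕ a (+ 0)))))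
      (trans (simplify (+ a)) (cong (λ z → - (- + 1 * z))
        (sym (trans (ℤ.pos-+ 0 (4 ℕ.+ 4 ℕ.* a)) (cong (λ z → + 0 + z) (trans (ℤ.pos-+ 4 (4 ℕ.* a)) (cong (λ z → + 4 + z) (ℤ.pos-* 4 a)))))))))
    , s≤s z≤n
    where
    simplify : ∀ a → + 4 * (+ 1 + a) ≡ - (- + 1 * (+ 0 + (+ 4 + + 4 * a)))
    simplify = solve-∀

  evalPair-twoBlocks : ∀ α p v j → evalPair (iterate α 2 p (2 ℕ.* suc j)) v
    ≡ stepAt true (α (3 ℕ.+ suc (2 ℕ.* j))) v (stepAt false (α (3 ℕ.+ 2 ℕ.* j)) v (evalPair (iterate α 2 p (2 ℕ.* j)) v))
  evalPair-twoBlocks α p v j =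
    trans (cong (λ n → evalPair (iterate α 2 p n) v) (ℕ.*-suc 2 j)) (trans (eval-iterate α 2 p v (suc (2 ℕ.* j)))
      (cong₂ (λ e z → stepAt e (α (3 ℕ.+ suc (2 ℕ.* j))) v z) (parity-even j)
        (trans (eval-iterate α 2 p v (2 ℕ.* j)) (cong (λ e → stepAt e (α (3 ℕ.+ 2 ℕ.* j)) v (evalPair (iterate α 2 p (2 ℕ.* j)) v)) (parity-odd j)))))
    where
    parity-even : ∀ j → isEven (3 ℕ.+ suc (2 ℕ.* j)) ≡ true
    parity-even j rewrite CographDistances.isEven-2* j = refl
    parity-odd : ∀ j → isEven (3 ℕ.+ 2 ℕ.* j) ≡ false
    parity-odd j rewrite CographDistances.isEven-2* j = refl

  -- Blocks 2j + 3 (odd) and 2j + 4 (even) are processed together.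
  module PairsOfBlocks (α : ℕ → ℕ) (L : ℕ) (α-positive : ∀ i → 1 ≤ i → i ≤ L → 1 ≤ α i) (p : Pair) where

    valueAfter : ℤ → ℕ → ℤ × ℤ
    valueAfter v j = evalPair (iterate α 2 p (2 ℕ.* j)) v

    even-index : ∀ j → 3 ℕ.+ suc (2 ℕ.* j) ≤ 2 ℕ.+ 2 ℕ.* suc j
    even-index j = ℕ.≤-reflexive (cong (2 ℕ.+_) (sym (ℕ.*-suc 2 j)))

    odd-index : ∀ j → 3 ℕ.+ 2 ℕ.* j ≤ 2 ℕ.+ 2 ℕ.* suc j
    odd-index j = ℕ.≤-trans (ℕ.n≤1+n _) (even-index j)

    1≤α-odd : ∀ j → 2 ℕ.+ 2 ℕ.* suc j ≤ L → 1 ≤ α (3 ℕ.+ 2 ℕ.* j)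
    1≤α-odd j le = α-positive _ (s≤s z≤n) (ℕ.≤-trans (odd-index j) le)

    1≤α-even : ∀ j → 2 ℕ.+ 2 ℕ.* suc j ≤ L → 1 ≤ α (3 ℕ.+ suc (2 ℕ.* j))
    1≤α-even j le = α-positive _ (s≤s z≤n) (ℕ.≤-trans (even-index j) le)

    earlier : ∀ j → 2 ℕ.+ 2 ℕ.* suc j ≤ L → 2 ℕ.+ 2 ℕ.* j ≤ L
    earlier j le = ℕ.≤-trans (ℕ.≤-trans (ℕ.n≤1+n _) (odd-index j)) le

    invariant₋₂ : AfterEven₋₂ (valueAfter (- + 2) 0) → ∀ j → 2 ℕ.+ 2 ℕ.* j ≤ L → AfterEven₋₂ (valueAfter (- + 2) j)
    invariant₋₂ start zero    _  = start
    invariant₋₂ start (suc j) le = ≡.subst AfterEven₋₂ (sym (evalPair-twoBlocks α p (- + 2) j))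
      (evenStep₋₂ _ _ (1≤α-even j le) (oddStep₋₂ _ _ (1≤α-odd j le) (invariant₋₂ start j (earlier j le))))

    invariant₀ : AfterEven₀ (valueAfter (+ 0) 0) → ∀ j → 2 ℕ.+ 2 ℕ.* j ≤ L → AfterEven₀ (valueAfter (+ 0) j)
    invariant₀ start zero    _  = start
    invariant₀ start (suc j) le = ≡.subst AfterEven₀ (sym (evalPair-twoBlocks α p (+ 0) j))
      (evenStep₀ _ _ (1≤α-even j le) (oddStep₀ _ _ (1≤α-odd j le) (invariant₀ start j (earlier j le))))

    nonzero₋₂ : AfterEven₋₂ (valueAfter (- + 2) 0) → ∀ j → 2 ℕ.+ 2 ℕ.* j ≤ L → proj₁ (valueAfter (- + 2) j) ≢ + 0
    nonzero₋₂ start j le with invariant₋₂ start j le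
    ... | opposite ς D r ς≢0 d≡ _ , 1≤D , _ = ςD≢0 ς D ς≢0 1≤D ∘ trans (sym d≡)

    -- At x = 0 the last step needs a last block with at least two vertices.
    nonzero₀ : AfterEven₀ (valueAfter (+ 0) 0) → ∀ j → 2 ℕ.+ 2 ℕ.* suc j ≤ L → 2 ≤ α (3 ℕ.+ suc (2 ℕ.* j))
      → proj₁ (valueAfter (+ 0) (suc j)) ≢ + 0
    nonzero₀ start j le 2≤b = last-even (α (3 ℕ.+ suc (2 ℕ.* j))) 2≤b refl
      where
      before : ℤ × ℤ
      before = stepAt false (α (3 ℕ.+ 2 ℕ.* j)) (+ 0) (valueAfter (+ 0) j)
      odd : AfterOdd₀ before
      odd = oddStep₀ _ _ (1≤α-odd j le) (invariant₀ start j (earlier j le))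
      last-even : ∀ b → 2 ≤ b → b ≡ α (3 ℕ.+ suc (2 ℕ.* j)) → proj₁ (valueAfter (+ 0) (suc j)) ≢ + 0
      last-even (suc zero)     (s≤s ())
      last-even (suc (suc b″)) _ b≡ e =
        ςD≢0 (- StrictlyOppositeSigns.ς odd) (2 ℕ.* suc b″ ℕ.* StrictlyOppositeSigns.D odd) (neg≢0 _ (StrictlyOppositeSigns.ς≢0 odd))
             (ℕ.*-mono-≤ {1} {2 ℕ.* suc b″} (s≤s z≤n) (StrictlyOppositeSigns.1≤D odd))
          (trans (sym (evenStep₀-d (suc b″) before odd))
            (trans (cong (λ z → proj₁ (stepAt true z (+ 0) before)) b≡) (trans (sym (cong proj₁ (evalPair-twoBlocks α p (+ 0) j))) e)))

  eval-*-≢0 : ∀ p q v → eval p v ≢ + 0 → eval q v ≢ + 0 → eval (p *ᴾ q) v ≢ + 0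
  eval-*-≢0 p q v p≢0 q≢0 e with ℤ.i*j≡0⇒i≡0∨j≡0 (eval p v) (trans (sym (eval-* p q v)) e)
  ... | inj₁ p≡0 = p≢0 p≡0
  ... | inj₂ q≡0 = q≢0 q≡0

  eval-^-≢0 : ∀ p n v → eval p v ≢ + 0 → eval (p ^ n) v ≢ + 0
  eval-^-≢0 p zero    v _   e with trans (sym (eval-const (+ 1) v)) e
  ... | ()
  eval-^-≢0 p (suc n) v p≢0 = eval-*-≢0 p (p ^ n) v p≢0 (eval-^-≢0 p n v p≢0)

module ClosedForm where

  open import Defs
  open import Data.Bool using (true; false)
  open import Data.Nat as ℕ using (ℕ; zero; suc; _+_; _*_; _∸_; _≤_; s≤s; z≤n)
  import Data.Nat.Properties as ℕ
  open import Relation.Binary.PropositionalEquality as ≡ using (_≡_; refl; sym; cong; cong₂)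

  open PolynomialRing
  open PolynomialDeterminant using (_^_; ^-+; 1#; solve; _:=_; _:*_)
  open CharacteristicPolynomial

  sumTo-∸1 : ∀ f k → (∀ i → 1 ≤ i → i ≤ k → 1 ≤ f i) → sumTo (λ i → f i ∸ 1) k ≡ sumTo f k ∸ k
  sumTo-∸1 f zero    _          = refl
  sumTo-∸1 f (suc k) 1≤f = begin
    sumTo (λ i → f i ∸ 1) k + (f (suc k) ∸ 1) ≡⟨ cong (_+ (f (suc k) ∸ 1)) (sumTo-∸1 f k 1≤f′) ⟩
    (sumTo f k ∸ k) + (f (suc k) ∸ 1)        ≡⟨ ℕ.+-∸-assoc (sumTo f k ∸ k) (1≤f (suc k) (s≤s z≤n) ℕ.≤-refl) ⟨
    (sumTo f k ∸ k) + f (suc k) ∸ 1          ≡⟨ cong (_∸ 1) (ℕ.+-∸-comm (f (suc k)) (k≤sumTo k 1≤f′)) ⟨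
    sumTo f k + f (suc k) ∸ k ∸ 1            ≡⟨ ℕ.∸-+-assoc (sumTo f k + f (suc k)) k 1 ⟩
    sumTo f k + f (suc k) ∸ (k + 1)          ≡⟨ cong (sumTo f k + f (suc k) ∸_) (ℕ.+-comm k 1) ⟩
    sumTo f k + f (suc k) ∸ suc k            ∎
    where
    open ≡.≡-Reasoning
    1≤f′ : ∀ i → 1 ≤ i → i ≤ k → 1 ≤ f i
    1≤f′ i 1≤i i≤k = 1≤f i 1≤i (ℕ.m≤n⇒m≤1+n i≤k)
    k≤sumTo : ∀ k → (∀ i → 1 ≤ i → i ≤ k → 1 ≤ f i) → k ≤ sumTo f k
    k≤sumTo zero    _   = z≤n
    k≤sumTo (suc k) 1≤f = ≡.subst (_≤ sumTo f k + f (suc k)) (ℕ.+-comm k 1)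
      (ℕ.+-mono-≤ (k≤sumTo k λ i 1≤i i≤k → 1≤f i 1≤i (ℕ.m≤n⇒m≤1+n i≤k)) (1≤f (suc k) (s≤s z≤n) ℕ.≤-refl))

  oddExcess evenExcess : (ℕ → ℕ) → ℕ → ℕ
  oddExcess  α j = sumTo (λ i → α (2 * i ∸ 1) ∸ 1) j
  evenExcess α j = sumTo (λ i → α (2 * i) ∸ 1) j

  prefactor-even : ∀ α j → prefactor α (2 * j) ≋ (x ^ oddExcess α j) *ᴾ (diagonal true ^ evenExcess α j)
  prefactor-even α zero    = ≋-sym (*-identityˡ 1#)
  prefactor-even α (suc j) =
    ≋-trans (≋-reflexive (cong (prefactor α) (ℕ.*-suc 2 j)))
    (≋-trans (≋-reflexive (cong₂ (λ e e′ → (prefactor α (2 * j) *ᴾ (diagonal e ^ a)) *ᴾ (diagonal e′ ^ b)) (parity-odd j) (parity-even j)))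
    (≋-trans (*-cong (*-cong (prefactor-even α j) (≋-refl {x ^ a})) (≋-refl {diagonal true ^ b}))
    (≋-trans (solve 4 (λ P Q X Y → ((P :* Q) :* X) :* Y := (P :* X) :* (Q :* Y)) ≋-refl
                      (x ^ oddExcess α j) (diagonal true ^ evenExcess α j) (x ^ a) (diagonal true ^ b))
    (≋-trans (*-cong (≋-sym (^-+ x (oddExcess α j) a)) (≋-sym (^-+ (diagonal true) (evenExcess α j) b)))
      (≋-reflexive (cong₂ (λ u w → (x ^ (oddExcess α j + u)) *ᴾ (diagonal true ^ (evenExcess α j + w)))
                          (cong (λ z → α z ∸ 1) (sym (cong (_∸ 1) (ℕ.*-suc 2 j))))
                          (cong (λ z → α z ∸ 1) (sym (ℕ.*-suc 2 j)))))))))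
    where
    a : ℕ
    a = α (suc (2 * j)) ∸ 1
    b : ℕ
    b = α (suc (suc (2 * j))) ∸ 1
    parity-odd : ∀ j → isEven (suc (2 * j)) ≡ false
    parity-odd j rewrite CographDistances.isEven-2* j = refl
    parity-even : ∀ j → isEven (suc (suc (2 * j))) ≡ true
    parity-even j rewrite CographDistances.isEven-2* j = refl

open import Defs
open import Data.Nat using (ℕ; _≤_; _*_; _+_; _∸_; suc)
open import Data.Integer using (+_; -_)
open import Data.Product using (_×_; _,_)
open import Relation.Binary.PropositionalEquality using (_≡_; _≢_)

module Multiplicities (k : ℕ) (2≤k : 2 ≤ k) (α : ℕ → ℕ)
                      (α-positive : ∀ i → 1 ≤ i → i ≤ 2 * k → 1 ≤ α i) (2≤αL : 2 ≤ α (2 * k)) where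

  open import Data.Bool using (true; false; if_then_else_)
  open import Data.Fin using (Fin; _≟_; toℕ)
  open import Data.List using ([]; _∷_)
  open import Data.Nat using (_≡ᵇ_; s≤s; z≤n)
  import Data.Nat.Properties as ℕ
  open import Function using (_∘_)
  open import Data.Product using (_,_; proj₁)
  open import Relation.Nullary.Decidable using (⌊_⌋)
  open import Relation.Binary.PropositionalEquality as ≡ using (sym; trans; cong)

  open PolynomialRing
  open PolynomialDeterminant
  open CharacteristicPolynomial
  open Evaluation
  open ClosedForm
  open CographDistances.EvenCograph α k 2≤k α-positive 2≤αL using (eccMatrix-formula)

  L : ℕ
  L = 2 * k
  E : Fin (nv α L) → Fin (nv α L) → ℕ
  E = eccMatrix (CG α L)
  Q : Poly
  Q = proj₁ (iterate α 0 (1# , 0#) L)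
  A : ℕ
  A = oddExcess α k
  B : ℕ
  B = evenExcess α k

  charPoly-factorisation : charPoly E ≋ ((x ^ A) *ᴾ (diagonal true ^ B)) *ᴾ Q
  charPoly-factorisation =
    ≋-trans (det-agrees (nv α L) xI-E)
      (≋-trans (det-cong (nv α L) entries)
        (≋-trans (proj₁ (Factorisation.D-T-factor α L α-positive)) (*-cong (prefactor-even α k) (≋-refl {Q}))))
    where
    xI-E : Fin (nv α L) → Fin (nv α L) → Poly
    xI-E u v = if ⌊ u ≟ v ⌋ then (- + E u v) ∷ + 1 ∷ [] else (- + E u v) ∷ []
    entries : ∀ u v → xI-E u v ≋ restrict (Blockwise.charMatrix α L) u v
    entries u v rewrite CographDistances.⌊≟⌋≡≡ᵇ u v | eccMatrix-formula u v with toℕ u ≡ᵇ toℕ v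
    ... | true  = ≋-refl
    ... | false = ≋-refl

  isMultiplicity : ∀ λ₀ m q → charPoly E ≋ ((((- λ₀) ∷ + 1 ∷ []) ^ m) *ᴾ q) → eval q λ₀ ≢ + 0 → EigMult E λ₀ m
  isMultiplicity λ₀ m q factorisation q≢0 = q , coeff-≡ (≋-trans factorisation (≋-reflexive (cong (_*ᴾ q) (^≡^ᴾ _ m)))) , q≢0

  positive-evens : ∀ i → 1 ≤ i → i ≤ k → 1 ≤ α (2 * i)
  positive-evens i 1≤i i≤k = α-positive (2 * i) (ℕ.≤-trans 1≤i (ℕ.m≤m+n i _)) (ℕ.*-monoʳ-≤ 2 i≤k)

  positive-odds : ∀ i → 1 ≤ i → i ≤ k → 1 ≤ α (2 * i ∸ 1)
  positive-odds (suc i) _ 1+i≤k = α-positive (2 * suc i ∸ 1) (ℕ.≤-trans (s≤s z≤n) (ℕ.m≤n+m (suc (i + 0)) i))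
    (ℕ.≤-trans (ℕ.m∸n≤m (2 * suc i) 1) (ℕ.*-monoʳ-≤ 2 1+i≤k))

  A≡ : A ≡ sumTo (λ i → α (2 * i ∸ 1)) k ∸ k
  A≡ = sumTo-∸1 (λ i → α (2 * i ∸ 1)) k positive-odds

  B≡ : B ≡ sumTo (λ i → α (2 * i)) k ∸ k
  B≡ = sumTo-∸1 (λ i → α (2 * i)) k positive-evens

  -- Blocks 3, …, L come in k - 1 odd-even pairs.
  k″ : ℕ
  k″ = k ∸ 2
  pairs : ℕ
  pairs = 2 * suc k″

  L≡2+pairs : 2 + pairs ≡ L
  L≡2+pairs = trans (sym (ℕ.*-suc 2 (suc k″))) (cong (2 *_) (trans (ℕ.+-comm 2 k″) (ℕ.m∸n+n≡m 2≤k)))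

  last-index : 3 + suc (2 * k″) ≡ L
  last-index = trans (cong (λ z → 2 + z) (sym (ℕ.*-suc 2 k″))) L≡2+pairs

  afterTwoBlocks : Pair
  afterTwoBlocks = iterate α 0 (1# , 0#) 2

  Q≡ : Q ≡ proj₁ (iterate α 2 afterTwoBlocks pairs)
  Q≡ = trans (cong (λ z → proj₁ (iterate α 0 (1# , 0#) z)) (sym L≡2+pairs)) (cong proj₁ (iterate-+ α (1# , 0#) pairs))

  1≤α₁ : 1 ≤ α 1
  1≤α₁ = α-positive 1 (s≤s z≤n) (ℕ.≤-trans (s≤s z≤n) (ℕ.*-monoʳ-≤ 2 2≤k))

  1≤α₂ : 1 ≤ α 2
  1≤α₂ = positive-evens 1 (s≤s z≤n) (ℕ.≤-trans (s≤s z≤n) 2≤k)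

  Q≢0-at-−2 : eval Q (- + 2) ≢ + 0
  Q≢0-at-−2 e = PairsOfBlocks.nonzero₋₂ α L α-positive afterTwoBlocks start (suc k″) (ℕ.≤-reflexive L≡2+pairs)
                  (trans (cong (λ z → eval z (- + 2)) (sym Q≡)) e)
    where
    start : AfterEven₋₂ (evalPair afterTwoBlocks (- + 2))
    start = ≡.subst AfterEven₋₂ (sym (eval-firstTwoBlocks α (- + 2))) (start₋₂ (α 1) (α 2) 1≤α₁ 1≤α₂)

  Q≢0-at-0 : α 2 ≢ 1 → eval Q (+ 0) ≢ + 0
  Q≢0-at-0 α₂≢1 e = PairsOfBlocks.nonzero₀ α L α-positive afterTwoBlocks start k″ (ℕ.≤-reflexive L≡2+pairs)
                      (≡.subst (λ i → 2 ≤ α i) (sym last-index) 2≤αL) (trans (cong (λ z → eval z (+ 0)) (sym Q≡)) e)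
    where
    2≤α₂ : 2 ≤ α 2
    2≤α₂ = ℕ.≤∧≢⇒< 1≤α₂ (α₂≢1 ∘ sym)
    start : AfterEven₀ (evalPair afterTwoBlocks (+ 0))
    start = ≡.subst AfterEven₀ (sym (eval-firstTwoBlocks α (+ 0))) (start₀ (α 1) (α 2) 1≤α₁ 2≤α₂)

  module _ (α₂≡1 : α 2 ≡ 1) where

    Q̃ : Poly
    Q̃ = proj₁ (iterate α 2 (x , 1# +ᴾ fromℕ (α 1)) pairs)

    Q≋xQ̃ : Q ≋ x *ᴾ Q̃
    Q≋xQ̃ = ≋-trans (≋-reflexive Q≡) (≋-trans (proj₁ (iterate-cong α 2 pairs (firstTwoBlocks-α₂≡1 α α₂≡1)))
                                                 (proj₁ (iterate-homogeneous α 2 x x (1# +ᴾ fromℕ (α 1)) pairs)))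

    Q̃≢0-at-0 : eval Q̃ (+ 0) ≢ + 0
    Q̃≢0-at-0 = PairsOfBlocks.nonzero₀ α L α-positive (x , 1# +ᴾ fromℕ (α 1)) (start₀-x (α 1)) k″ (ℕ.≤-reflexive L≡2+pairs)
                 (≡.subst (λ i → 2 ≤ α i) (sym last-index) 2≤αL)

  eigenvalue-−2 : EigMult E (- + 2) (sumTo (λ i → α (2 * i)) k ∸ k)
  eigenvalue-−2 = ≡.subst (EigMult E (- + 2)) B≡ (isMultiplicity (- + 2) B ((x ^ A) *ᴾ Q)
    (≋-trans charPoly-factorisation (solve 3 (λ P R S → (P :* R) :* S := R :* (P :* S)) ≋-refl (x ^ A) (diagonal true ^ B) Q))
    (eval-*-≢0 (x ^ A) Q (- + 2) (eval-^-≢0 x A (- + 2) (λ ())) Q≢0-at-−2))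

  eigenvalue-0 : α 2 ≢ 1 → EigMult E (+ 0) (sumTo (λ i → α (2 * i ∸ 1)) k ∸ k)
  eigenvalue-0 α₂≢1 = ≡.subst (EigMult E (+ 0)) A≡ (isMultiplicity (+ 0) A ((diagonal true ^ B) *ᴾ Q)
    (≋-trans charPoly-factorisation (*-assoc (x ^ A) (diagonal true ^ B) Q))
    (eval-*-≢0 (diagonal true ^ B) Q (+ 0) (eval-^-≢0 (diagonal true) B (+ 0) (λ ())) (Q≢0-at-0 α₂≢1)))

  eigenvalue-0-α₂≡1 : α 2 ≡ 1 → EigMult E (+ 0) (sumTo (λ i → α (2 * i ∸ 1)) k ∸ k + 1)
  eigenvalue-0-α₂≡1 α₂≡1 = ≡.subst (λ m → EigMult E (+ 0) (m + 1)) A≡ (isMultiplicity (+ 0) (A + 1) ((diagonal true ^ B) *ᴾ Q̃ α₂≡1)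
    (≋-trans charPoly-factorisation (≋-trans (*-cong (≋-refl {(x ^ A) *ᴾ (diagonal true ^ B)}) (Q≋xQ̃ α₂≡1))
      (≋-trans (solve 4 (λ P R X S → (P :* R) :* (X :* S) := (P :* X) :* (R :* S)) ≋-refl (x ^ A) (diagonal true ^ B) x (Q̃ α₂≡1))
               (*-cong (≋-sym (≋-trans (^-+ x A 1) (*-cong (≋-refl {x ^ A}) (≋-trans (*-comm x 1ᴾ) (*-identityˡ x))))) ≋-refl))))
    (eval-*-≢0 (diagonal true ^ B) (Q̃ α₂≡1) (+ 0) (eval-^-≢0 (diagonal true) B (+ 0) (λ ())) (Q̃≢0-at-0 α₂≡1)))

mainTheorem7 : (k : ℕ) → 2 ≤ k → (α : ℕ → ℕ)
    → (∀ i → 1 ≤ i → i ≤ 2 * k → 1 ≤ α i) → 2 ≤ α (2 * k)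
    → EigMult (eccMatrix (CG α (2 * k))) (- (+ 2)) (sumTo (λ i → α (2 * i)) k ∸ k)
    × (α 2 ≡ 1 → EigMult (eccMatrix (CG α (2 * k))) (+ 0) (sumTo (λ i → α (2 * i ∸ 1)) k ∸ k + 1))
    × (α 2 ≢ 1 → EigMult (eccMatrix (CG α (2 * k))) (+ 0) (sumTo (λ i → α (2 * i ∸ 1)) k ∸ k))
mainTheorem7 k 2≤k α α-positive 2≤αL = eigenvalue-−2 , eigenvalue-0-α₂≡1 , eigenvalue-0
  where open Multiplicities k 2≤k α α-positive 2≤αL
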